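{- There is an effective method which, given a unary predicate $p$ and a $\mathsf{MON}_=$ formula $F$, computes a formula $F'$ such that: (1) $F'$ is a $\mathsf{QMON}_=$ formula; (2) $F' \equiv \exists p\, F$; (3) $p$ is the only quantified predicate in $F'$; (4) all occurrences of $p$ in $F'$ are within positive occurrences of subformulas of the form \[\exists p\, \Big( \bigwedge_{1 \leq i \leq a} \forall^{<a_i} x\, (A_i[x] \lor px) \land \bigwedge_{1 \leq i \leq b} \forall^{<b_i} x\, (B_i[x] \lor \lnot px) \land \bigwedge_{1 \leq i \leq c} \exists^{\geq c_i} x\, (C_i[x] \land px) \land \bigwedge_{1 \leq i \leq d} \exists^{\geq d_i} x\, (D_i[x] \land \lnot px)\Big),\] where $a, b, c, d \geq 0$ are natural numbers, all $a_i, b_i, c_i, d_i \geq 1$ are natural numbers, and the $A_i[x], B_i[x], C_i[x], D_i[x]$ are first-order formulas in which $p$ does not occur; (5) every free individual variable, every constant and every predicate occurring in $F'$ also occurs in $F$.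
   Context: $\mathsf{MON}_=$ is the class of first-order formulas with equality whose predicates are nullary or unary, which may contain constants but no function symbols of positive arity, and which may contain free individual variables; $\mathsf{QMON}_=$ is $\mathsf{MON}_=$ extended by second-order quantification upon predicates. Counting quantifiers are treated as abbreviations: for $n \geq 1$, $\exists^{\geq n} x\, G[x]$ abbreviates $\exists x_1 \ldots \exists x_n\, (\bigwedge_{i} G[x_i] \land \bigwedge_{i<j} x_i \neq x_j)$ with fresh $x_i$ ("at least $n$ individuals satisfy $G$"), and $\forall^{<n} x\, G$ abbreviates $\lnot \exists^{\geq n} x\, \lnot G$ ("all with the exception of fewer than $n$ individuals satisfy $G$"). A subformula occurrence is positive if it lies within the scope of an even number of negations. $G \equiv H$ means same truth value in every interpretation under every assignment. -}

module Defs where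

open import Level using (0ℓ)
open import Data.Nat using (ℕ; _≡ᵇ_; _≥_)
open import Data.Bool using (Bool; true; false; not; if_then_else_)
open import Data.List using (List; []; _∷_; _++_; map; foldr; length)
open import Data.List.Relation.Unary.All using (All)
open import Data.List.Relation.Unary.Unique.Propositional using (Unique)
open import Data.List.Relation.Binary.Pointwise using (Pointwise)
open import Data.Product using (Σ; _×_; _,_; ∃)
open import Data.Sum using (_⊎_)
open import Data.Unit using (⊤)
open import Data.Empty using (⊥)
open import Relation.Nullary using (¬_)
open import Relation.Binary.PropositionalEquality using (_≡_; _≢_)
open import Function.Bundles using (_⇔_)
open import Axiom.ExcludedMiddle using (ExcludedMiddle)

Var : Set
Var = ℕ
Const : Set
Const = ℕ
PName : Set    -- predicate symbols (nullary and unary ones are separate sorts)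
PName = ℕ

data Term : Set where
  var : Var → Term
  con : Const → Term

data Fm : Set where
  ⊤ᶠ ⊥ᶠ   : Fm
  nul     : PName → Fm
  app     : PName → Term → Fm
  eqᶠ     : Term → Term → Fm
  ¬ᶠ_     : Fm → Fm
  _∧ᶠ_    : Fm → Fm → Fm
  _∨ᶠ_    : Fm → Fm → Fm
  ∀ᶠ ∃ᶠ   : Var → Fm → Fm
  ∀₀ ∃₀   : PName → Fm → Fm
  ∀₁ ∃₁   : PName → Fm → Fm

-- MON= : no second-order quantification
IsFO : Fm → Set
IsFO (¬ᶠ G) = IsFO G
IsFO (G ∧ᶠ H) = IsFO G × IsFO H
IsFO (G ∨ᶠ H) = IsFO G × IsFO H
IsFO (∀ᶠ x G) = IsFO G
IsFO (∃ᶠ x G) = IsFO G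
IsFO (∀₀ q G) = ⊥
IsFO (∃₀ q G) = ⊥
IsFO (∀₁ q G) = ⊥
IsFO (∃₁ q G) = ⊥
IsFO _ = ⊤

record Env (D : Set) : Set where
  field
    ind  : Var → D
    cst  : Const → D
    nulP : PName → Bool
    unP  : PName → D → Bool
open Env public

setInd : ∀ {D} → Env D → Var → D → Env D
setInd e x d = record e { ind = λ y → if y ≡ᵇ x then d else ind e y }

setNul : ∀ {D} → Env D → PName → Bool → Env D
setNul e q b = record e { nulP = λ r → if r ≡ᵇ q then b else nulP e r }

setUn : ∀ {D} → Env D → PName → (D → Bool) → Env D
setUn e q P = record e { unP = λ r → if r ≡ᵇ q then P else unP e r }

evalT : ∀ {D} → Env D → Term → D
evalT e (var x) = ind e x
evalT e (con c) = cst e c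

Sat : ∀ {D} → Env D → Fm → Set
Sat e ⊤ᶠ = ⊤
Sat e ⊥ᶠ = ⊥
Sat e (nul q) = nulP e q ≡ true
Sat e (app q t) = unP e q (evalT e t) ≡ true
Sat e (eqᶠ t s) = evalT e t ≡ evalT e s
Sat e (¬ᶠ G) = ¬ Sat e G
Sat e (G ∧ᶠ H) = Sat e G × Sat e H
Sat e (G ∨ᶠ H) = Sat e G ⊎ Sat e H
Sat {D} e (∀ᶠ x G) = (d : D) → Sat (setInd e x d) G
Sat {D} e (∃ᶠ x G) = Σ D λ d → Sat (setInd e x d) G
Sat e (∀₀ q G) = (b : Bool) → Sat (setNul e q b) G
Sat e (∃₀ q G) = Σ Bool λ b → Sat (setNul e q b) G
Sat {D} e (∀₁ q G) = (P : D → Bool) → Sat (setUn e q P) G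
Sat {D} e (∃₁ q G) = Σ (D → Bool) λ P → Sat (setUn e q P) G

-- G ≡ H : same truth value in every interpretation (nonempty domain,
-- since the variable assignment provides an element) under every
-- assignment; evaluated classically (excluded middle assumed).
_≈ᶠ_ : Fm → Fm → Set₁
G ≈ᶠ H = ExcludedMiddle 0ℓ → (D : Set) (e : Env D) → Sat e G ⇔ Sat e H

OccT : Var → Term → Set
OccT x (var y) = x ≡ y
OccT x (con c) = ⊥

ConT : Const → Term → Set
ConT c (var y) = ⊥
ConT c (con d) = c ≡ d

FreeV : Var → Fm → Set
FreeV x (app q t) = OccT x t
FreeV x (eqᶠ t s) = OccT x t ⊎ OccT x s
FreeV x (¬ᶠ G) = FreeV x G
FreeV x (G ∧ᶠ H) = FreeV x G ⊎ FreeV x H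
FreeV x (G ∨ᶠ H) = FreeV x G ⊎ FreeV x H
FreeV x (∀ᶠ y G) = x ≢ y × FreeV x G
FreeV x (∃ᶠ y G) = x ≢ y × FreeV x G
FreeV x (∀₀ q G) = FreeV x G
FreeV x (∃₀ q G) = FreeV x G
FreeV x (∀₁ q G) = FreeV x G
FreeV x (∃₁ q G) = FreeV x G
FreeV x _ = ⊥

VarOcc : Var → Fm → Set
VarOcc x (app q t) = OccT x t
VarOcc x (eqᶠ t s) = OccT x t ⊎ OccT x s
VarOcc x (¬ᶠ G) = VarOcc x G
VarOcc x (G ∧ᶠ H) = VarOcc x G ⊎ VarOcc x H
VarOcc x (G ∨ᶠ H) = VarOcc x G ⊎ VarOcc x H
VarOcc x (∀ᶠ y G) = x ≡ y ⊎ VarOcc x G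
VarOcc x (∃ᶠ y G) = x ≡ y ⊎ VarOcc x G
VarOcc x (∀₀ q G) = VarOcc x G
VarOcc x (∃₀ q G) = VarOcc x G
VarOcc x (∀₁ q G) = VarOcc x G
VarOcc x (∃₁ q G) = VarOcc x G
VarOcc x _ = ⊥

OccC : Const → Fm → Set
OccC c (app q t) = ConT c t
OccC c (eqᶠ t s) = ConT c t ⊎ ConT c s
OccC c (¬ᶠ G) = OccC c G
OccC c (G ∧ᶠ H) = OccC c G ⊎ OccC c H
OccC c (G ∨ᶠ H) = OccC c G ⊎ OccC c H
OccC c (∀ᶠ y G) = OccC c G
OccC c (∃ᶠ y G) = OccC c G
OccC c (∀₀ q G) = OccC c G
OccC c (∃₀ q G) = OccC c G
OccC c (∀₁ q G) = OccC c G
OccC c (∃₁ q G) = OccC c G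
OccC c _ = ⊥

OccN : PName → Fm → Set
OccN p (nul q) = p ≡ q
OccN p (¬ᶠ G) = OccN p G
OccN p (G ∧ᶠ H) = OccN p G ⊎ OccN p H
OccN p (G ∨ᶠ H) = OccN p G ⊎ OccN p H
OccN p (∀ᶠ y G) = OccN p G
OccN p (∃ᶠ y G) = OccN p G
OccN p (∀₀ q G) = p ≡ q ⊎ OccN p G
OccN p (∃₀ q G) = p ≡ q ⊎ OccN p G
OccN p (∀₁ q G) = OccN p G
OccN p (∃₁ q G) = OccN p G
OccN p _ = ⊥

OccU : PName → Fm → Set
OccU p (app q t) = p ≡ q
OccU p (¬ᶠ G) = OccU p G
OccU p (G ∧ᶠ H) = OccU p G ⊎ OccU p H
OccU p (G ∨ᶠ H) = OccU p G ⊎ OccU p H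
OccU p (∀ᶠ y G) = OccU p G
OccU p (∃ᶠ y G) = OccU p G
OccU p (∀₀ q G) = OccU p G
OccU p (∃₀ q G) = OccU p G
OccU p (∀₁ q G) = p ≡ q ⊎ OccU p G
OccU p (∃₁ q G) = p ≡ q ⊎ OccU p G
OccU p _ = ⊥

-- replace free occurrences of variable x by variable y
-- (capture-free whenever y does not occur in the formula)
substT : Var → Var → Term → Term
substT x y (var z) = if z ≡ᵇ x then var y else var z
substT x y (con c) = con c

subst : Var → Var → Fm → Fm
subst x y (app q t) = app q (substT x y t)
subst x y (eqᶠ t s) = eqᶠ (substT x y t) (substT x y s)
subst x y (¬ᶠ G) = ¬ᶠ subst x y G
subst x y (G ∧ᶠ H) = subst x y G ∧ᶠ subst x y H
subst x y (G ∨ᶠ H) = subst x y G ∨ᶠ subst x y H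
subst x y (∀ᶠ z G) = if z ≡ᵇ x then ∀ᶠ z G else ∀ᶠ z (subst x y G)
subst x y (∃ᶠ z G) = if z ≡ᵇ x then ∃ᶠ z G else ∃ᶠ z (subst x y G)
subst x y (∀₀ q G) = ∀₀ q (subst x y G)
subst x y (∃₀ q G) = ∃₀ q (subst x y G)
subst x y (∀₁ q G) = ∀₁ q (subst x y G)
subst x y (∃₁ q G) = ∃₁ q (subst x y G)
subst x y G = G

⋀ : List Fm → Fm
⋀ [] = ⊤ᶠ
⋀ (G ∷ []) = G
⋀ (G ∷ Gs) = G ∧ᶠ ⋀ Gs

distinctness : List Var → List Fm
distinctness [] = []
distinctness (y ∷ ys) = map (λ z → ¬ᶠ eqᶠ (var y) (var z)) ys ++ distinctness ys

-- H is (an expansion of) ∃^{≥n} x G[x]: for some pairwise distinct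
-- variables x_1..x_n fresh for G,
--   H = ∃x_1 … ∃x_n (⋀_i G[x_i] ∧ ⋀_{i<j} x_i ≠ x_j)
CountGE : ℕ → Var → Fm → Fm → Set
CountGE n x G H =
  Σ (List Var) λ ys →
    length ys ≡ n × Unique ys × All (λ y → ¬ VarOcc y G) ys ×
    H ≡ foldr ∃ᶠ (⋀ (map (λ y → subst x y G) ys ++ distinctness ys)) ys

-- H is (an expansion of) ∀^{<n} x G = ¬ ∃^{≥n} x ¬G
CountLT : ℕ → Var → Fm → Fm → Set
CountLT n x G H = Σ Fm λ H' → CountGE n x (¬ᶠ G) H' × H ≡ ¬ᶠ H'

-- a conjunct specification (n, x, A[x]) : count, variable, formula
Spec : Set
Spec = ℕ × Var × Fm

SpecOK : PName → Spec → Set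
SpecOK p (n , x , A) = n ≥ 1 × IsFO A × ¬ OccU p A

ConjA ConjB ConjC ConjD : PName → Spec → Fm → Set
ConjA p (n , x , A) H = CountLT n x (A ∨ᶠ app p (var x)) H
ConjB p (n , x , B) H = CountLT n x (B ∨ᶠ (¬ᶠ app p (var x))) H
ConjC p (n , x , C) H = CountGE n x (C ∧ᶠ app p (var x)) H
ConjD p (n , x , D) H = CountGE n x (D ∧ᶠ (¬ᶠ app p (var x))) H

-- H = ∃p ( ⋀_i ∀^{<a_i}x(A_i ∨ px) ∧ ⋀_i ∀^{<b_i}x(B_i ∨ ¬px)
--        ∧ ⋀_i ∃^{≥c_i}x(C_i ∧ px) ∧ ⋀_i ∃^{≥d_i}x(D_i ∧ ¬px) )
-- (the four groups written as one flat conjunction, in this order)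
Block : PName → Fm → Set
Block p H =
  Σ (List Spec) λ as → Σ (List Spec) λ bs → Σ (List Spec) λ cs → Σ (List Spec) λ ds →
  Σ (List Fm) λ Has → Σ (List Fm) λ Hbs → Σ (List Fm) λ Hcs → Σ (List Fm) λ Hds →
    All (SpecOK p) as × All (SpecOK p) bs × All (SpecOK p) cs × All (SpecOK p) ds ×
    Pointwise (ConjA p) as Has × Pointwise (ConjB p) bs Hbs ×
    Pointwise (ConjC p) cs Hcs × Pointwise (ConjD p) ds Hds ×
    H ≡ ∃₁ p (⋀ (Has ++ Hbs ++ Hcs ++ Hds))

-- Guarded p s G : every occurrence of the unary predicate p in G (atoms
-- and quantifiers) lies within a positive occurrence (relative to the
-- polarity s of G itself; true = positive) of a Block-subformula.
mutual
  Guarded : PName → Bool → Fm → Set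
  Guarded p s G = (s ≡ true × Block p G) ⊎ GuardedSub p s G

  GuardedSub : PName → Bool → Fm → Set
  GuardedSub p s (app q t) = p ≢ q
  GuardedSub p s (¬ᶠ G) = Guarded p (not s) G
  GuardedSub p s (G ∧ᶠ H) = Guarded p s G × Guarded p s H
  GuardedSub p s (G ∨ᶠ H) = Guarded p s G × Guarded p s H
  GuardedSub p s (∀ᶠ y G) = Guarded p s G
  GuardedSub p s (∃ᶠ y G) = Guarded p s G
  GuardedSub p s (∀₀ q G) = Guarded p s G
  GuardedSub p s (∃₀ q G) = Guarded p s G
  GuardedSub p s (∀₁ q G) = p ≢ q × Guarded p s G
  GuardedSub p s (∃₁ q G) = p ≢ q × Guarded p s G
  GuardedSub p s _ = ⊤

OnlyQuantifies : PName → Fm → Set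
OnlyQuantifies p (¬ᶠ G) = OnlyQuantifies p G
OnlyQuantifies p (G ∧ᶠ H) = OnlyQuantifies p G × OnlyQuantifies p H
OnlyQuantifies p (G ∨ᶠ H) = OnlyQuantifies p G × OnlyQuantifies p H
OnlyQuantifies p (∀ᶠ y G) = OnlyQuantifies p G
OnlyQuantifies p (∃ᶠ y G) = OnlyQuantifies p G
OnlyQuantifies p (∀₀ q G) = ⊥
OnlyQuantifies p (∃₀ q G) = ⊥
OnlyQuantifies p (∀₁ q G) = p ≡ q × OnlyQuantifies p G
OnlyQuantifies p (∃₁ q G) = p ≡ q × OnlyQuantifies p G
OnlyQuantifies p _ = ⊤

SymbolsFrom : Fm → Fm → Set
SymbolsFrom F F' =
  (∀ x → FreeV x F' → FreeV x F) ×
  (∀ c → OccC c F' → OccC c F) ×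
  (∀ q → OccN q F' → OccN q F) ×
  (∀ q → OccU q F' → OccU q F)

-- Quantifier elimination for monadic logic with equality turns F into an equivalent Boolean
-- combination of atoms of F and counting atoms "at least n elements z satisfy the cell K", where
-- K fixes the values at z of some predicates and whether z equals some terms: ∃x splits on
-- whether x is the value of a term of the formula or a new element of some colour. In such a
-- normal form p occurs only in the atoms p t and in counting atoms whose cell mentions p.
-- Branching on the truth values of these p-atoms leaves a p-free formula in each branch, and the
-- chosen truth values are realised by some p exactly when a block holds: p t becomes
-- ∃^{≥1}x (x = t ∧ px), a cell requiring p (resp. ¬p) yields a count of C ∧ px (resp. D ∧ ¬px),
-- and atoms chosen false yield the dual conjuncts ∀^{<n}x (¬C ∨ ¬px) (resp. ∀^{<n}x (¬D ∨ px)).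
-- Since the p-free parts do not depend on p, ∃p distributes over the branches onto the blocks.

module Submission where

open import Defs
open import Level using (0ℓ)
open import Data.Nat using (ℕ; zero; suc; _≡ᵇ_; _≥_; _<_; _≤_; s≤s; z≤n; _⊔_)
open import Data.Nat.Properties
  using (≡ᵇ⇒≡; ≡⇒≡ᵇ; suc-injective; ≤-refl; ≤-trans; <⇒≢; ≤⇒≯; n≤1+n; <⇒≤; m⊔n≤o⇒m≤o; m⊔n≤o⇒n≤o)
  renaming (_≟_ to _≟ℕ_)
open import Data.Bool using (Bool; true; false; not; if_then_else_; T; _∧_)
open import Data.Bool.Properties using (¬-not; not-¬) renaming (_≟_ to _≟B_)
open import Data.Bool.ListAction using (and; or)
open import Data.List using (List; []; _∷_; _++_; map; foldr; length; concatMap)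
open import Data.List.Properties using (≡-dec)
open import Data.List.Relation.Unary.All using (All; []; _∷_)
import Data.List.Relation.Unary.All as All
open import Data.List.Relation.Unary.All.Properties using (++⁺; ++⁻; map⁺; map⁻; concat⁺; All¬⇒¬Any; ¬Any⇒All¬)
open import Data.List.Relation.Unary.Any using (Any; here; there)
import Data.List.Relation.Unary.Any as Any
open import Data.List.Relation.Unary.Any.Properties using () renaming (++⁻ to any++⁻)
open import Data.List.Relation.Unary.AllPairs using ([]; _∷_)
open import Data.List.Relation.Unary.Unique.Propositional using (Unique)
open import Data.List.Relation.Binary.Pointwise using (Pointwise; []; _∷_)
open import Data.List.Membership.Propositional using (_∈_; _∉_; find)
open import Data.List.Membership.Propositional.Properties using (∈-++⁺ˡ; ∈-++⁺ʳ; ∈-++⁻)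
open import Data.Product using (Σ; _×_; _,_; proj₁; proj₂)
open import Data.Sum using (_⊎_; inj₁; inj₂; [_,_]′)
import Data.Sum as Sum
open import Data.Unit using (tt) renaming (⊤ to Unit)
open import Data.Empty using (⊥; ⊥-elim)
open import Relation.Nullary using (¬_; Dec; yes; no)
open import Relation.Binary.PropositionalEquality
  using (_≡_; _≢_; refl; sym; trans; cong) renaming (subst to substP)
open import Function.Base using (_∘_)
open import Function.Bundles using (_⇔_; mk⇔)
open import Axiom.ExcludedMiddle using (ExcludedMiddle)

infix 1 _⟺_
_⟺_ : Set → Set → Set
A ⟺ B = (A → B) × (B → A)

⟺-refl : ∀ {A} → A ⟺ A
⟺-refl = (λ a → a) , (λ a → a)

⟺-sym : ∀ {A B} → A ⟺ B → B ⟺ A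
⟺-sym (f , g) = g , f

⟺-trans : ∀ {A B C} → A ⟺ B → B ⟺ C → A ⟺ C
⟺-trans (f , g) (h , k) = (λ a → h (f a)) , (λ c → g (k c))

×-⟺ : ∀ {A B C E} → A ⟺ B → C ⟺ E → (A × C) ⟺ (B × E)
×-⟺ (f , g) (h , k) = (λ { (a , c) → f a , h c }) , (λ { (b , e) → g b , k e })

⊎-⟺ : ∀ {A B C E} → A ⟺ B → C ⟺ E → (A ⊎ C) ⟺ (B ⊎ E)
⊎-⟺ (f , g) (h , k) = (λ { (inj₁ a) → inj₁ (f a) ; (inj₂ c) → inj₂ (h c) }) ,
                     (λ { (inj₁ a) → inj₁ (g a) ; (inj₂ c) → inj₂ (k c) })

¬-⟺ : ∀ {A B} → A ⟺ B → (¬ A) ⟺ (¬ B)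
¬-⟺ (f , g) = (λ na b → na (g b)) , (λ nb a → nb (f a))

Π-⟺ : ∀ {X : Set} {A B : X → Set} → (∀ x → A x ⟺ B x) → ((x : X) → A x) ⟺ ((x : X) → B x)
Π-⟺ h = (λ a x → proj₁ (h x) (a x)) , (λ b x → proj₂ (h x) (b x))

Σ-⟺ : ∀ {X : Set} {A B : X → Set} → (∀ x → A x ⟺ B x) → Σ X A ⟺ Σ X B
Σ-⟺ h = (λ { (x , a) → x , proj₁ (h x) a }) , (λ { (x , b) → x , proj₂ (h x) b })

×-comm-⟺ : ∀ {A B} → (A × B) ⟺ (B × A)
×-comm-⟺ = (λ { (a , b) → b , a }) , (λ { (b , a) → a , b })

Σ-⟺-under : ∀ {X : Set} {C A B : X → Set} → (∀ x → C x → A x ⟺ B x) → Σ X (λ x → C x × A x) ⟺ Σ X (λ x → C x × B x)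
Σ-⟺-under h = (λ { (x , c , a) → x , c , proj₁ (h x c) a }) , (λ { (x , c , b) → x , c , proj₂ (h x c) b })

All-∷-⟺ : ∀ {A : Set} {P : A → Set} {x xs} → All P (x ∷ xs) ⟺ (P x × All P xs)
All-∷-⟺ = (λ { (p ∷ ps) → p , ps }) , (λ { (p , ps) → p ∷ ps })

All-⟺-with : ∀ {A : Set} {R P Q : A → Set} {xs} → All R xs → (∀ x → R x → P x ⟺ Q x) → All P xs ⟺ All Q xs
All-⟺-with rs h = All.zipWith (λ { (r , p) → proj₁ (h _ r) p }) ∘ (rs ,_) , All.zipWith (λ { (r , q) → proj₂ (h _ r) q }) ∘ (rs ,_)

All-⟺ : ∀ {A : Set} {P Q : A → Set} {xs} → (∀ x → P x ⟺ Q x) → All P xs ⟺ All Q xs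
All-⟺ h = All.map (proj₁ (h _)) , All.map (proj₂ (h _))

true≢false : true ≢ false
true≢false ()

≡ᵇ-true⇒≡ : ∀ {m n} → (m ≡ᵇ n) ≡ true → m ≡ n
≡ᵇ-true⇒≡ {m} {n} e = ≡ᵇ⇒≡ m n (substP T (sym e) tt)

≡ᵇ-false⇒≢ : ∀ {m n} → (m ≡ᵇ n) ≡ false → m ≢ n
≡ᵇ-false⇒≢ {m} {n} e m≡n = substP T e (≡⇒≡ᵇ m n m≡n)

≡ᵇ-refl : ∀ n → (n ≡ᵇ n) ≡ true
≡ᵇ-refl zero = refl
≡ᵇ-refl (suc n) = ≡ᵇ-refl n

≢⇒≡ᵇ-false : ∀ {m n} → m ≢ n → (m ≡ᵇ n) ≡ false
≢⇒≡ᵇ-false {m} {n} ne with m ≡ᵇ n in eq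
... | true = ⊥-elim (ne (≡ᵇ-true⇒≡ eq))
... | false = refl

record Agree {D : Set} (G : Fm) (e e' : Env D) : Set where
  field
    ind≡  : ∀ v → VarOcc v G → ind e v ≡ ind e' v
    cst≡  : ∀ c → cst e c ≡ cst e' c
    nulP≡ : ∀ q → nulP e q ≡ nulP e' q
    unP≡  : ∀ q → OccU q G → ∀ d → unP e q d ≡ unP e' q d
open Agree

Agree-mono : ∀ {D G H} {e e' : Env D} → (∀ v → VarOcc v H → VarOcc v G) → (∀ q → OccU q H → OccU q G) →
             Agree G e e' → Agree H e e'
Agree-mono iv iu ag = record
  { ind≡ = λ v o → ind≡ ag v (iv v o) ; cst≡ = cst≡ ag ; nulP≡ = nulP≡ ag ; unP≡ = λ q o → unP≡ ag q (iu q o) }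

ind-setInd-≡ : ∀ {D} (e : Env D) y d → ind (setInd e y d) y ≡ d
ind-setInd-≡ e y d rewrite ≡ᵇ-refl y = refl

ind-setInd-≢ : ∀ {D} (e : Env D) {y v} d → v ≢ y → ind (setInd e y d) v ≡ ind e v
ind-setInd-≢ e {y} {v} d v≢y rewrite ≢⇒≡ᵇ-false v≢y = refl

Agree-setInd : ∀ {D} G H {e e' : Env D} y {a b} → a ≡ b → (∀ v → VarOcc v G → VarOcc v H) →
               (∀ q → OccU q G → OccU q H) → Agree H e e' → Agree G (setInd e y a) (setInd e' y b)
Agree-setInd G H {e} {e'} y {a} {b} a≡b iv iu ag =
  record { ind≡ = ind≡′ ; cst≡ = cst≡ ag ; nulP≡ = nulP≡ ag ; unP≡ = λ q o → unP≡ ag q (iu q o) }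
  where
  ind≡′ : ∀ v → VarOcc v G → ind (setInd e y a) v ≡ ind (setInd e' y b) v
  ind≡′ v o with v ≡ᵇ y
  ... | true = a≡b
  ... | false = ind≡ ag v (iv v o)

Agree-setNul : ∀ {D} G {e e' : Env D} q b → Agree G e e' → Agree G (setNul e q b) (setNul e' q b)
Agree-setNul G {e} {e'} q b ag = record { ind≡ = ind≡ ag ; cst≡ = cst≡ ag ; nulP≡ = nulP≡′ ; unP≡ = unP≡ ag }
  where
  nulP≡′ : ∀ r → nulP (setNul e q b) r ≡ nulP (setNul e' q b) r
  nulP≡′ r with r ≡ᵇ q
  ... | true = refl
  ... | false = nulP≡ ag r

Agree-setUn : ∀ {D} G H {e e' : Env D} q P → (∀ v → VarOcc v G → VarOcc v H) → (∀ r → OccU r G → OccU r H) →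
              Agree H e e' → Agree G (setUn e q P) (setUn e' q P)
Agree-setUn G H {e} {e'} q P iv iu ag =
  record { ind≡ = λ v o → ind≡ ag v (iv v o) ; cst≡ = cst≡ ag ; nulP≡ = nulP≡ ag ; unP≡ = unP≡′ }
  where
  unP≡′ : ∀ r → OccU r G → ∀ d → unP (setUn e q P) r d ≡ unP (setUn e' q P) r d
  unP≡′ r o d with r ≡ᵇ q
  ... | true = refl
  ... | false = unP≡ ag r (iu r o) d

evalT-agree : ∀ {D} {e e' : Env D} t → (∀ v → OccT v t → ind e v ≡ ind e' v) → (∀ c → cst e c ≡ cst e' c) →
              evalT e t ≡ evalT e' t
evalT-agree (var x) a b = a x refl
evalT-agree (con c) a b = b c

unP-cong : ∀ {D} {e : Env D} q {a b} → a ≡ b → (unP e q a ≡ true) ⟺ (unP e q b ≡ true)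
unP-cong q refl = ⟺-refl

≡-cong-⟺ : ∀ {D : Set} {a b a' b' : D} → a ≡ a' → b ≡ b' → (a ≡ b) ⟺ (a' ≡ b')
≡-cong-⟺ refl refl = ⟺-refl

coincidence : ∀ {D} G {e e' : Env D} → Agree G e e' → Sat e G ⟺ Sat e' G
coincidence ⊤ᶠ ag = ⟺-refl
coincidence ⊥ᶠ ag = ⟺-refl
coincidence (nul q) ag = (λ s → trans (sym (nulP≡ ag q)) s) , (λ s → trans (nulP≡ ag q) s)
coincidence (app q t) {e} {e'} ag =
  ⟺-trans (unP-cong {e = e} q (evalT-agree t (ind≡ ag) (cst≡ ag)))
          ((λ s → trans (sym (unP≡ ag q refl _)) s) , (λ s → trans (unP≡ ag q refl _) s))
coincidence (eqᶠ t s) ag =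
  ≡-cong-⟺ (evalT-agree t (λ v o → ind≡ ag v (inj₁ o)) (cst≡ ag)) (evalT-agree s (λ v o → ind≡ ag v (inj₂ o)) (cst≡ ag))
coincidence (¬ᶠ G) ag = ¬-⟺ (coincidence G (Agree-mono (λ _ o → o) (λ _ o → o) ag))
coincidence (G ∧ᶠ H) ag =
  ×-⟺ (coincidence G (Agree-mono (λ v → inj₁) (λ q → inj₁) ag)) (coincidence H (Agree-mono (λ v → inj₂) (λ q → inj₂) ag))
coincidence (G ∨ᶠ H) ag =
  ⊎-⟺ (coincidence G (Agree-mono (λ v → inj₁) (λ q → inj₁) ag)) (coincidence H (Agree-mono (λ v → inj₂) (λ q → inj₂) ag))
coincidence (∀ᶠ y G) ag = Π-⟺ (λ d → coincidence G (Agree-setInd G (∀ᶠ y G) y refl (λ v → inj₂) (λ q o → o) ag))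
coincidence (∃ᶠ y G) ag = Σ-⟺ (λ d → coincidence G (Agree-setInd G (∃ᶠ y G) y refl (λ v → inj₂) (λ q o → o) ag))
coincidence (∀₀ q G) ag = Π-⟺ (λ b → coincidence G (Agree-setNul G q b (Agree-mono (λ _ o → o) (λ _ o → o) ag)))
coincidence (∃₀ q G) ag = Σ-⟺ (λ b → coincidence G (Agree-setNul G q b (Agree-mono (λ _ o → o) (λ _ o → o) ag)))
coincidence (∀₁ q G) ag = Π-⟺ (λ P → coincidence G (Agree-setUn G (∀₁ q G) q P (λ v o → o) (λ r → inj₂) ag))
coincidence (∃₁ q G) ag = Σ-⟺ (λ P → coincidence G (Agree-setUn G (∃₁ q G) q P (λ v o → o) (λ r → inj₂) ag))

Agree-ind : ∀ {D} G (e : Env D) (f : Var → D) → (∀ v → ind e v ≡ f v) → Agree G e (record e { ind = f })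
Agree-ind G e f h = record { ind≡ = λ v _ → h v ; cst≡ = λ c → refl ; nulP≡ = λ q → refl ; unP≡ = λ q _ d → refl }

evalT-substT : ∀ {D} (e : Env D) x y t → evalT e (substT x y t) ≡ evalT (setInd e x (ind e y)) t
evalT-substT e x y (var z) with z ≡ᵇ x
... | true = refl
... | false = refl
evalT-substT e x y (con c) = refl

setInd-shadow : ∀ {D} (e : Env D) {x z} a d → (z ≡ᵇ x) ≡ true →
                ∀ v → ind (setInd e z d) v ≡ ind (setInd (setInd e x a) z d) v
setInd-shadow e {x} {z} a d zx v with v ≡ᵇ z in vz
... | true = refl
... | false = sym (ind-setInd-≢ e a (λ v≡x → ≡ᵇ-false⇒≢ vz (trans v≡x (sym (≡ᵇ-true⇒≡ zx)))))

setInd-swap : ∀ {D} (e : Env D) {x y z} d → (z ≡ᵇ x) ≡ false → (y ≡ᵇ z) ≡ false →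
              ∀ v → ind (setInd (setInd e z d) x (ind (setInd e z d) y)) v ≡ ind (setInd (setInd e x (ind e y)) z d) v
setInd-swap e {x} {y} {z} d zx yz v rewrite yz with v ≡ᵇ x in vx | v ≡ᵇ z in vz
... | true | true = ⊥-elim (≡ᵇ-false⇒≢ {z} {x} zx (trans (sym (≡ᵇ-true⇒≡ {v} {z} vz)) (≡ᵇ-true⇒≡ {v} {x} vx)))
... | true | false = refl
... | false | true = refl
... | false | false = refl

Sat-subst : ∀ {D} G (e : Env D) x y → ¬ VarOcc y G → Sat e (subst x y G) ⟺ Sat (setInd e x (ind e y)) G
Sat-subst ⊤ᶠ e x y ny = ⟺-refl
Sat-subst ⊥ᶠ e x y ny = ⟺-refl
Sat-subst (nul q) e x y ny = ⟺-refl
Sat-subst (app q t) e x y ny = unP-cong {e = e} q (evalT-substT e x y t)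
Sat-subst (eqᶠ t s) e x y ny = ≡-cong-⟺ (evalT-substT e x y t) (evalT-substT e x y s)
Sat-subst (¬ᶠ G) e x y ny = ¬-⟺ (Sat-subst G e x y ny)
Sat-subst (G ∧ᶠ H) e x y ny = ×-⟺ (Sat-subst G e x y (λ o → ny (inj₁ o))) (Sat-subst H e x y (λ o → ny (inj₂ o)))
Sat-subst (G ∨ᶠ H) e x y ny = ⊎-⟺ (Sat-subst G e x y (λ o → ny (inj₁ o))) (Sat-subst H e x y (λ o → ny (inj₂ o)))
Sat-subst (∀ᶠ z G) e x y ny with z ≡ᵇ x in zx
... | true = Π-⟺ (λ d → coincidence G (Agree-ind G _ _ (setInd-shadow e _ d zx)))
... | false = Π-⟺ (λ d → ⟺-trans (Sat-subst G (setInd e z d) x y (λ o → ny (inj₂ o)))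
                                   (coincidence G (Agree-ind G _ _ (setInd-swap e d zx (≢⇒≡ᵇ-false (λ q → ny (inj₁ q)))))))
Sat-subst (∃ᶠ z G) e x y ny with z ≡ᵇ x in zx
... | true = Σ-⟺ (λ d → coincidence G (Agree-ind G _ _ (setInd-shadow e _ d zx)))
... | false = Σ-⟺ (λ d → ⟺-trans (Sat-subst G (setInd e z d) x y (λ o → ny (inj₂ o)))
                                   (coincidence G (Agree-ind G _ _ (setInd-swap e d zx (≢⇒≡ᵇ-false (λ q → ny (inj₁ q)))))))
Sat-subst (∀₀ q G) e x y ny = Π-⟺ (λ b → Sat-subst G (setNul e q b) x y ny)
Sat-subst (∃₀ q G) e x y ny = Σ-⟺ (λ b → Sat-subst G (setNul e q b) x y ny)
Sat-subst (∀₁ q G) e x y ny = Π-⟺ (λ P → Sat-subst G (setUn e q P) x y ny)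
Sat-subst (∃₁ q G) e x y ny = Σ-⟺ (λ P → Sat-subst G (setUn e q P) x y ny)

AtLeast : {D : Set} → ℕ → (D → Set) → Set
AtLeast {D} n P = Σ (List D) λ ds → length ds ≡ n × Unique ds × All P ds

distinctWitnesses : Var → Fm → List Var → Fm
distinctWitnesses x G ys = foldr ∃ᶠ (⋀ (map (λ y → subst x y G) ys ++ distinctness ys)) ys

All-++-⟺ : ∀ {A : Set} {P : A → Set} xs {ys} → All P (xs ++ ys) ⟺ (All P xs × All P ys)
All-++-⟺ xs = ++⁻ xs , (λ { (a , b) → ++⁺ a b })

Sat-⋀∷ : ∀ {D} G Gs (e : Env D) → Sat e (⋀ (G ∷ Gs)) ⟺ All (Sat e) (G ∷ Gs)
Sat-⋀∷ G [] e = (λ s → s ∷ []) , (λ { (s ∷ []) → s })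
Sat-⋀∷ G (G' ∷ Gs) e = (λ { (s , r) → s ∷ proj₁ (Sat-⋀∷ G' Gs e) r }) , (λ { (s ∷ r) → s , proj₂ (Sat-⋀∷ G' Gs e) r })

Sat-⋀ : ∀ {D} Gs (e : Env D) → Sat e (⋀ Gs) ⟺ All (Sat e) Gs
Sat-⋀ [] e = (λ _ → []) , (λ _ → tt)
Sat-⋀ (G ∷ Gs) e = Sat-⋀∷ G Gs e

setInds : ∀ {D} → Env D → List Var → List D → Env D
setInds e (y ∷ ys) (d ∷ ds) = setInds (setInd e y d) ys ds
setInds e _ _ = e

Sat-∃ᶠ* : ∀ {D} ys B (e : Env D) →
          Sat e (foldr ∃ᶠ B ys) ⟺ (Σ (List D) λ ds → length ds ≡ length ys × Sat (setInds e ys ds) B)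
Sat-∃ᶠ* [] B e = (λ s → [] , refl , s) , λ { ([] , _ , s) → s }
Sat-∃ᶠ* {D} (y ∷ ys) B e = to , from
  where
  Assignment : Set
  Assignment = Σ (List D) λ ds → length ds ≡ length (y ∷ ys) × Sat (setInds e (y ∷ ys) ds) B
  to : Sat e (foldr ∃ᶠ B (y ∷ ys)) → Assignment
  to (d , s) with proj₁ (Sat-∃ᶠ* ys B (setInd e y d)) s
  ... | ds , l , s' = d ∷ ds , cong suc l , s'
  from : Assignment → Sat e (foldr ∃ᶠ B (y ∷ ys))
  from (d ∷ ds , l , s) = d , proj₂ (Sat-∃ᶠ* ys B (setInd e y d)) (ds , suc-injective l , s)

setInds-∉ : ∀ {D} (e : Env D) ys ds v → v ∉ ys → ind (setInds e ys ds) v ≡ ind e v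
setInds-∉ e [] ds v n = refl
setInds-∉ e (y ∷ ys) [] v n = refl
setInds-∉ e (y ∷ ys) (d ∷ ds) v n
  rewrite setInds-∉ (setInd e y d) ys ds v (λ m → n (there m)) = ind-setInd-≢ e d (λ q → n (here q))

setInds-∈ : ∀ {D} (e : Env D) ys ds → Unique ys → length ds ≡ length ys →
            Pointwise (λ y d → ind (setInds e ys ds) y ≡ d) ys ds
setInds-∈ e [] [] u l = []
setInds-∈ e (y ∷ ys) (d ∷ ds) (y∉ys ∷ u) l = at-y ∷ setInds-∈ (setInd e y d) ys ds u (suc-injective l)
  where
  at-y : ind (setInds (setInd e y d) ys ds) y ≡ d
  at-y rewrite setInds-∉ (setInd e y d) ys ds y (All¬⇒¬Any y∉ys) = ind-setInd-≡ e y d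

Agree-refl : ∀ {D} {G} {e : Env D} → Agree G e e
Agree-refl = record { ind≡ = λ _ _ → refl ; cst≡ = λ _ → refl ; nulP≡ = λ _ → refl ; unP≡ = λ _ _ _ → refl }

Agree-trans : ∀ {D} {G} {e e' e'' : Env D} → Agree G e e' → Agree G e' e'' → Agree G e e''
Agree-trans a b = record
  { ind≡ = λ v o → trans (ind≡ a v o) (ind≡ b v o) ; cst≡ = λ c → trans (cst≡ a c) (cst≡ b c)
  ; nulP≡ = λ q → trans (nulP≡ a q) (nulP≡ b q) ; unP≡ = λ q o d → trans (unP≡ a q o d) (unP≡ b q o d) }

Agree-setInds : ∀ {D} G (e : Env D) ys ds → All (λ y → ¬ VarOcc y G) ys → Agree G (setInds e ys ds) e
Agree-setInds G e [] ds fresh = Agree-refl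
Agree-setInds G e (y ∷ ys) [] fresh = Agree-refl
Agree-setInds G e (y ∷ ys) (d ∷ ds) (y∉G ∷ fresh) = Agree-trans (Agree-setInds G (setInd e y d) ys ds fresh) at-y
  where
  at-y : Agree G (setInd e y d) e
  at-y = record { ind≡ = λ v o → ind-setInd-≢ e d (λ { refl → y∉G o }) ; cst≡ = λ _ → refl
                ; nulP≡ = λ _ → refl ; unP≡ = λ _ _ _ → refl }

Sat-instances : ∀ {D} (e e' : Env D) x G ys ds → All (λ y → ¬ VarOcc y G) ys → Agree G e' e →
                Pointwise (λ y d → ind e' y ≡ d) ys ds →
                All (Sat e') (map (λ y → subst x y G) ys) ⟺ All (λ d → Sat (setInd e x d) G) ds
Sat-instances e e' x G [] [] fresh ag [] = (λ _ → []) , (λ _ → [])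
Sat-instances e e' x G (y ∷ ys) (d ∷ ds) (y∉G ∷ fresh) ag (y↦d ∷ pw) =
  (λ { (s ∷ r) → proj₁ instance-y s ∷ proj₁ rest r }) , (λ { (s ∷ r) → proj₂ instance-y s ∷ proj₂ rest r })
  where
  rest = Sat-instances e e' x G ys ds fresh ag pw
  instance-y : Sat e' (subst x y G) ⟺ Sat (setInd e x d) G
  instance-y = ⟺-trans (Sat-subst G e' x y y∉G)
                       (coincidence G (Agree-setInd G G x y↦d (λ _ o → o) (λ _ o → o) ag))

Sat-distinctness : ∀ {D} ys ds (e : Env D) → Pointwise (λ y d → ind e y ≡ d) ys ds →
                   All (Sat e) (distinctness ys) ⟺ Unique ds
Sat-distinctness [] [] e [] = (λ _ → []) , (λ _ → [])
Sat-distinctness (y ∷ ys) (d ∷ ds) e (y↦d ∷ pw) =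
  ⟺-trans (All-++-⟺ (map (λ z → ¬ᶠ eqᶠ (var y) (var z)) ys))
          ((λ { (a , u) → proj₁ (head ys ds pw) a ∷ proj₁ (Sat-distinctness ys ds e pw) u }) ,
           (λ { (a ∷ u) → proj₂ (head ys ds pw) a , proj₂ (Sat-distinctness ys ds e pw) u }))
  where
  head : ∀ zs es → Pointwise (λ y d → ind e y ≡ d) zs es →
         All (Sat e) (map (λ z → ¬ᶠ eqᶠ (var y) (var z)) zs) ⟺ All (λ c → ¬ d ≡ c) es
  head [] [] [] = (λ _ → []) , (λ _ → [])
  head (z ∷ zs) (c ∷ es) (z↦c ∷ qs) =
    (λ { (s ∷ r) → (λ d≡c → s (trans y↦d (trans d≡c (sym z↦c)))) ∷ proj₁ (head zs es qs) r }) ,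
    (λ { (s ∷ r) → (λ y≡z → s (trans (sym y↦d) (trans y≡z z↦c))) ∷ proj₂ (head zs es qs) r })

Sat-distinctWitnesses : ∀ {D} x G ys (e : Env D) → Unique ys → All (λ y → ¬ VarOcc y G) ys →
                        Sat e (distinctWitnesses x G ys) ⟺ AtLeast (length ys) (λ d → Sat (setInd e x d) G)
Sat-distinctWitnesses x G ys e u fresh = ⟺-trans (Sat-∃ᶠ* ys _ e) (Σ-⟺-under body)
  where
  body : ∀ ds → length ds ≡ length ys →
         Sat (setInds e ys ds) (⋀ (map (λ y → subst x y G) ys ++ distinctness ys)) ⟺
         (Unique ds × All (λ d → Sat (setInd e x d) G) ds)
  body ds l = ⟺-trans (Sat-⋀ _ _) (⟺-trans (All-++-⟺ (map (λ y → subst x y G) ys)) (⟺-trans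
                (×-⟺ (Sat-instances e _ x G ys ds fresh (Agree-setInds G e ys ds fresh) pw) (Sat-distinctness ys ds _ pw))
                ×-comm-⟺))
    where pw = setInds-∈ e ys ds u l

AtLeast-map : ∀ {D} {P Q : D → Set} n → (∀ d → P d → Q d) → AtLeast n P → AtLeast n Q
AtLeast-map n f (ds , l , u , a) = ds , l , u , All.map (f _) a

AtLeast-⟺ : ∀ {D} {P Q : D → Set} n → (∀ d → P d ⟺ Q d) → AtLeast n P ⟺ AtLeast n Q
AtLeast-⟺ n h = AtLeast-map n (λ d → proj₁ (h d)) , AtLeast-map n (λ d → proj₂ (h d))

module _ {D : Set} where
  AtLeast-1 : ∀ {Q : D → Set} → AtLeast 1 Q ⟺ Σ D Q
  AtLeast-1 = (λ { (z ∷ _ , _ , _ , q ∷ _) → z , q }) , (λ { (z , q) → z ∷ [] , refl , [] ∷ [] , q ∷ [] })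

  AtLeast-≡ : ∀ {Q : D → Set} {d} n → AtLeast (suc n) (λ z → Q z × z ≡ d) ⟺ (n ≡ 0 × Q d)
  AtLeast-≡ {Q} {d} n = to , λ { (refl , q) → d ∷ [] , refl , [] ∷ [] , (q , refl) ∷ [] }
    where
    to : AtLeast (suc n) (λ z → Q z × z ≡ d) → n ≡ 0 × Q d
    to (z ∷ [] , l , u , (q , refl) ∷ []) = sym (suc-injective l) , q
    to (z ∷ z' ∷ zs , l , (z∉ ∷ _) ∷ _ , (q , z≡d) ∷ (q' , z'≡d) ∷ _) = ⊥-elim (z∉ (trans z≡d (sym z'≡d)))

  AtLeast-≢-absent : ∀ {Q : D → Set} {d} k → ¬ Q d → AtLeast k (λ z → Q z × z ≢ d) ⟺ AtLeast k Q
  AtLeast-≢-absent {Q} k ¬Qd = AtLeast-map k (λ z → proj₁) , AtLeast-map k (λ { z q → q , (λ { refl → ¬Qd q }) })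

  AtLeast-remove : ExcludedMiddle 0ℓ → ∀ {P : D → Set} {d} k ds → Unique ds → length ds ≡ suc k → All P ds →
                   AtLeast k (λ z → P z × z ≢ d)
  AtLeast-remove em zero ds u l a = [] , refl , [] , []
  AtLeast-remove em {P} {d} (suc k) (x ∷ xs) (x∉xs ∷ u) l (px ∷ a) with em {x ≡ d}
  ... | yes refl = xs , suc-injective l , u , All.zipWith (λ { (x≢z , pz) → pz , λ { refl → x≢z refl } }) (x∉xs , a)
  ... | no x≢d with AtLeast-remove em {λ z → P z × x ≢ z} {d} k xs u (suc-injective l) (All.zipWith (λ q → q) (a , x∉xs))
  ...   | ys , l' , u' , a' =
    x ∷ ys , cong suc l' , All.map (λ { ((_ , x≢z) , _) → x≢z }) a' ∷ u' ,
    (px , x≢d) ∷ All.map (λ { ((pz , _) , z≢d) → pz , z≢d }) a'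

  AtLeast-≢-present : ExcludedMiddle 0ℓ → ∀ {Q : D → Set} {d} k → Q d →
                      AtLeast k (λ z → Q z × z ≢ d) ⟺ AtLeast (suc k) Q
  AtLeast-≢-present em {Q} {d} k qd = add-d , (λ { (ds , l , u , a) → AtLeast-remove em k ds u l a })
    where
    add-d : AtLeast k (λ z → Q z × z ≢ d) → AtLeast (suc k) Q
    add-d (ds , l , u , a) = d ∷ ds , cong suc l , All.map (λ { (_ , z≢d) d≡z → z≢d (sym d≡z) }) a ∷ u , qd ∷ All.map proj₁ a

-- Monadic normal forms

data Lit : Set where
  predL : PName → Bool → Lit
  eqL : Term → Bool → Lit

-- cntA n K says that at least n + 1 elements z satisfy every literal of the cell K, where
-- predL q b reads "q z = b" and eqL t b reads "z = t" if b holds and "z ≠ t" otherwise.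
data At : Set where
  nulA : PName → At
  unA : PName → Term → At
  eqA : Term → Term → At
  cntA : ℕ → List Lit → At

data NF : Set where
  ⊤ⁿ ⊥ⁿ : NF
  atom : At → NF
  neg : NF → NF
  conj disj : NF → NF → NF

Signed : Bool → Set → Set
Signed true A = A
Signed false A = ¬ A

SatLit : ∀ {D} → Env D → D → Lit → Set
SatLit e d (predL q b) = unP e q d ≡ b
SatLit e d (eqL t b) = Signed b (d ≡ evalT e t)

SatCell : ∀ {D} → Env D → D → List Lit → Set
SatCell e d K = All (SatLit e d) K

SatAtom : ∀ {D} → Env D → At → Set
SatAtom e (nulA q) = nulP e q ≡ true
SatAtom e (unA q t) = unP e q (evalT e t) ≡ true
SatAtom e (eqA t s) = evalT e t ≡ evalT e s
SatAtom e (cntA n K) = AtLeast (suc n) (λ d → SatCell e d K)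

SatNF : ∀ {D} → Env D → NF → Set
SatNF e ⊤ⁿ = Unit
SatNF e ⊥ⁿ = ⊥
SatNF e (atom A) = SatAtom e A
SatNF e (neg Φ) = ¬ SatNF e Φ
SatNF e (conj Φ Ψ) = SatNF e Φ × SatNF e Ψ
SatNF e (disj Φ Ψ) = SatNF e Φ ⊎ SatNF e Ψ

TermBelow : ℕ → Term → Set
TermBelow m (var v) = v < m
TermBelow m (con c) = Unit

LitBelow : ℕ → Lit → Set
LitBelow m (predL q b) = Unit
LitBelow m (eqL t b) = TermBelow m t

AtomBelow : ℕ → At → Set
AtomBelow m (nulA q) = Unit
AtomBelow m (unA q t) = TermBelow m t
AtomBelow m (eqA t s) = TermBelow m t × TermBelow m s
AtomBelow m (cntA n K) = All (LitBelow m) K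

NFBelow : ℕ → NF → Set
NFBelow m (atom A) = AtomBelow m A
NFBelow m (neg Φ) = NFBelow m Φ
NFBelow m (conj Φ Ψ) = NFBelow m Φ × NFBelow m Ψ
NFBelow m (disj Φ Ψ) = NFBelow m Φ × NFBelow m Ψ
NFBelow m _ = Unit

VarsAtMost : ℕ → Fm → Set
VarsAtMost m G = ∀ y → VarOcc y G → y ≤ m

-- A normal form whose variables are below m is rendered with m as the counted element
-- and m + 1, m + 2, … as its distinct witnesses.
litFm : Var → Lit → Fm
litFm x (predL q true) = app q (var x)
litFm x (predL q false) = ¬ᶠ app q (var x)
litFm x (eqL t true) = eqᶠ (var x) t
litFm x (eqL t false) = ¬ᶠ eqᶠ (var x) t

cellFm : Var → List Lit → Fm
cellFm x K = ⋀ (map (litFm x) K)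

freshVars : ℕ → ℕ → List Var
freshVars s zero = []
freshVars s (suc n) = s ∷ freshVars (suc s) n

atLeastFm : ℕ → ℕ → Fm → Fm
atLeastFm m n G = distinctWitnesses m G (freshVars (suc m) n)

atomFm : ℕ → At → Fm
atomFm m (nulA q) = nul q
atomFm m (unA q t) = app q t
atomFm m (eqA t s) = eqᶠ t s
atomFm m (cntA n K) = atLeastFm m (suc n) (cellFm m K)

nfFm : ℕ → NF → Fm
nfFm m ⊤ⁿ = ⊤ᶠ
nfFm m ⊥ⁿ = ⊥ᶠ
nfFm m (atom A) = atomFm m A
nfFm m (neg Φ) = ¬ᶠ nfFm m Φ
nfFm m (conj Φ Ψ) = nfFm m Φ ∧ᶠ nfFm m Ψ
nfFm m (disj Φ Ψ) = nfFm m Φ ∨ᶠ nfFm m Ψ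

freshVars-length : ∀ s n → length (freshVars s n) ≡ n
freshVars-length s zero = refl
freshVars-length s (suc n) = cong suc (freshVars-length (suc s) n)

freshVars-≥ : ∀ s n → All (s ≤_) (freshVars s n)
freshVars-≥ s zero = []
freshVars-≥ s (suc n) = ≤-refl ∷ All.map (≤-trans (n≤1+n s)) (freshVars-≥ (suc s) n)

freshVars-unique : ∀ s n → Unique (freshVars s n)
freshVars-unique s zero = []
freshVars-unique s (suc n) = All.map <⇒≢ (freshVars-≥ (suc s) n) ∷ freshVars-unique (suc s) n

freshVars-fresh : ∀ m n G → VarsAtMost m G → All (λ y → ¬ VarOcc y G) (freshVars (suc m) n)
freshVars-fresh m n G bound = All.map (λ {y} m<y o → ≤⇒≯ (bound y o) m<y) (freshVars-≥ (suc m) n)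

evalT-setInd-below : ∀ {D} (e : Env D) m d t → TermBelow m t → evalT (setInd e m d) t ≡ evalT e t
evalT-setInd-below e m d (var v) v<m = ind-setInd-≢ e d (<⇒≢ v<m)
evalT-setInd-below e m d (con c) _ = refl

Sat-litFm : ∀ {D} (e : Env D) m d l → LitBelow m l → Sat (setInd e m d) (litFm m l) ⟺ SatLit e d l
Sat-litFm e m d (predL q true) b rewrite ≡ᵇ-refl m = ⟺-refl
Sat-litFm e m d (predL q false) b rewrite ≡ᵇ-refl m = ¬-not , not-¬
Sat-litFm e m d (eqL t true) b rewrite ≡ᵇ-refl m | evalT-setInd-below e m d t b = ⟺-refl
Sat-litFm e m d (eqL t false) b rewrite ≡ᵇ-refl m | evalT-setInd-below e m d t b = ⟺-refl

Sat-cellFm : ∀ {D} (e : Env D) m d K → All (LitBelow m) K → Sat (setInd e m d) (cellFm m K) ⟺ SatCell e d K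
Sat-cellFm e m d K bs =
  ⟺-trans (Sat-⋀ (map (litFm m) K) (setInd e m d)) (⟺-trans (map⁻ , map⁺) (All-⟺-with bs (Sat-litFm e m d)))

VarOcc-⋀ : ∀ y Gs → VarOcc y (⋀ Gs) → Any (VarOcc y) Gs
VarOcc-⋀ y (G ∷ []) o = here o
VarOcc-⋀ y (G ∷ G' ∷ Gs) (inj₁ o) = here o
VarOcc-⋀ y (G ∷ G' ∷ Gs) (inj₂ o) = there (VarOcc-⋀ y (G' ∷ Gs) o)

OccT-below : ∀ m y t → TermBelow m t → OccT y t → y < m
OccT-below m y (var v) b refl = b

VarOcc-litFm : ∀ m l → LitBelow m l → VarsAtMost m (litFm m l)
VarOcc-litFm m (predL q true) b y refl = ≤-refl
VarOcc-litFm m (predL q false) b y refl = ≤-refl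
VarOcc-litFm m (eqL t true) b y (inj₁ refl) = ≤-refl
VarOcc-litFm m (eqL t true) b y (inj₂ o) = <⇒≤ (OccT-below m y t b o)
VarOcc-litFm m (eqL t false) b y (inj₁ refl) = ≤-refl
VarOcc-litFm m (eqL t false) b y (inj₂ o) = <⇒≤ (OccT-below m y t b o)

VarOcc-cellFm : ∀ m K → All (LitBelow m) K → VarsAtMost m (cellFm m K)
VarOcc-cellFm m K bs y o = go K bs (VarOcc-⋀ y (map (litFm m) K) o)
  where
  go : ∀ K → All (LitBelow m) K → Any (VarOcc y) (map (litFm m) K) → y ≤ m
  go (l ∷ K) (b ∷ bs) (here o) = VarOcc-litFm m l b y o
  go (l ∷ K) (b ∷ bs) (there a) = go K bs a

Sat-atLeastFm : ∀ {D} (e : Env D) m n G → VarsAtMost m G →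
                Sat e (atLeastFm m n G) ⟺ AtLeast n (λ d → Sat (setInd e m d) G)
Sat-atLeastFm e m n G bound =
  substP (λ k → Sat e (atLeastFm m n G) ⟺ AtLeast k (λ d → Sat (setInd e m d) G)) (freshVars-length (suc m) n)
         (Sat-distinctWitnesses m G _ e (freshVars-unique (suc m) n) (freshVars-fresh m n G bound))

Sat-atomFm : ∀ {D} (e : Env D) m A → AtomBelow m A → Sat e (atomFm m A) ⟺ SatAtom e A
Sat-atomFm e m (nulA q) b = ⟺-refl
Sat-atomFm e m (unA q t) b = ⟺-refl
Sat-atomFm e m (eqA t s) b = ⟺-refl
Sat-atomFm e m (cntA n K) b = ⟺-trans (Sat-atLeastFm e m (suc n) (cellFm m K) (VarOcc-cellFm m K b))
                                      (AtLeast-⟺ (suc n) (λ d → Sat-cellFm e m d K b))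

Sat-nfFm : ∀ {D} (e : Env D) m Φ → NFBelow m Φ → Sat e (nfFm m Φ) ⟺ SatNF e Φ
Sat-nfFm e m ⊤ⁿ b = ⟺-refl
Sat-nfFm e m ⊥ⁿ b = ⟺-refl
Sat-nfFm e m (atom A) b = Sat-atomFm e m A b
Sat-nfFm e m (neg Φ) b = ¬-⟺ (Sat-nfFm e m Φ b)
Sat-nfFm e m (conj Φ Ψ) (b , c) = ×-⟺ (Sat-nfFm e m Φ b) (Sat-nfFm e m Ψ c)
Sat-nfFm e m (disj Φ Ψ) (b , c) = ⊎-⟺ (Sat-nfFm e m Φ b) (Sat-nfFm e m Ψ c)

-- Elimination of individual quantifiers

isVar : Var → Term → Bool
isVar x (var y) = y ≡ᵇ x
isVar x (con c) = false

evalT-isVar : ∀ {D} (e : Env D) x d s → isVar x s ≡ true → evalT (setInd e x d) s ≡ d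
evalT-isVar e x d (var y) h rewrite h = refl
evalT-isVar e x d (con c) ()

evalT-¬isVar : ∀ {D} (e : Env D) x d s → isVar x s ≡ false → evalT (setInd e x d) s ≡ evalT e s
evalT-¬isVar e x d (var y) h rewrite h = refl
evalT-¬isVar e x d (con c) h = refl

Signed-≡-cong : ∀ {D : Set} b {z a a' : D} → a ≡ a' → Signed b (z ≡ a) ⟺ Signed b (z ≡ a')
Signed-≡-cong b refl = ⟺-refl

cellTerms : List Lit → List Term
cellTerms [] = []
cellTerms (predL q b ∷ K) = cellTerms K
cellTerms (eqL t b ∷ K) = t ∷ cellTerms K

cellPreds : List Lit → List PName
cellPreds [] = []
cellPreds (predL q b ∷ K) = q ∷ cellPreds K
cellPreds (eqL t b ∷ K) = cellPreds K

atomTerms : At → List Term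
atomTerms (nulA q) = []
atomTerms (unA q t) = t ∷ []
atomTerms (eqA t s) = t ∷ s ∷ []
atomTerms (cntA n K) = cellTerms K

atomPreds : At → List PName
atomPreds (nulA q) = []
atomPreds (unA q t) = q ∷ []
atomPreds (eqA t s) = []
atomPreds (cntA n K) = cellPreds K

nfTerms : NF → List Term
nfTerms (atom A) = atomTerms A
nfTerms (neg Φ) = nfTerms Φ
nfTerms (conj Φ Ψ) = nfTerms Φ ++ nfTerms Ψ
nfTerms (disj Φ Ψ) = nfTerms Φ ++ nfTerms Ψ
nfTerms _ = []

nfPreds : NF → List PName
nfPreds (atom A) = atomPreds A
nfPreds (neg Φ) = nfPreds Φ
nfPreds (conj Φ Ψ) = nfPreds Φ ++ nfPreds Ψ
nfPreds (disj Φ Ψ) = nfPreds Φ ++ nfPreds Ψ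
nfPreds _ = []

replT : Var → Term → Term → Term
replT x t s = if isVar x s then t else s

replL : Var → Term → Lit → Lit
replL x t (predL q b) = predL q b
replL x t (eqL s b) = eqL (replT x t s) b

replA : Var → Term → At → At
replA x t (nulA q) = nulA q
replA x t (unA q s) = unA q (replT x t s)
replA x t (eqA s s') = eqA (replT x t s) (replT x t s')
replA x t (cntA n K) = cntA n (map (replL x t) K)

replN : Var → Term → NF → NF
replN x t ⊤ⁿ = ⊤ⁿ
replN x t ⊥ⁿ = ⊥ⁿ
replN x t (atom A) = atom (replA x t A)
replN x t (neg Φ) = neg (replN x t Φ)
replN x t (conj Φ Ψ) = conj (replN x t Φ) (replN x t Ψ)
replN x t (disj Φ Ψ) = disj (replN x t Φ) (replN x t Ψ)

evalT-replT : ∀ {D} (e : Env D) x t s → evalT e (replT x t s) ≡ evalT (setInd e x (evalT e t)) s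
evalT-replT e x t s with isVar x s in h
... | true = sym (evalT-isVar e x (evalT e t) s h)
... | false = sym (evalT-¬isVar e x (evalT e t) s h)

SatCell-replL : ∀ {D} (e : Env D) x t z K → SatCell e z (map (replL x t) K) ⟺ SatCell (setInd e x (evalT e t)) z K
SatCell-replL e x t z K = ⟺-trans (map⁻ , map⁺) (All-⟺ one)
  where
  one : ∀ l → SatLit e z (replL x t l) ⟺ SatLit (setInd e x (evalT e t)) z l
  one (predL q b) = ⟺-refl
  one (eqL s b) = Signed-≡-cong b (evalT-replT e x t s)

SatNF-replN : ∀ {D} (e : Env D) x t Φ → SatNF e (replN x t Φ) ⟺ SatNF (setInd e x (evalT e t)) Φ
SatNF-replN e x t ⊤ⁿ = ⟺-refl
SatNF-replN e x t ⊥ⁿ = ⟺-refl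
SatNF-replN e x t (atom (nulA q)) = ⟺-refl
SatNF-replN e x t (atom (unA q s)) = unP-cong {e = e} q (evalT-replT e x t s)
SatNF-replN e x t (atom (eqA s s')) = ≡-cong-⟺ (evalT-replT e x t s) (evalT-replT e x t s')
SatNF-replN e x t (atom (cntA n K)) = AtLeast-⟺ (suc n) (λ z → SatCell-replL e x t z K)
SatNF-replN e x t (neg Φ) = ¬-⟺ (SatNF-replN e x t Φ)
SatNF-replN e x t (conj Φ Ψ) = ×-⟺ (SatNF-replN e x t Φ) (SatNF-replN e x t Ψ)
SatNF-replN e x t (disj Φ Ψ) = ⊎-⟺ (SatNF-replN e x t Φ) (SatNF-replN e x t Ψ)

varLits : Var → List Lit → List Bool
varLits x [] = []
varLits x (predL q b ∷ K) = varLits x K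
varLits x (eqL s b ∷ K) = if isVar x s then b ∷ varLits x K else varLits x K

dropVarLits : Var → List Lit → List Lit
dropVarLits x [] = []
dropVarLits x (predL q b ∷ K) = predL q b ∷ dropVarLits x K
dropVarLits x (eqL s b ∷ K) = if isVar x s then dropVarLits x K else eqL s b ∷ dropVarLits x K

SatCell-setInd : ∀ {D} (e : Env D) x d z K →
           SatCell (setInd e x d) z K ⟺ (SatCell e z (dropVarLits x K) × All (λ b → Signed b (z ≡ d)) (varLits x K))
SatCell-setInd e x d z [] = (λ _ → [] , []) , (λ _ → [])
SatCell-setInd e x d z (predL q b ∷ K) = (λ { (s ∷ r) → let (a , c) = proj₁ ih r in s ∷ a , c }) ,
                                (λ { (s ∷ a , c) → s ∷ proj₂ ih (a , c) })
  where ih = SatCell-setInd e x d z K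
SatCell-setInd e x d z (eqL s b ∷ K) with isVar x s in h
... | true = (λ { (u ∷ r) → let (a , c) = proj₁ ih r in a , proj₁ (Signed-≡-cong b (evalT-isVar e x d s h)) u ∷ c }) ,
             (λ { (a , u ∷ c) → proj₂ (Signed-≡-cong b (evalT-isVar e x d s h)) u ∷ proj₂ ih (a , c) })
  where ih = SatCell-setInd e x d z K
... | false = (λ { (u ∷ r) → let (a , c) = proj₁ ih r in proj₁ (Signed-≡-cong b (evalT-¬isVar e x d s h)) u ∷ a , c }) ,
              (λ { (u ∷ a , c) → proj₂ (Signed-≡-cong b (evalT-¬isVar e x d s h)) u ∷ proj₂ ih (a , c) })
  where ih = SatCell-setInd e x d z K

dropVarLits-terms : ∀ x K s → s ∈ cellTerms (dropVarLits x K) → s ∈ cellTerms K × isVar x s ≡ false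
dropVarLits-terms x [] s ()
dropVarLits-terms x (predL q b ∷ K) s m = dropVarLits-terms x K s m
dropVarLits-terms x (eqL t b ∷ K) s m with isVar x t in h
... | true = let (a , c) = dropVarLits-terms x K s m in there a , c
dropVarLits-terms x (eqL t b ∷ K) s (here refl) | false = here refl , h
dropVarLits-terms x (eqL t b ∷ K) s (there m) | false = let (a , c) = dropVarLits-terms x K s m in there a , c

dropVarLits-preds : ∀ x K q → q ∈ cellPreds (dropVarLits x K) → q ∈ cellPreds K
dropVarLits-preds x [] q ()
dropVarLits-preds x (predL r b ∷ K) q (here e) = here e
dropVarLits-preds x (predL r b ∷ K) q (there m) = there (dropVarLits-preds x K q m)
dropVarLits-preds x (eqL t b ∷ K) q m with isVar x t
... | true = dropVarLits-preds x K q m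
... | false = dropVarLits-preds x K q m

HasColour : ∀ {D} → Env D → D → List (PName × Bool) → Set
HasColour e d L = All (λ p → unP e (proj₁ p) d ≡ proj₂ p) L

lookupColour : List (PName × Bool) → PName → Bool
lookupColour [] q = false
lookupColour ((r , b) ∷ L) q = if q ≡ᵇ r then b else lookupColour L q

lookupColour-correct : ∀ {D} (e : Env D) d L q → HasColour e d L → q ∈ map proj₁ L → lookupColour L q ≡ unP e q d
lookupColour-correct e d ((r , b) ∷ L) q (h ∷ hs) m with q ≡ᵇ r in eq
... | true rewrite ≡ᵇ-true⇒≡ {q} {r} eq = sym h
lookupColour-correct e d ((r , b) ∷ L) q (h ∷ hs) (here e') | false = ⊥-elim (≡ᵇ-false⇒≢ {q} {r} eq e')
lookupColour-correct e d ((r , b) ∷ L) q (h ∷ hs) (there m) | false = lookupColour-correct e d L q hs m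

_≐_ : Bool → Bool → Bool
true ≐ b = b
false ≐ b = not b

≡⟺≐ : ∀ a b → (a ≡ b) ⟺ (a ≐ b ≡ true)
≡⟺≐ true true = (λ _ → refl) , (λ _ → refl)
≡⟺≐ true false = (λ ()) , (λ ())
≡⟺≐ false true = (λ ()) , (λ ())
≡⟺≐ false false = (λ _ → refl) , (λ _ → refl)

∧≡true : ∀ a b → ((a ∧ b) ≡ true) ⟺ (a ≡ true × b ≡ true)
∧≡true true true = (λ _ → refl , refl) , (λ _ → refl)
∧≡true true false = (λ ()) , (λ { (_ , ()) })
∧≡true false b = (λ ()) , (λ { (() , _) })

evalLit : Var → List (PName × Bool) → Lit → Bool
evalLit x L (predL q b) = lookupColour L q ≐ b
evalLit x L (eqL s b) = isVar x s ≐ b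

Signed-⊥ : ∀ {A : Set} b → ¬ A → Signed b A ⟺ (false ≐ b ≡ true)
Signed-⊥ true n = (λ q → ⊥-elim (n q)) , (λ ())
Signed-⊥ false n = (λ _ → refl) , (λ _ → n)

evalCell : Var → List (PName × Bool) → List Lit → Bool
evalCell x L [] = true
evalCell x L (l ∷ K) = evalLit x L l ∧ evalCell x L K

SatCell-evalCell : ∀ {D} (e : Env D) x d L K → HasColour e d L → (∀ q → q ∈ cellPreds K → q ∈ map proj₁ L) →
         (∀ s → s ∈ cellTerms K → (¬ d ≡ evalT e s) × isVar x s ≡ false) →
         SatCell e d K ⟺ (evalCell x L K ≡ true)
SatCell-evalCell e x d L [] hL cP cT = (λ _ → refl) , (λ _ → [])
SatCell-evalCell e x d L (predL q b ∷ K) hL cP cT = ⟺-trans All-∷-⟺ (⟺-trans (×-⟺ one ih) (⟺-sym (∧≡true _ _)))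
  where
  ih = SatCell-evalCell e x d L K hL (λ r m → cP r (there m)) cT
  lk = lookupColour-correct e d L q hL (cP q (here refl))
  one : (unP e q d ≡ b) ⟺ (lookupColour L q ≐ b ≡ true)
  one rewrite lk = ≡⟺≐ (unP e q d) b
SatCell-evalCell e x d L (eqL s b ∷ K) hL cP cT = ⟺-trans All-∷-⟺ (⟺-trans (×-⟺ one ih) (⟺-sym (∧≡true _ _)))
  where
  ih = SatCell-evalCell e x d L K hL cP (λ t m → cT t (there m))
  nd = proj₁ (cT s (here refl))
  one : Signed b (d ≡ evalT e s) ⟺ (isVar x s ≐ b ≡ true)
  one rewrite proj₂ (cT s (here refl)) = Signed-⊥ b nd

constNF : Bool → NF
constNF true = ⊤ⁿ
constNF false = ⊥ⁿ

SatNF-constNF : ∀ {D} (e : Env D) b → SatNF e (constNF b) ⟺ (b ≡ true)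
SatNF-constNF e true = (λ _ → refl) , (λ _ → tt)
SatNF-constNF e false = (λ ()) , (λ ())

-- instCount n K v bs is cntA n K′ with x eliminated, where K′ is K plus literals "z = x" with
-- signs bs and x satisfies K iff v: if one of those literals is positive, only x itself can be
-- counted; otherwise x is excluded, so the count over K must be one larger exactly when v holds.
instCount : ℕ → List Lit → Bool → List Bool → NF
instCount n K' v [] = atom (cntA n K')
instCount n K' v (b ∷ bs) = if or (b ∷ bs) then constNF ((n ≡ᵇ 0) ∧ (v ∧ and (b ∷ bs)))
                        else (if v then atom (cntA (suc n) K') else atom (cntA n K'))

instAtom : Var → List (PName × Bool) → At → NF
instAtom x L (nulA q) = atom (nulA q)
instAtom x L (unA q s) = if isVar x s then constNF (lookupColour L q) else atom (unA q s)
instAtom x L (eqA s s') = if isVar x s then constNF (isVar x s') else (if isVar x s' then ⊥ⁿ else atom (eqA s s'))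
instAtom x L (cntA n K) = instCount n (dropVarLits x K) (evalCell x L (dropVarLits x K)) (varLits x K)

instNF : Var → List (PName × Bool) → NF → NF
instNF x L ⊤ⁿ = ⊤ⁿ
instNF x L ⊥ⁿ = ⊥ⁿ
instNF x L (atom A) = instAtom x L A
instNF x L (neg Φ) = neg (instNF x L Φ)
instNF x L (conj Φ Ψ) = conj (instNF x L Φ) (instNF x L Ψ)
instNF x L (disj Φ Ψ) = disj (instNF x L Φ) (instNF x L Ψ)

module _ {A : Set} where
  All-Signed-or : ∀ bs → or bs ≡ true → All (λ b → Signed b A) bs ⟺ (A × and bs ≡ true)
  All-Signed-or bs o = f bs o , g bs
    where
    andE : ∀ bs → A → All (λ b → Signed b A) bs → and bs ≡ true
    andE [] zd _ = refl
    andE (true ∷ bs) zd (_ ∷ r) = andE bs zd r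
    andE (false ∷ bs) zd (n ∷ r) = ⊥-elim (n zd)
    f : ∀ bs → or bs ≡ true → All (λ b → Signed b A) bs → A × and bs ≡ true
    f [] () a
    f (true ∷ bs) o (zd ∷ r) = zd , andE bs zd r
    f (false ∷ bs) o (n ∷ r) = ⊥-elim (n (proj₁ (f bs o r)))
    g : ∀ bs → A × and bs ≡ true → All (λ b → Signed b A) bs
    g [] _ = []
    g (true ∷ bs) (zd , a) = zd ∷ g bs (zd , a)
    g (false ∷ bs) (zd , ())

  All-Signed-nor : ∀ b bs → or (b ∷ bs) ≡ false → All (λ b → Signed b A) (b ∷ bs) ⟺ (¬ A)
  All-Signed-nor b bs o = f b bs o , g (b ∷ bs) o
    where
    f : ∀ b bs → or (b ∷ bs) ≡ false → All (λ b → Signed b A) (b ∷ bs) → ¬ A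
    f false bs o (n ∷ _) = n
    f true bs () _
    g : ∀ bs → or bs ≡ false → ¬ A → All (λ b → Signed b A) bs
    g [] _ _ = []
    g (false ∷ bs) o n = n ∷ g bs o n
    g (true ∷ bs) () n

≡0⟺≡ᵇ0 : ∀ n → (n ≡ 0) ⟺ ((n ≡ᵇ 0) ≡ true)
≡0⟺≡ᵇ0 zero = (λ _ → refl) , (λ _ → refl)
≡0⟺≡ᵇ0 (suc n) = (λ ()) , (λ ())

SatNF-instCount : ∀ {D} (e : Env D) x d L n K → HasColour e d L → (∀ q → q ∈ cellPreds K → q ∈ map proj₁ L) →
        (∀ s → s ∈ cellTerms K → isVar x s ≡ false → ¬ d ≡ evalT e s) → ExcludedMiddle 0ℓ →
        SatAtom (setInd e x d) (cntA n K) ⟺ SatNF e (instAtom x L (cntA n K))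
SatNF-instCount {D} e x d L n K hL cP nT em = ⟺-trans (AtLeast-⟺ (suc n) (λ z → SatCell-setInd e x d z K)) (by-signs (varLits x K))
  where
  K' = dropVarLits x K
  v = evalCell x L K'
  P : D → Set
  P z = SatCell e z K'
  x∈K : P d ⟺ (v ≡ true)
  x∈K = SatCell-evalCell e x d L K' hL (λ q m → cP q (dropVarLits-preds x K q m))
         (λ s m → let (m' , h) = dropVarLits-terms x K s m in nT s m' h , h)
  by-signs : ∀ bs → AtLeast (suc n) (λ z → P z × All (λ b → Signed b (z ≡ d)) bs) ⟺ SatNF e (instCount n K' v bs)
  by-signs [] = AtLeast-⟺ (suc n) (λ z → proj₁ , (λ p → p , []))
  by-signs (b ∷ bs) with or (b ∷ bs) in o
  ... | true = ⟺-trans (AtLeast-⟺ (suc n) (λ z → ⟺-trans (×-⟺ ⟺-refl (All-Signed-or (b ∷ bs) o))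
                          ((λ { (p , zd , a) → (p , a) , zd }) , (λ { ((p , a) , zd) → p , zd , a }))))
               (⟺-trans (AtLeast-≡ n)
               (⟺-trans (×-⟺ (≡0⟺≡ᵇ0 n) (×-⟺ x∈K ⟺-refl))
               (⟺-trans (⟺-sym (⟺-trans (∧≡true _ _) (×-⟺ ⟺-refl (∧≡true _ _))))
               (⟺-sym (SatNF-constNF e _)))))
  ... | false with v in hv
  ...   | true = ⟺-trans (AtLeast-⟺ (suc n) (λ z → ×-⟺ ⟺-refl (All-Signed-nor b bs o)))
                        (AtLeast-≢-present em (suc n) (proj₂ x∈K hv))
  ...   | false = ⟺-trans (AtLeast-⟺ (suc n) (λ z → ×-⟺ ⟺-refl (All-Signed-nor b bs o)))
                        (AtLeast-≢-absent (suc n) (λ pd → true≢false (trans (sym (proj₁ x∈K pd)) hv)))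

SatNF-instNF : ∀ {D} (e : Env D) x d L Φ → ExcludedMiddle 0ℓ → HasColour e d L → (∀ q → q ∈ nfPreds Φ → q ∈ map proj₁ L) →
          (∀ s → s ∈ nfTerms Φ → isVar x s ≡ false → ¬ d ≡ evalT e s) →
          SatNF (setInd e x d) Φ ⟺ SatNF e (instNF x L Φ)
SatNF-instNF e x d L ⊤ⁿ em hL cP nT = ⟺-refl
SatNF-instNF e x d L ⊥ⁿ em hL cP nT = ⟺-refl
SatNF-instNF e x d L (atom (nulA q)) em hL cP nT = ⟺-refl
SatNF-instNF e x d L (atom (unA q s)) em hL cP nT with isVar x s in h
... | true rewrite evalT-isVar e x d s h | lookupColour-correct e d L q hL (cP q (here refl)) = ⟺-sym (SatNF-constNF e (unP e q d))
... | false rewrite evalT-¬isVar e x d s h = ⟺-refl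
SatNF-instNF e x d L (atom (eqA s s')) em hL cP nT with isVar x s in h | isVar x s' in h'
... | true | true rewrite evalT-isVar e x d s h | evalT-isVar e x d s' h' = (λ _ → tt) , (λ _ → refl)
... | true | false rewrite evalT-isVar e x d s h | evalT-¬isVar e x d s' h' = (λ q → nT s' (there (here refl)) h' q) , (λ ())
... | false | true rewrite evalT-¬isVar e x d s h | evalT-isVar e x d s' h' = (λ q → nT s (here refl) h (sym q)) , (λ ())
... | false | false rewrite evalT-¬isVar e x d s h | evalT-¬isVar e x d s' h' = ⟺-refl
SatNF-instNF e x d L (atom (cntA n K)) em hL cP nT = SatNF-instCount e x d L n K hL cP nT em
SatNF-instNF e x d L (neg Φ) em hL cP nT = ¬-⟺ (SatNF-instNF e x d L Φ em hL cP nT)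
SatNF-instNF e x d L (conj Φ Ψ) em hL cP nT =
  ×-⟺ (SatNF-instNF e x d L Φ em hL (λ q m → cP q (∈-++⁺ˡ m)) (λ s m → nT s (∈-++⁺ˡ m)))
     (SatNF-instNF e x d L Ψ em hL (λ q m → cP q (∈-++⁺ʳ (nfPreds Φ) m)) (λ s m → nT s (∈-++⁺ʳ (nfTerms Φ) m)))
SatNF-instNF e x d L (disj Φ Ψ) em hL cP nT =
  ⊎-⟺ (SatNF-instNF e x d L Φ em hL (λ q m → cP q (∈-++⁺ˡ m)) (λ s m → nT s (∈-++⁺ˡ m)))
     (SatNF-instNF e x d L Ψ em hL (λ q m → cP q (∈-++⁺ʳ (nfPreds Φ) m)) (λ s m → nT s (∈-++⁺ʳ (nfTerms Φ) m)))

cellOf : List (PName × Bool) → List Term → List Lit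
cellOf L Ts = map (λ p → predL (proj₁ p) (proj₂ p)) L ++ map (λ t → eqL t false) Ts

splitColours : Var → List Term → List (PName × Bool) → List PName → NF → NF
splitColours x Ts L [] Φ = conj (atom (cntA 0 (cellOf L Ts))) (instNF x L Φ)
splitColours x Ts L (q ∷ Qs) Φ = disj (splitColours x Ts ((q , true) ∷ L) Qs Φ) (splitColours x Ts ((q , false) ∷ L) Qs Φ)

SatCell-cellOf : ∀ {D} (e : Env D) z L Ts → SatCell e z (cellOf L Ts) ⟺ (HasColour e z L × All (λ t → ¬ z ≡ evalT e t) Ts)
SatCell-cellOf e z L Ts = ⟺-trans (All-++-⟺ (map _ L)) (×-⟺ (map⁻ , map⁺) (map⁻ , map⁺))

NewWitness : ∀ {D} → Env D → Var → List Term → List (PName × Bool) → NF → Set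
NewWitness {D} e x Ts L Φ = Σ D (λ d → HasColour e d L × All (λ t → d ≢ evalT e t) Ts × SatNF (setInd e x d) Φ)

SatNF-splitColours : ∀ {D} (e : Env D) x Ts L Qs Φ → ExcludedMiddle 0ℓ →
         (∀ q → q ∈ nfPreds Φ → q ∈ map proj₁ L ⊎ q ∈ Qs) →
         (∀ s → s ∈ nfTerms Φ → isVar x s ≡ false → s ∈ Ts) →
         SatNF e (splitColours x Ts L Qs Φ) ⟺ NewWitness e x Ts L Φ
SatNF-splitColours e x Ts L [] Φ em cP cT = to , from
  where
  cP' : ∀ q → q ∈ nfPreds Φ → q ∈ map proj₁ L
  cP' q m with cP q m
  ... | inj₁ m' = m'
  ... | inj₂ ()
  nT : ∀ d → All (λ t → ¬ d ≡ evalT e t) Ts → ∀ s → s ∈ nfTerms Φ → isVar x s ≡ false → ¬ d ≡ evalT e s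
  nT d a s m h = All.lookup a (cT s m h)
  to : SatNF e (splitColours x Ts L [] Φ) → NewWitness e x Ts L Φ
  to (c , si) with proj₁ AtLeast-1 c
  ... | d , k with proj₁ (SatCell-cellOf e d L Ts) k
  ... | hL , hT = d , hL , hT , proj₂ (SatNF-instNF e x d L Φ em hL cP' (nT d hT)) si
  from : NewWitness e x Ts L Φ → SatNF e (splitColours x Ts L [] Φ)
  from (d , hL , hT , s) = proj₂ AtLeast-1 (d , proj₂ (SatCell-cellOf e d L Ts) (hL , hT)) ,
                        proj₁ (SatNF-instNF e x d L Φ em hL cP' (nT d hT)) s
SatNF-splitColours e x Ts L (q ∷ Qs) Φ em cP cT = to , from
  where
  cPb : ∀ b r → r ∈ nfPreds Φ → r ∈ map proj₁ ((q , b) ∷ L) ⊎ r ∈ Qs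
  cPb b r m with cP r m
  ... | inj₁ m' = inj₁ (there m')
  ... | inj₂ (here e') = inj₁ (here e')
  ... | inj₂ (there m') = inj₂ m'
  ihT = SatNF-splitColours e x Ts ((q , true) ∷ L) Qs Φ em (cPb true) cT
  ihF = SatNF-splitColours e x Ts ((q , false) ∷ L) Qs Φ em (cPb false) cT
  to : SatNF e (splitColours x Ts L (q ∷ Qs) Φ) → NewWitness e x Ts L Φ
  to (inj₁ s) with proj₁ ihT s
  ... | d , (_ ∷ hL) , hT , s' = d , hL , hT , s'
  to (inj₂ s) with proj₁ ihF s
  ... | d , (_ ∷ hL) , hT , s' = d , hL , hT , s'
  from : NewWitness e x Ts L Φ → SatNF e (splitColours x Ts L (q ∷ Qs) Φ)
  from (d , hL , hT , s) with unP e q d in eq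
  ... | true = inj₁ (proj₂ ihT (d , eq ∷ hL , hT , s))
  ... | false = inj₂ (proj₂ ihF (d , eq ∷ hL , hT , s))

dropVar : Var → List Term → List Term
dropVar x [] = []
dropVar x (t ∷ ts) = if isVar x t then dropVar x ts else t ∷ dropVar x ts

dropVar⁺ : ∀ x ts s → s ∈ ts → isVar x s ≡ false → s ∈ dropVar x ts
dropVar⁺ x (t ∷ ts) s (here refl) h rewrite h = here refl
dropVar⁺ x (t ∷ ts) s (there m) h with isVar x t
... | true = dropVar⁺ x ts s m h
... | false = there (dropVar⁺ x ts s m h)

dropVar⁻ : ∀ x ts s → s ∈ dropVar x ts → s ∈ ts × isVar x s ≡ false
dropVar⁻ x [] s ()
dropVar⁻ x (t ∷ ts) s m with isVar x t in h
... | true = let (a , b) = dropVar⁻ x ts s m in there a , b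
dropVar⁻ x (t ∷ ts) s (here refl) | false = here refl , h
dropVar⁻ x (t ∷ ts) s (there m) | false = let (a , b) = dropVar⁻ x ts s m in there a , b

⋁ⁿ : List NF → NF
⋁ⁿ [] = ⊥ⁿ
⋁ⁿ (Φ ∷ Φs) = disj Φ (⋁ⁿ Φs)

SatNF-⋁ⁿ : ∀ {D} (e : Env D) (f : Term → NF) ts → SatNF e (⋁ⁿ (map f ts)) ⟺ Any (λ t → SatNF e (f t)) ts
SatNF-⋁ⁿ e f [] = (λ ()) , (λ ())
SatNF-⋁ⁿ e f (t ∷ ts) = (λ { (inj₁ s) → here s ; (inj₂ s) → there (proj₁ (SatNF-⋁ⁿ e f ts) s) }) ,
                       (λ { (here s) → inj₁ s ; (there a) → inj₂ (proj₂ (SatNF-⋁ⁿ e f ts) a) })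

-- The value of x is either that of a term of Φ other than x, or a new element, distinct from
-- all of those, of one of the colours given by the predicates of Φ.
existsNF : Var → NF → NF
existsNF x Φ = disj (⋁ⁿ (map (λ t → replN x t Φ) (dropVar x (nfTerms Φ)))) (splitColours x (dropVar x (nfTerms Φ)) [] (nfPreds Φ) Φ)

SatNF-existsNF : ∀ {D} (e : Env D) x Φ → ExcludedMiddle 0ℓ → SatNF e (existsNF x Φ) ⟺ Σ D (λ d → SatNF (setInd e x d) Φ)
SatNF-existsNF {D} e x Φ em = to , from
  where
  Ts = dropVar x (nfTerms Φ)
  new = SatNF-splitColours e x Ts [] (nfPreds Φ) Φ em (λ q m → inj₂ m) (λ s m h → dropVar⁺ x (nfTerms Φ) s m h)
  old = SatNF-⋁ⁿ e (λ t → replN x t Φ) Ts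
  to : SatNF e (existsNF x Φ) → Σ D (λ d → SatNF (setInd e x d) Φ)
  to (inj₁ s) = let (t , _ , s') = find (proj₁ old s) in evalT e t , proj₁ (SatNF-replN e x t Φ) s'
  to (inj₂ s) = let (d , _ , _ , s') = proj₁ new s in d , s'
  from : Σ D (λ d → SatNF (setInd e x d) Φ) → SatNF e (existsNF x Φ)
  from (d , s) with em {Any (λ t → d ≡ evalT e t) Ts}
  ... | yes a = inj₁ (proj₂ old (Any.map (λ { {t} refl → proj₂ (SatNF-replN e x t Φ) s }) a))
  ... | no n = inj₂ (proj₂ new (d , [] , ¬Any⇒All¬ Ts n , s))

toNF : Fm → NF
toNF ⊤ᶠ = ⊤ⁿ
toNF ⊥ᶠ = ⊥ⁿ
toNF (nul q) = atom (nulA q)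
toNF (app q t) = atom (unA q t)
toNF (eqᶠ t s) = atom (eqA t s)
toNF (¬ᶠ G) = neg (toNF G)
toNF (G ∧ᶠ H) = conj (toNF G) (toNF H)
toNF (G ∨ᶠ H) = disj (toNF G) (toNF H)
toNF (∀ᶠ x G) = neg (existsNF x (neg (toNF G)))
toNF (∃ᶠ x G) = existsNF x (toNF G)
toNF _ = ⊥ⁿ

Sat-toNF : ∀ {D} (e : Env D) F → ExcludedMiddle 0ℓ → IsFO F → Sat e F ⟺ SatNF e (toNF F)
Sat-toNF e ⊤ᶠ em fo = ⟺-refl
Sat-toNF e ⊥ᶠ em fo = ⟺-refl
Sat-toNF e (nul q) em fo = ⟺-refl
Sat-toNF e (app q t) em fo = ⟺-refl
Sat-toNF e (eqᶠ t s) em fo = ⟺-refl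
Sat-toNF e (¬ᶠ G) em fo = ¬-⟺ (Sat-toNF e G em fo)
Sat-toNF e (G ∧ᶠ H) em (a , b) = ×-⟺ (Sat-toNF e G em a) (Sat-toNF e H em b)
Sat-toNF e (G ∨ᶠ H) em (a , b) = ⊎-⟺ (Sat-toNF e G em a) (Sat-toNF e H em b)
Sat-toNF {D} e (∀ᶠ x G) em fo = ⟺-trans (to , from) (¬-⟺ (⟺-sym (SatNF-existsNF e x (neg (toNF G)) em)))
  where
  ih : ∀ d → Sat (setInd e x d) G ⟺ SatNF (setInd e x d) (toNF G)
  ih d = Sat-toNF (setInd e x d) G em fo
  to : Sat e (∀ᶠ x G) → ¬ Σ D (λ d → ¬ SatNF (setInd e x d) (toNF G))
  to a (d , n) = n (proj₁ (ih d) (a d))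
  from : ¬ Σ D (λ d → ¬ SatNF (setInd e x d) (toNF G)) → Sat e (∀ᶠ x G)
  from n d with em {SatNF (setInd e x d) (toNF G)}
  ... | yes s = proj₂ (ih d) s
  ... | no ns = ⊥-elim (n (d , ns))
Sat-toNF e (∃ᶠ x G) em fo = ⟺-trans (Σ-⟺ (λ d → Sat-toNF (setInd e x d) G em fo)) (⟺-sym (SatNF-existsNF e x (toNF G) em))

maxVarTerm : Term → ℕ
maxVarTerm (var v) = v
maxVarTerm (con c) = 0

maxVarCell : List Lit → ℕ
maxVarCell [] = 0
maxVarCell (predL q b ∷ K) = maxVarCell K
maxVarCell (eqL t b ∷ K) = maxVarTerm t ⊔ maxVarCell K

maxVarAtom : At → ℕ
maxVarAtom (nulA q) = 0
maxVarAtom (unA q t) = maxVarTerm t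
maxVarAtom (eqA t s) = maxVarTerm t ⊔ maxVarTerm s
maxVarAtom (cntA n K) = maxVarCell K

maxVarNF : NF → ℕ
maxVarNF (atom A) = maxVarAtom A
maxVarNF (neg Φ) = maxVarNF Φ
maxVarNF (conj Φ Ψ) = maxVarNF Φ ⊔ maxVarNF Ψ
maxVarNF (disj Φ Ψ) = maxVarNF Φ ⊔ maxVarNF Ψ
maxVarNF _ = 0

maxVarTerm-below : ∀ t k → maxVarTerm t ≤ k → TermBelow (suc k) t
maxVarTerm-below (var v) k h = s≤s h
maxVarTerm-below (con c) k h = tt

maxVarCell-below : ∀ K k → maxVarCell K ≤ k → All (LitBelow (suc k)) K
maxVarCell-below [] k h = []
maxVarCell-below (predL q b ∷ K) k h = tt ∷ maxVarCell-below K k h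
maxVarCell-below (eqL t b ∷ K) k h = maxVarTerm-below t k (m⊔n≤o⇒m≤o (maxVarTerm t) (maxVarCell K) h) ∷ maxVarCell-below K k (m⊔n≤o⇒n≤o (maxVarTerm t) (maxVarCell K) h)

maxVarAtom-below : ∀ A k → maxVarAtom A ≤ k → AtomBelow (suc k) A
maxVarAtom-below (nulA q) k h = tt
maxVarAtom-below (unA q t) k h = maxVarTerm-below t k h
maxVarAtom-below (eqA t s) k h = maxVarTerm-below t k (m⊔n≤o⇒m≤o (maxVarTerm t) (maxVarTerm s) h) , maxVarTerm-below s k (m⊔n≤o⇒n≤o (maxVarTerm t) (maxVarTerm s) h)
maxVarAtom-below (cntA n K) k h = maxVarCell-below K k h

maxVarNF-below : ∀ Φ k → maxVarNF Φ ≤ k → NFBelow (suc k) Φ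
maxVarNF-below ⊤ⁿ k h = tt
maxVarNF-below ⊥ⁿ k h = tt
maxVarNF-below (atom A) k h = maxVarAtom-below A k h
maxVarNF-below (neg Φ) k h = maxVarNF-below Φ k h
maxVarNF-below (conj Φ Ψ) k h = maxVarNF-below Φ k (m⊔n≤o⇒m≤o (maxVarNF Φ) (maxVarNF Ψ) h) , maxVarNF-below Ψ k (m⊔n≤o⇒n≤o (maxVarNF Φ) (maxVarNF Ψ) h)
maxVarNF-below (disj Φ Ψ) k h = maxVarNF-below Φ k (m⊔n≤o⇒m≤o (maxVarNF Φ) (maxVarNF Ψ) h) , maxVarNF-below Ψ k (m⊔n≤o⇒n≤o (maxVarNF Φ) (maxVarNF Ψ) h)

predSigns : PName → List Lit → List Bool
predSigns p [] = []
predSigns p (predL q b ∷ K) = if q ≡ᵇ p then b ∷ predSigns p K else predSigns p K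
predSigns p (eqL t b ∷ K) = predSigns p K

dropPred : PName → List Lit → List Lit
dropPred p [] = []
dropPred p (predL q b ∷ K) = if q ≡ᵇ p then dropPred p K else predL q b ∷ dropPred p K
dropPred p (eqL t b ∷ K) = eqL t b ∷ dropPred p K

nonEmpty : List Bool → Bool
nonEmpty [] = false
nonEmpty (_ ∷ _) = true

mentions : PName → At → Bool
mentions p (unA q t) = q ≡ᵇ p
mentions p (cntA n K) = nonEmpty (predSigns p K)
mentions p _ = false

unP-setUn-other : ∀ {D} (e : Env D) p P q d → (q ≡ᵇ p) ≡ false → unP (setUn e p P) q d ≡ unP e q d
unP-setUn-other e p P q d h rewrite h = refl

SatCell-dropPred : ∀ {D} (e : Env D) p z K →
            SatCell e z K ⟺ (SatCell e z (dropPred p K) × All (λ b → unP e p z ≡ b) (predSigns p K))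
SatCell-dropPred e p z [] = (λ _ → [] , []) , (λ _ → [])
SatCell-dropPred e p z (eqL t b ∷ K) = (λ { (s ∷ r) → let (a , c) = proj₁ ih r in s ∷ a , c }) ,
                                (λ { (s ∷ a , c) → s ∷ proj₂ ih (a , c) })
  where ih = SatCell-dropPred e p z K
SatCell-dropPred e p z (predL q b ∷ K) with q ≡ᵇ p in h
... | true rewrite ≡ᵇ-true⇒≡ {q} {p} h = (λ { (u ∷ r) → let (a , c) = proj₁ ih r in a , u ∷ c }) ,
             (λ { (a , u ∷ c) → u ∷ proj₂ ih (a , c) })
  where ih = SatCell-dropPred e p z K
... | false = (λ { (u ∷ r) → let (a , c) = proj₁ ih r in u ∷ a , c }) ,
              (λ { (u ∷ a , c) → u ∷ proj₂ ih (a , c) })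
  where ih = SatCell-dropPred e p z K

evalT-setUn : ∀ {D} (e : Env D) p P t → evalT (setUn e p P) t ≡ evalT e t
evalT-setUn e p P (var x) = refl
evalT-setUn e p P (con c) = refl

SatCell-dropPred-setUn : ∀ {D} (e : Env D) p P z K → SatCell (setUn e p P) z (dropPred p K) ⟺ SatCell e z (dropPred p K)
SatCell-dropPred-setUn e p P z [] = (λ _ → []) , (λ _ → [])
SatCell-dropPred-setUn e p P z (eqL t b ∷ K) = (λ { (s ∷ r) → proj₁ (Signed-≡-cong b (evalT-setUn e p P t)) s ∷ proj₁ ih r }) , (λ { (s ∷ r) → proj₂ (Signed-≡-cong b (evalT-setUn e p P t)) s ∷ proj₂ ih r })
  where ih = SatCell-dropPred-setUn e p P z K
SatCell-dropPred-setUn e p P z (predL q b ∷ K) with q ≡ᵇ p in h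
... | true = SatCell-dropPred-setUn e p P z K
... | false = (λ { (s ∷ r) → trans (sym (unP-setUn-other e p P q z h)) s ∷ proj₁ ih r }) , (λ { (s ∷ r) → trans (unP-setUn-other e p P q z h) s ∷ proj₂ ih r })
  where ih = SatCell-dropPred-setUn e p P z K

SatAtom-setUn-unmentioned : ∀ {D} (e : Env D) p P A → mentions p A ≡ false → SatAtom (setUn e p P) A ⟺ SatAtom e A
SatAtom-setUn-unmentioned e p P (nulA q) h = ⟺-refl
SatAtom-setUn-unmentioned e p P (unA q t) h rewrite evalT-setUn e p P t | unP-setUn-other e p P q (evalT e t) h = ⟺-refl
SatAtom-setUn-unmentioned e p P (eqA t s) h rewrite evalT-setUn e p P t | evalT-setUn e p P s = ⟺-refl
SatAtom-setUn-unmentioned e p P (cntA n K) h = AtLeast-⟺ (suc n) (λ z →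
  ⟺-trans (SatCell-dropPred (setUn e p P) p z K)
  (⟺-trans (×-⟺ (SatCell-dropPred-setUn e p P z K) (vacuous (predSigns p K) h))
  (⟺-sym (SatCell-dropPred e p z K))))
  where
  vacuous : ∀ bs → nonEmpty bs ≡ false → ∀ {X Y : Bool → Set} → All X bs ⟺ All Y bs
  vacuous [] _ = (λ _ → []) , (λ _ → [])

_≟T_ : (s t : Term) → Dec (s ≡ t)
var x ≟T var y with x ≟ℕ y
... | yes refl = yes refl
... | no n = no (λ { refl → n refl })
var x ≟T con c = no (λ ())
con c ≟T var y = no (λ ())
con c ≟T con d with c ≟ℕ d
... | yes refl = yes refl
... | no n = no (λ { refl → n refl })

_≟L_ : (l l' : Lit) → Dec (l ≡ l')
predL q b ≟L predL r c with q ≟ℕ r | b ≟B c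
... | yes refl | yes refl = yes refl
... | no n | _ = no (λ { refl → n refl })
... | yes _ | no n = no (λ { refl → n refl })
predL q b ≟L eqL t c = no (λ ())
eqL t b ≟L predL r c = no (λ ())
eqL t b ≟L eqL s c with t ≟T s | b ≟B c
... | yes refl | yes refl = yes refl
... | no n | _ = no (λ { refl → n refl })
... | yes _ | no n = no (λ { refl → n refl })

_≟A_ : (A B : At) → Dec (A ≡ B)
nulA q ≟A nulA r with q ≟ℕ r
... | yes refl = yes refl
... | no n = no (λ { refl → n refl })
unA q t ≟A unA r s with q ≟ℕ r | t ≟T s
... | yes refl | yes refl = yes refl
... | no n | _ = no (λ { refl → n refl })
... | yes _ | no n = no (λ { refl → n refl })
eqA t t' ≟A eqA s s' with t ≟T s | t' ≟T s'
... | yes refl | yes refl = yes refl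
... | no n | _ = no (λ { refl → n refl })
... | yes _ | no n = no (λ { refl → n refl })
cntA n K ≟A cntA k K' with n ≟ℕ k | ≡-dec _≟L_ K K'
... | yes refl | yes refl = yes refl
... | no n' | _ = no (λ { refl → n' refl })
... | yes _ | no n' = no (λ { refl → n' refl })
nulA _ ≟A unA _ _ = no (λ ())
nulA _ ≟A eqA _ _ = no (λ ())
nulA _ ≟A cntA _ _ = no (λ ())
unA _ _ ≟A nulA _ = no (λ ())
unA _ _ ≟A eqA _ _ = no (λ ())
unA _ _ ≟A cntA _ _ = no (λ ())
eqA _ _ ≟A nulA _ = no (λ ())
eqA _ _ ≟A unA _ _ = no (λ ())
eqA _ _ ≟A cntA _ _ = no (λ ())
cntA _ _ ≟A nulA _ = no (λ ())
cntA _ _ ≟A unA _ _ = no (λ ())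
cntA _ _ ≟A eqA _ _ = no (λ ())

lookupAtom : List (At × Bool) → At → Bool
lookupAtom [] A = false
lookupAtom ((B , b) ∷ L) A with A ≟A B
... | yes _ = b
... | no _ = lookupAtom L A

SatSigned : ∀ {D} → Env D → List (At × Bool) → Set
SatSigned e L = All (λ l → Signed (proj₂ l) (SatAtom e (proj₁ l))) L

lookupAtom-correct : ∀ {D} (e : Env D) L A → SatSigned e L → A ∈ map proj₁ L → Signed (lookupAtom L A) (SatAtom e A)
lookupAtom-correct e ((B , b) ∷ L) A (h ∷ hs) m with A ≟A B
... | yes refl = h
lookupAtom-correct e ((B , b) ∷ L) A (h ∷ hs) (here e') | no n = ⊥-elim (n e')
lookupAtom-correct e ((B , b) ∷ L) A (h ∷ hs) (there m) | no n = lookupAtom-correct e L A hs m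

assume : PName → List (At × Bool) → NF → NF
assume p L ⊤ⁿ = ⊤ⁿ
assume p L ⊥ⁿ = ⊥ⁿ
assume p L (atom A) = if mentions p A then constNF (lookupAtom L A) else atom A
assume p L (neg Φ) = neg (assume p L Φ)
assume p L (conj Φ Ψ) = conj (assume p L Φ) (assume p L Ψ)
assume p L (disj Φ Ψ) = disj (assume p L Φ) (assume p L Ψ)

predAtoms : PName → NF → List At
predAtoms p (atom A) = if mentions p A then A ∷ [] else []
predAtoms p (neg Φ) = predAtoms p Φ
predAtoms p (conj Φ Ψ) = predAtoms p Φ ++ predAtoms p Ψ
predAtoms p (disj Φ Ψ) = predAtoms p Φ ++ predAtoms p Ψ
predAtoms p _ = []

SatNF-constNF-Signed : ∀ {D} (e : Env D) b {X : Set} → Signed b X → SatNF e (constNF b) ⟺ X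
SatNF-constNF-Signed e true x = (λ _ → x) , (λ _ → tt)
SatNF-constNF-Signed e false nx = (λ ()) , (λ x → nx x)

SatNF-assume : ∀ {D} (e : Env D) p L Φ → SatSigned e L → (∀ A → A ∈ predAtoms p Φ → A ∈ map proj₁ L) →
            SatNF e (assume p L Φ) ⟺ SatNF e Φ
SatNF-assume e p L ⊤ⁿ h c = ⟺-refl
SatNF-assume e p L ⊥ⁿ h c = ⟺-refl
SatNF-assume e p L (atom A) h c with mentions p A
... | true = SatNF-constNF-Signed e (lookupAtom L A) (lookupAtom-correct e L A h (c A (here refl)))
... | false = ⟺-refl
SatNF-assume e p L (neg Φ) h c = ¬-⟺ (SatNF-assume e p L Φ h c)
SatNF-assume e p L (conj Φ Ψ) h c = ×-⟺ (SatNF-assume e p L Φ h (λ A m → c A (∈-++⁺ˡ m))) (SatNF-assume e p L Ψ h (λ A m → c A (∈-++⁺ʳ (predAtoms p Φ) m)))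
SatNF-assume e p L (disj Φ Ψ) h c = ⊎-⟺ (SatNF-assume e p L Φ h (λ A m → c A (∈-++⁺ˡ m))) (SatNF-assume e p L Ψ h (λ A m → c A (∈-++⁺ʳ (predAtoms p Φ) m)))

SatNF-constNF-env : ∀ {D} (e e' : Env D) b → SatNF e (constNF b) ⟺ SatNF e' (constNF b)
SatNF-constNF-env e e' true = ⟺-refl
SatNF-constNF-env e e' false = ⟺-refl

SatNF-assume-setUn : ∀ {D} (e : Env D) p P L Φ → SatNF (setUn e p P) (assume p L Φ) ⟺ SatNF e (assume p L Φ)
SatNF-assume-setUn e p P L ⊤ⁿ = ⟺-refl
SatNF-assume-setUn e p P L ⊥ⁿ = ⟺-refl
SatNF-assume-setUn e p P L (atom A) with mentions p A in h
... | true = SatNF-constNF-env _ _ (lookupAtom L A)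
... | false = SatAtom-setUn-unmentioned e p P A h
SatNF-assume-setUn e p P L (neg Φ) = ¬-⟺ (SatNF-assume-setUn e p P L Φ)
SatNF-assume-setUn e p P L (conj Φ Ψ) = ×-⟺ (SatNF-assume-setUn e p P L Φ) (SatNF-assume-setUn e p P L Ψ)
SatNF-assume-setUn e p P L (disj Φ Ψ) = ⊎-⟺ (SatNF-assume-setUn e p P L Φ) (SatNF-assume-setUn e p P L Ψ)

assume-below : ∀ m p L Φ → NFBelow m Φ → NFBelow m (assume p L Φ)
assume-below m p L ⊤ⁿ b = tt
assume-below m p L ⊥ⁿ b = tt
assume-below m p L (atom A) b with mentions p A
... | true with lookupAtom L A
...   | true = tt
...   | false = tt
assume-below m p L (atom A) b | false = b
assume-below m p L (neg Φ) b = assume-below m p L Φ b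
assume-below m p L (conj Φ Ψ) (b , c) = assume-below m p L Φ b , assume-below m p L Ψ c
assume-below m p L (disj Φ Ψ) (b , c) = assume-below m p L Φ b , assume-below m p L Ψ c

-- Blocks

conjA conjB conjC conjD : PName → ℕ → Spec → Fm
conjA p m (n , x , A) = ¬ᶠ distinctWitnesses x (¬ᶠ (A ∨ᶠ app p (var x))) (freshVars (suc m) n)
conjB p m (n , x , B) = ¬ᶠ distinctWitnesses x (¬ᶠ (B ∨ᶠ (¬ᶠ app p (var x)))) (freshVars (suc m) n)
conjC p m (n , x , C) = distinctWitnesses x (C ∧ᶠ app p (var x)) (freshVars (suc m) n)
conjD p m (n , x , D) = distinctWitnesses x (D ∧ᶠ (¬ᶠ app p (var x))) (freshVars (suc m) n)

Specs⁴ : Set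
Specs⁴ = List Spec × List Spec × List Spec × List Spec

cellOrFalse : ℕ → Bool → List Lit → Fm
cellOrFalse m true K = cellFm m K
cellOrFalse m false K = ⊥ᶠ

-- countSpecs m o a b n K is the block conjunct for the literal "at least n elements satisfy K′"
-- with sign b, where K′ is the p-free cell K plus literals "p z = v" whose signs have disjunction
-- o and conjunction a. If K′ requires p it counts C ∧ px, with C = ⊥ when K′ also requires ¬p,
-- and otherwise D ∧ ¬px; the negative sign gives the dual ∀^{<n} conjunct.
countSpecs : ℕ → Bool → Bool → Bool → ℕ → List Lit → Specs⁴
countSpecs m true a true n K = [] , [] , (n , m , cellOrFalse m a K) ∷ [] , []
countSpecs m true a false n K = [] , (n , m , ¬ᶠ cellOrFalse m a K) ∷ [] , [] , []
countSpecs m false a true n K = [] , [] , [] , (n , m , cellFm m K) ∷ []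
countSpecs m false a false n K = (n , m , ¬ᶠ cellFm m K) ∷ [] , [] , [] , []

literalSpecs : PName → ℕ → At × Bool → Specs⁴
literalSpecs p m (unA q t , true) = [] , [] , (1 , m , eqᶠ (var m) t) ∷ [] , []
literalSpecs p m (unA q t , false) = [] , [] , [] , (1 , m , eqᶠ (var m) t) ∷ []
literalSpecs p m (cntA n K , b) = countSpecs m (or (predSigns p K)) (and (predSigns p K)) b (suc n) (dropPred p K)
literalSpecs p m _ = [] , [] , [] , []

specsA specsB specsC specsD : PName → ℕ → At × Bool → List Spec
specsA p m l = proj₁ (literalSpecs p m l)
specsB p m l = proj₁ (proj₂ (literalSpecs p m l))
specsC p m l = proj₁ (proj₂ (proj₂ (literalSpecs p m l)))
specsD p m l = proj₂ (proj₂ (proj₂ (literalSpecs p m l)))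

blockConjuncts : PName → ℕ → List (At × Bool) → List Fm
blockConjuncts p m L = map (conjA p m) (concatMap (specsA p m) L) ++ map (conjB p m) (concatMap (specsB p m) L) ++
                       map (conjC p m) (concatMap (specsC p m) L) ++ map (conjD p m) (concatMap (specsD p m) L)

blockBody : PName → ℕ → List (At × Bool) → Fm
blockBody p m L = ⋀ (blockConjuncts p m L)

block : PName → ℕ → List (At × Bool) → Fm
block p m L = ∃₁ p (blockBody p m L)

PAtom : PName → ℕ → At → Set
PAtom p m A = mentions p A ≡ true × AtomBelow m A

PLiteral : PName → ℕ → At × Bool → Set
PLiteral p m l = PAtom p m (proj₁ l)

VarsAtMost-∪ : ∀ {m G} → VarsAtMost m G → ∀ y → VarOcc y G ⊎ y ≡ m → y ≤ m
VarsAtMost-∪ bound y = Sum.[ bound y , (λ { refl → ≤-refl }) ]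

module _ {D : Set} (e : Env D) (p : PName) (m n : ℕ) (G : Fm) (bound : VarsAtMost m G) where
  private
    p-at-m : ∀ d → (unP (setInd e m d) p (ind (setInd e m d) m) ≡ true) ⟺ (unP e p d ≡ true)
    p-at-m d rewrite ≡ᵇ-refl m = ⟺-refl

  Sat-conjA : Sat e (conjA p m (n , m , G)) ⟺ (¬ AtLeast n (λ d → ¬ (Sat (setInd e m d) G ⊎ unP e p d ≡ true)))
  Sat-conjA = ¬-⟺ (⟺-trans (Sat-atLeastFm e m n (¬ᶠ (G ∨ᶠ app p (var m))) (VarsAtMost-∪ {G = G} bound))
                           (AtLeast-⟺ n (λ d → ¬-⟺ (⊎-⟺ ⟺-refl (p-at-m d)))))

  Sat-conjB : Sat e (conjB p m (n , m , G)) ⟺ (¬ AtLeast n (λ d → ¬ (Sat (setInd e m d) G ⊎ ¬ unP e p d ≡ true)))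
  Sat-conjB = ¬-⟺ (⟺-trans (Sat-atLeastFm e m n (¬ᶠ (G ∨ᶠ (¬ᶠ app p (var m)))) (VarsAtMost-∪ {G = G} bound))
                           (AtLeast-⟺ n (λ d → ¬-⟺ (⊎-⟺ ⟺-refl (¬-⟺ (p-at-m d))))))

  Sat-conjC : Sat e (conjC p m (n , m , G)) ⟺ AtLeast n (λ d → Sat (setInd e m d) G × unP e p d ≡ true)
  Sat-conjC = ⟺-trans (Sat-atLeastFm e m n (G ∧ᶠ app p (var m)) (VarsAtMost-∪ {G = G} bound)) (AtLeast-⟺ n (λ d → ×-⟺ ⟺-refl (p-at-m d)))

  Sat-conjD : Sat e (conjD p m (n , m , G)) ⟺ AtLeast n (λ d → Sat (setInd e m d) G × ¬ unP e p d ≡ true)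
  Sat-conjD = ⟺-trans (Sat-atLeastFm e m n (G ∧ᶠ (¬ᶠ app p (var m))) (VarsAtMost-∪ {G = G} bound)) (AtLeast-⟺ n (λ d → ×-⟺ ⟺-refl (¬-⟺ (p-at-m d))))

All≡-and : ∀ {v : Bool} bs → and bs ≡ true → nonEmpty bs ≡ true → All (v ≡_) bs ⟺ (v ≡ true)
All≡-and (true ∷ []) a n = (λ { (q ∷ []) → q }) , (λ q → q ∷ [])
All≡-and (true ∷ b ∷ bs) a n = (λ { (q ∷ r) → q }) , (λ q → q ∷ proj₂ (All≡-and (b ∷ bs) a refl) q)

All≡-mixed : ∀ {v : Bool} bs → or bs ≡ true → and bs ≡ false → ¬ All (v ≡_) bs
All≡-mixed {v} bs o a al = true≢false (trans (sym (has-true bs o al)) (has-false bs a al))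
  where
  has-true : ∀ bs → or bs ≡ true → All (v ≡_) bs → v ≡ true
  has-true (true ∷ bs) o (q ∷ _) = q
  has-true (false ∷ bs) o (_ ∷ r) = has-true bs o r
  has-false : ∀ bs → and bs ≡ false → All (v ≡_) bs → v ≡ false
  has-false (false ∷ bs) a (q ∷ _) = q
  has-false (true ∷ bs) a (_ ∷ r) = has-false bs a r

All≡-nor : ∀ {v : Bool} bs → or bs ≡ false → nonEmpty bs ≡ true → All (v ≡_) bs ⟺ (v ≢ true)
All≡-nor {v} bs o n = to bs o n , from bs o
  where
  to : ∀ bs → or bs ≡ false → nonEmpty bs ≡ true → All (v ≡_) bs → v ≢ true
  to (false ∷ bs) o n (refl ∷ _) ()
  from : ∀ bs → or bs ≡ false → v ≢ true → All (v ≡_) bs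
  from [] o v≢true = []
  from (false ∷ bs) o v≢true = ¬-not v≢true ∷ from bs o v≢true

¬⊎¬⟺× : ExcludedMiddle 0ℓ → ∀ {X Y : Set} → (¬ (¬ X ⊎ ¬ Y)) ⟺ (X × Y)
¬⊎¬⟺× em {X} {Y} = to , (λ { (x , y) → Sum.[ (λ ¬x → ¬x x) , (λ ¬y → ¬y y) ] })
  where
  to : ¬ (¬ X ⊎ ¬ Y) → X × Y
  to n with em {X} | em {Y}
  ... | yes x | yes y = x , y
  ... | no ¬x | _ = ⊥-elim (n (inj₁ ¬x))
  ... | _ | no ¬y = ⊥-elim (n (inj₂ ¬y))

¬⊎⟺×¬ : ExcludedMiddle 0ℓ → ∀ {X Y : Set} → (¬ (¬ X ⊎ Y)) ⟺ (X × ¬ Y)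
¬⊎⟺×¬ em {X} {Y} = to , (λ { (x , ¬y) → Sum.[ (λ ¬x → ¬x x) , ¬y ] })
  where
  to : ¬ (¬ X ⊎ Y) → X × ¬ Y
  to n with em {X}
  ... | yes x = x , (λ y → n (inj₂ y))
  ... | no ¬x = ⊥-elim (n (inj₁ ¬x))

dropPred-below : ∀ m p K → All (LitBelow m) K → All (LitBelow m) (dropPred p K)
dropPred-below m p [] [] = []
dropPred-below m p (predL q b ∷ K) (x ∷ xs) with q ≡ᵇ p
... | true = dropPred-below m p K xs
... | false = x ∷ dropPred-below m p K xs
dropPred-below m p (eqL t b ∷ K) (x ∷ xs) = x ∷ dropPred-below m p K xs

AllSpecs⁴ : (Fm → Set) → PName → ℕ → Specs⁴ → Set
AllSpecs⁴ R p m S = All (R ∘ conjA p m) (proj₁ S) × All (R ∘ conjB p m) (proj₁ (proj₂ S)) ×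
                    All (R ∘ conjC p m) (proj₁ (proj₂ (proj₂ S))) × All (R ∘ conjD p m) (proj₂ (proj₂ (proj₂ S)))

module _ {R : Fm → Set} {p : PName} {m : ℕ} {s : Spec} where
  AllSpecs⁴-A : AllSpecs⁴ R p m (s ∷ [] , [] , [] , []) ⟺ R (conjA p m s)
  AllSpecs⁴-A = (λ { (c ∷ [] , _) → c }) , (λ c → c ∷ [] , [] , [] , [])

  AllSpecs⁴-B : AllSpecs⁴ R p m ([] , s ∷ [] , [] , []) ⟺ R (conjB p m s)
  AllSpecs⁴-B = (λ { (_ , c ∷ [] , _) → c }) , (λ c → [] , c ∷ [] , [] , [])

  AllSpecs⁴-C : AllSpecs⁴ R p m ([] , [] , s ∷ [] , []) ⟺ R (conjC p m s)
  AllSpecs⁴-C = (λ { (_ , _ , c ∷ [] , _) → c }) , (λ c → [] , [] , c ∷ [] , [])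

  AllSpecs⁴-D : AllSpecs⁴ R p m ([] , [] , [] , s ∷ []) ⟺ R (conjD p m s)
  AllSpecs⁴-D = (λ { (_ , _ , _ , c ∷ []) → c }) , (λ c → [] , [] , [] , c ∷ [])

All-concatMap : ∀ {A B C : Set} {P : C → Set} (g : B → C) (f : A → List B) L →
                All P (map g (concatMap f L)) ⟺ All (λ l → All (P ∘ g) (f l)) L
All-concatMap g f [] = (λ _ → []) , (λ _ → [])
All-concatMap {P = P} g f (l ∷ L) =
  (λ a → let (a1 , a2) = ++⁻ (f l) (map⁻ a) in a1 ∷ proj₁ (All-concatMap {P = P} g f L) (map⁺ a2)) ,
  (λ { (a1 ∷ a2) → map⁺ (++⁺ a1 (map⁻ (proj₂ (All-concatMap {P = P} g f L) a2))) })

All-unzip⁴ : ∀ {A : Set} {P Q R S : A → Set} L →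
             (All P L × All Q L × All R L × All S L) ⟺ All (λ l → P l × Q l × R l × S l) L
All-unzip⁴ [] = (λ _ → []) , (λ _ → [] , [] , [] , [])
All-unzip⁴ (l ∷ L) =
  (λ { (p ∷ ps , q ∷ qs , r ∷ rs , s ∷ ss) → (p , q , r , s) ∷ proj₁ (All-unzip⁴ L) (ps , qs , rs , ss) }) ,
  (λ { ((p , q , r , s) ∷ xs) → let (ps , qs , rs , ss) = proj₂ (All-unzip⁴ L) xs in p ∷ ps , q ∷ qs , r ∷ rs , s ∷ ss })

All-blockConjuncts : ∀ {R : Fm → Set} p m L →
                     All R (blockConjuncts p m L) ⟺ All (λ l → AllSpecs⁴ R p m (literalSpecs p m l)) L
All-blockConjuncts {R} p m L =
  ⟺-trans (⟺-trans (All-++-⟺ (map (conjA p m) _)) (×-⟺ ⟺-refl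
           (⟺-trans (All-++-⟺ (map (conjB p m) _)) (×-⟺ ⟺-refl (All-++-⟺ (map (conjC p m) _))))))
  (⟺-trans (×-⟺ (All-concatMap {P = R} (conjA p m) (specsA p m) L) (×-⟺ (All-concatMap {P = R} (conjB p m) (specsB p m) L)
           (×-⟺ (All-concatMap {P = R} (conjC p m) (specsC p m) L) (All-concatMap {P = R} (conjD p m) (specsD p m) L))))
  (All-unzip⁴ L))

VarOcc-=var-below : ∀ m t → TermBelow m t → VarsAtMost m (eqᶠ (var m) t)
VarOcc-=var-below m t b y = Sum.[ (λ { refl → ≤-refl }) , (λ o → <⇒≤ (OccT-below m y t b o)) ]

Sat-witness : ∀ {D} (e : Env D) m t {X : D → Set} → TermBelow m t →
              Σ D (λ d → Sat (setInd e m d) (eqᶠ (var m) t) × X d) ⟺ X (evalT e t)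
Sat-witness e m t {X} b = to , (λ x → evalT e t , at-t , x)
  where
  to : Σ _ (λ d → Sat (setInd e m d) (eqᶠ (var m) t) × X d) → X (evalT e t)
  to (d , d≡t , x) rewrite ≡ᵇ-refl m | evalT-setInd-below e m d t b | d≡t = x
  at-t : Sat (setInd e m (evalT e t)) (eqᶠ (var m) t)
  at-t rewrite ≡ᵇ-refl m | evalT-setInd-below e m (evalT e t) t b = refl

module _ {D : Set} (e : Env D) (em : ExcludedMiddle 0ℓ) (p : PName) (m n : ℕ) (K : List Lit)
         (b : All (LitBelow m) K) (mentioned : nonEmpty (predSigns p K) ≡ true) where
  private
    bs = predSigns p K
    K′ = dropPred p K
    b′ = dropPred-below m p K b

    Sat-cell : ∀ z → Sat (setInd e m z) (cellFm m K′) ⟺ SatCell e z K′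
    Sat-cell z = Sat-cellFm e m z K′ b′

    bound : ∀ a → VarsAtMost m (cellOrFalse m a K′)
    bound true = VarOcc-cellFm m K′ b′
    bound false y ()

    requires-p : ∀ a → or bs ≡ true → and bs ≡ a →
                 ∀ z → (Sat (setInd e m z) (cellOrFalse m a K′) × unP e p z ≡ true) ⟺ SatCell e z K
    requires-p true o a z = ⟺-trans (×-⟺ (Sat-cell z) (⟺-sym (All≡-and bs a mentioned))) (⟺-sym (SatCell-dropPred e p z K))
    requires-p false o a z =
      (λ { (() , _) }) , (λ s → ⊥-elim (All≡-mixed bs o a (proj₂ (proj₁ (SatCell-dropPred e p z K) s))))

    requires-¬p : or bs ≡ false → ∀ z → (Sat (setInd e m z) (cellFm m K′) × ¬ unP e p z ≡ true) ⟺ SatCell e z K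
    requires-¬p o z = ⟺-trans (×-⟺ (Sat-cell z) (⟺-sym (All≡-nor bs o mentioned))) (⟺-sym (SatCell-dropPred e p z K))

  Sat-countSpecs : ∀ o a s → or bs ≡ o → and bs ≡ a →
                    AllSpecs⁴ (Sat e) p m (countSpecs m o a s (suc n) K′) ⟺ Signed s (SatAtom e (cntA n K))
  Sat-countSpecs true a true o≡ a≡ = ⟺-trans (AllSpecs⁴-C {R = Sat e})
    (⟺-trans (Sat-conjC e p m (suc n) (cellOrFalse m a K′) (bound a)) (AtLeast-⟺ (suc n) (requires-p a o≡ a≡)))
  Sat-countSpecs true a false o≡ a≡ = ⟺-trans (AllSpecs⁴-B {R = Sat e})
    (⟺-trans (Sat-conjB e p m (suc n) (¬ᶠ cellOrFalse m a K′) (bound a)) (¬-⟺ (AtLeast-⟺ (suc n) (λ z → ⟺-trans (¬⊎¬⟺× em) (requires-p a o≡ a≡ z)))))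
  Sat-countSpecs false a true o≡ a≡ = ⟺-trans (AllSpecs⁴-D {R = Sat e})
    (⟺-trans (Sat-conjD e p m (suc n) (cellFm m K′) (bound true)) (AtLeast-⟺ (suc n) (requires-¬p o≡)))
  Sat-countSpecs false a false o≡ a≡ = ⟺-trans (AllSpecs⁴-A {R = Sat e})
    (⟺-trans (Sat-conjA e p m (suc n) (¬ᶠ cellFm m K′) (bound true)) (¬-⟺ (AtLeast-⟺ (suc n) (λ z → ⟺-trans (¬⊎⟺×¬ em) (requires-¬p o≡ z)))))

Sat-literalSpecs : ∀ {D} (e : Env D) p m l → ExcludedMiddle 0ℓ → PLiteral p m l →
                    AllSpecs⁴ (Sat e) p m (literalSpecs p m l) ⟺ Signed (proj₂ l) (SatAtom e (proj₁ l))
Sat-literalSpecs e p m (unA q t , true) em (q≡p , b) rewrite ≡ᵇ-true⇒≡ {q} {p} q≡p =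
  ⟺-trans (AllSpecs⁴-C {R = Sat e}) (⟺-trans (Sat-conjC e p m 1 (eqᶠ (var m) t) bound) (⟺-trans AtLeast-1 (Sat-witness e m t b)))
  where bound = VarOcc-=var-below m t b
Sat-literalSpecs e p m (unA q t , false) em (q≡p , b) rewrite ≡ᵇ-true⇒≡ {q} {p} q≡p =
  ⟺-trans (AllSpecs⁴-D {R = Sat e}) (⟺-trans (Sat-conjD e p m 1 (eqᶠ (var m) t) bound) (⟺-trans AtLeast-1 (Sat-witness e m t b)))
  where bound = VarOcc-=var-below m t b
Sat-literalSpecs e p m (cntA n K , s) em (mentioned , b) =
  Sat-countSpecs e em p m n K b mentioned (or (predSigns p K)) (and (predSigns p K)) s refl refl

Sat-blockBody : ∀ {D} (e : Env D) p m L → ExcludedMiddle 0ℓ → All (PLiteral p m) L →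
                Sat e (blockBody p m L) ⟺ SatSigned e L
Sat-blockBody e p m L em pL =
  ⟺-trans (Sat-⋀ _ e) (⟺-trans (All-blockConjuncts p m L) (All-⟺-with pL (λ l → Sat-literalSpecs e p m l em)))

splitAtoms : PName → ℕ → NF → List (At × Bool) → List At → Fm
splitAtoms p m Φ L [] = nfFm m (assume p L Φ) ∧ᶠ block p m L
splitAtoms p m Φ L (A ∷ As) = splitAtoms p m Φ ((A , true) ∷ L) As ∨ᶠ splitAtoms p m Φ ((A , false) ∷ L) As

predAtoms-PAtom : ∀ p m Φ → NFBelow m Φ → All (PAtom p m) (predAtoms p Φ)
predAtoms-PAtom p m ⊤ⁿ b = []
predAtoms-PAtom p m ⊥ⁿ b = []
predAtoms-PAtom p m (atom A) b with mentions p A in h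
... | true = (h , b) ∷ []
... | false = []
predAtoms-PAtom p m (neg Φ) b = predAtoms-PAtom p m Φ b
predAtoms-PAtom p m (conj Φ Ψ) (b , c) = ++⁺ (predAtoms-PAtom p m Φ b) (predAtoms-PAtom p m Ψ c)
predAtoms-PAtom p m (disj Φ Ψ) (b , c) = ++⁺ (predAtoms-PAtom p m Φ b) (predAtoms-PAtom p m Ψ c)

SomeP : ∀ {D} → Env D → PName → List (At × Bool) → NF → Set
SomeP {D} e p L Φ = Σ (D → Bool) (λ P → SatSigned (setUn e p P) L × SatNF (setUn e p P) Φ)

Sat-nfFm-assume : ∀ {D} (e : Env D) p m Φ L P → NFBelow m Φ → SatSigned (setUn e p P) L →
                  (∀ A → A ∈ predAtoms p Φ → A ∈ map proj₁ L) →
                  Sat e (nfFm m (assume p L Φ)) ⟺ SatNF (setUn e p P) Φ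
Sat-nfFm-assume e p m Φ L P nb h covered =
  ⟺-trans (Sat-nfFm e m (assume p L Φ) (assume-below m p L Φ nb))
  (⟺-trans (⟺-sym (SatNF-assume-setUn e p P L Φ)) (SatNF-assume (setUn e p P) p L Φ h covered))

Sat-assumed : ∀ {D} (e : Env D) p m Φ L → ExcludedMiddle 0ℓ → NFBelow m Φ → All (PLiteral p m) L →
              (∀ A → A ∈ predAtoms p Φ → A ∈ map proj₁ L) →
              Sat e (splitAtoms p m Φ L []) ⟺ SomeP e p L Φ
Sat-assumed e p m Φ L em nb pL covered = to , from
  where
  Sat-block : ∀ P → Sat (setUn e p P) (blockBody p m L) ⟺ SatSigned (setUn e p P) L
  Sat-block P = Sat-blockBody (setUn e p P) p m L em pL
  to : Sat e (splitAtoms p m Φ L []) → SomeP e p L Φ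
  to (s , P , bb) = let h = proj₁ (Sat-block P) bb in P , h , proj₁ (Sat-nfFm-assume e p m Φ L P nb h covered) s
  from : SomeP e p L Φ → Sat e (splitAtoms p m Φ L [])
  from (P , h , s) = proj₂ (Sat-nfFm-assume e p m Φ L P nb h covered) s , P , proj₂ (Sat-block P) h

Sat-splitAtoms : ∀ {D} (e : Env D) p m Φ L As → ExcludedMiddle 0ℓ → NFBelow m Φ → All (PLiteral p m) L →
                 All (PAtom p m) As → (∀ A → A ∈ predAtoms p Φ → A ∈ map proj₁ L ⊎ A ∈ As) →
                 Sat e (splitAtoms p m Φ L As) ⟺ SomeP e p L Φ
Sat-splitAtoms e p m Φ L [] em nb pL pA covered = Sat-assumed e p m Φ L em nb pL (λ A mem → [ (λ m → m) , (λ ()) ]′ (covered A mem))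
Sat-splitAtoms e p m Φ L (A ∷ As) em nb pL (pa ∷ pA) covered = to , from
  where
  covered′ : ∀ b B → B ∈ predAtoms p Φ → B ∈ map proj₁ ((A , b) ∷ L) ⊎ B ∈ As
  covered′ b B mem with covered B mem
  ... | inj₁ m′ = inj₁ (there m′)
  ... | inj₂ (here B≡A) = inj₁ (here B≡A)
  ... | inj₂ (there m′) = inj₂ m′
  branch : ∀ b → Sat e (splitAtoms p m Φ ((A , b) ∷ L) As) ⟺ SomeP e p ((A , b) ∷ L) Φ
  branch b = Sat-splitAtoms e p m Φ ((A , b) ∷ L) As em nb (pa ∷ pL) pA (covered′ b)
  to : Sat e (splitAtoms p m Φ L (A ∷ As)) → SomeP e p L Φ
  to (inj₁ s) with proj₁ (branch true) s
  ... | P , (_ ∷ h) , s′ = P , h , s′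
  to (inj₂ s) with proj₁ (branch false) s
  ... | P , (_ ∷ h) , s′ = P , h , s′
  from : SomeP e p L Φ → Sat e (splitAtoms p m Φ L (A ∷ As))
  from (P , h , s) with em {SatAtom (setUn e p P) A}
  ... | yes a = inj₁ (proj₂ (branch true) (P , a ∷ h , s))
  ... | no ¬a = inj₂ (proj₂ (branch false) (P , ¬a ∷ h , s))

-- Without p-atoms no block is emitted: the empty block ∃p ⊤ would introduce p, which need not
-- occur in the input.
eliminateOn : PName → ℕ → NF → List At → Fm
eliminateOn p m Φ [] = nfFm m (assume p [] Φ)
eliminateOn p m Φ (A ∷ As) = splitAtoms p m Φ [] (A ∷ As)

eliminate : PName → NF → Fm
eliminate p Φ = eliminateOn p (suc (maxVarNF Φ)) Φ (predAtoms p Φ)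

Sat-eliminateOn : ∀ {D} (e : Env D) p m Φ As → ExcludedMiddle 0ℓ → NFBelow m Φ → All (PAtom p m) As →
                  (∀ A → A ∈ predAtoms p Φ → A ∈ As) →
                  Sat e (eliminateOn p m Φ As) ⟺ Σ (D → Bool) (λ P → SatNF (setUn e p P) Φ)
Sat-eliminateOn e p m Φ [] em nb pA covered =
  (λ s → unP e p , proj₁ (Sat-p-free (unP e p)) s) , (λ { (P , s) → proj₂ (Sat-p-free P) s })
  where
  ∉[] : ∀ {A} → A ∉ []
  ∉[] ()
  Sat-p-free : ∀ P → Sat e (nfFm m (assume p [] Φ)) ⟺ SatNF (setUn e p P) Φ
  Sat-p-free P = Sat-nfFm-assume e p m Φ [] P nb [] (λ A mem → ⊥-elim (∉[] (covered A mem)))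
Sat-eliminateOn e p m Φ (A ∷ As) em nb pA covered =
  ⟺-trans (Sat-splitAtoms e p m Φ [] (A ∷ As) em nb [] pA (λ B mem → inj₂ (covered B mem)))
          ((λ { (P , _ , s) → P , s }) , (λ { (P , s) → P , [] , s }))

Sat-eliminate : ∀ {D} (e : Env D) p Φ → ExcludedMiddle 0ℓ → Sat e (eliminate p Φ) ⟺ Σ (D → Bool) (λ P → SatNF (setUn e p P) Φ)
Sat-eliminate e p Φ em =
  Sat-eliminateOn e p m Φ (predAtoms p Φ) em nb (predAtoms-PAtom p m Φ nb) (λ A mem → mem)
  where
  m = suc (maxVarNF Φ)
  nb = maxVarNF-below Φ (maxVarNF Φ) ≤-refl

method : PName → Fm → Fm
method p F = eliminate p (toNF F)

method-correct : ∀ p F → IsFO F → method p F ≈ᶠ ∃₁ p F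
method-correct p F fo em D e = mk⇔ (proj₁ h) (proj₂ h)
  where
  h : Sat e (method p F) ⟺ Sat e (∃₁ p F)
  h = ⟺-trans (Sat-eliminate e p (toNF F) em) (Σ-⟺ (λ P → ⟺-sym (Sat-toNF (setUn e p P) F em fo)))

data Sym : Set where
  const nullary unary : Sym

OccSym : Sym → ℕ → Fm → Set
OccSym const = OccC
OccSym nullary = OccN
OccSym unary = OccU

OccSym-¬ : ∀ k a G → OccSym k a (¬ᶠ G) ⟺ OccSym k a G
OccSym-¬ const a G = ⟺-refl
OccSym-¬ nullary a G = ⟺-refl
OccSym-¬ unary a G = ⟺-refl

OccSym-∧ : ∀ k a G H → OccSym k a (G ∧ᶠ H) ⟺ (OccSym k a G ⊎ OccSym k a H)
OccSym-∧ const a G H = ⟺-refl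
OccSym-∧ nullary a G H = ⟺-refl
OccSym-∧ unary a G H = ⟺-refl

OccSym-∨ : ∀ k a G H → OccSym k a (G ∨ᶠ H) ⟺ (OccSym k a G ⊎ OccSym k a H)
OccSym-∨ const a G H = ⟺-refl
OccSym-∨ nullary a G H = ⟺-refl
OccSym-∨ unary a G H = ⟺-refl

OccSym-∀ᶠ : ∀ k a y G → OccSym k a (∀ᶠ y G) ⟺ OccSym k a G
OccSym-∀ᶠ const a y G = ⟺-refl
OccSym-∀ᶠ nullary a y G = ⟺-refl
OccSym-∀ᶠ unary a y G = ⟺-refl

OccSym-∃ᶠ : ∀ k a y G → OccSym k a (∃ᶠ y G) ⟺ OccSym k a G
OccSym-∃ᶠ const a y G = ⟺-refl
OccSym-∃ᶠ nullary a y G = ⟺-refl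
OccSym-∃ᶠ unary a y G = ⟺-refl

ConT-substT : ∀ c x y t → ConT c (substT x y t) → ConT c t
ConT-substT c x y (var z) o with z ≡ᵇ x
ConT-substT c x y (var z) () | true
ConT-substT c x y (var z) () | false
ConT-substT c x y (con d) o = o

OccSym-subst : ∀ k a x y G → OccSym k a (subst x y G) → OccSym k a G
OccSym-subst const a x y (app q t) o = ConT-substT a x y t o
OccSym-subst nullary a x y (app q t) ()
OccSym-subst unary a x y (app q t) o = o
OccSym-subst const a x y (eqᶠ t s) (inj₁ o) = inj₁ (ConT-substT a x y t o)
OccSym-subst const a x y (eqᶠ t s) (inj₂ o) = inj₂ (ConT-substT a x y s o)
OccSym-subst nullary a x y (eqᶠ t s) ()
OccSym-subst unary a x y (eqᶠ t s) ()
OccSym-subst k a x y ⊤ᶠ o = o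
OccSym-subst k a x y ⊥ᶠ o = o
OccSym-subst k a x y (nul q) o = o
OccSym-subst k a x y (¬ᶠ G) o = proj₂ (OccSym-¬ k a G) (OccSym-subst k a x y G (proj₁ (OccSym-¬ k a _) o))
OccSym-subst k a x y (G ∧ᶠ H) o =
  proj₂ (OccSym-∧ k a G H) (Sum.map (OccSym-subst k a x y G) (OccSym-subst k a x y H) (proj₁ (OccSym-∧ k a _ _) o))
OccSym-subst k a x y (G ∨ᶠ H) o =
  proj₂ (OccSym-∨ k a G H) (Sum.map (OccSym-subst k a x y G) (OccSym-subst k a x y H) (proj₁ (OccSym-∨ k a _ _) o))
OccSym-subst k a x y (∀ᶠ z G) o with z ≡ᵇ x
... | true = o
... | false = proj₂ (OccSym-∀ᶠ k a z G) (OccSym-subst k a x y G (proj₁ (OccSym-∀ᶠ k a z _) o))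
OccSym-subst k a x y (∃ᶠ z G) o with z ≡ᵇ x
... | true = o
... | false = proj₂ (OccSym-∃ᶠ k a z G) (OccSym-subst k a x y G (proj₁ (OccSym-∃ᶠ k a z _) o))
OccSym-subst const a x y (∀₀ q G) o = OccSym-subst const a x y G o
OccSym-subst nullary a x y (∀₀ q G) (inj₁ e) = inj₁ e
OccSym-subst nullary a x y (∀₀ q G) (inj₂ o) = inj₂ (OccSym-subst nullary a x y G o)
OccSym-subst unary a x y (∀₀ q G) o = OccSym-subst unary a x y G o
OccSym-subst const a x y (∃₀ q G) o = OccSym-subst const a x y G o
OccSym-subst nullary a x y (∃₀ q G) (inj₁ e) = inj₁ e
OccSym-subst nullary a x y (∃₀ q G) (inj₂ o) = inj₂ (OccSym-subst nullary a x y G o)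
OccSym-subst unary a x y (∃₀ q G) o = OccSym-subst unary a x y G o
OccSym-subst const a x y (∀₁ q G) o = OccSym-subst const a x y G o
OccSym-subst nullary a x y (∀₁ q G) o = OccSym-subst nullary a x y G o
OccSym-subst unary a x y (∀₁ q G) (inj₁ e) = inj₁ e
OccSym-subst unary a x y (∀₁ q G) (inj₂ o) = inj₂ (OccSym-subst unary a x y G o)
OccSym-subst const a x y (∃₁ q G) o = OccSym-subst const a x y G o
OccSym-subst nullary a x y (∃₁ q G) o = OccSym-subst nullary a x y G o
OccSym-subst unary a x y (∃₁ q G) (inj₁ e) = inj₁ e
OccSym-subst unary a x y (∃₁ q G) (inj₂ o) = inj₂ (OccSym-subst unary a x y G o)

OccSym-∃ᶠ* : ∀ k a B ys → OccSym k a (foldr ∃ᶠ B ys) → OccSym k a B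
OccSym-∃ᶠ* k a B [] o = o
OccSym-∃ᶠ* k a B (y ∷ ys) o = OccSym-∃ᶠ* k a B ys (proj₁ (OccSym-∃ᶠ k a y _) o)

OccSym-⋀∷ : ∀ k a G Gs → OccSym k a (⋀ (G ∷ Gs)) → Any (OccSym k a) (G ∷ Gs)
OccSym-⋀∷ k a G [] o = here o
OccSym-⋀∷ k a G (G' ∷ Gs) o with proj₁ (OccSym-∧ k a G (⋀ (G' ∷ Gs))) o
... | inj₁ o' = here o'
... | inj₂ o' = there (OccSym-⋀∷ k a G' Gs o')

OccSym-⋀ : ∀ k a Gs → OccSym k a (⋀ Gs) → Any (OccSym k a) Gs
OccSym-⋀ k a (G ∷ Gs) o = OccSym-⋀∷ k a G Gs o
OccSym-⋀ const a [] ()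
OccSym-⋀ nullary a [] ()
OccSym-⋀ unary a [] ()

OccSym-≢ : ∀ k a y z → OccSym k a (¬ᶠ eqᶠ (var y) (var z)) → ⊥
OccSym-≢ const a y z (inj₁ ())
OccSym-≢ const a y z (inj₂ ())
OccSym-≢ nullary a y z ()
OccSym-≢ unary a y z ()

OccSym-distinctness : ∀ k a ys → Any (OccSym k a) (distinctness ys) → ⊥
OccSym-distinctness k a (y ∷ ys) an with any++⁻ (map (λ z → ¬ᶠ eqᶠ (var y) (var z)) ys) an
... | inj₁ a1 = h ys a1
  where
  h : ∀ zs → Any (OccSym k a) (map (λ z → ¬ᶠ eqᶠ (var y) (var z)) zs) → ⊥
  h (z ∷ zs) (here o) = OccSym-≢ k a y z o
  h (z ∷ zs) (there w) = h zs w
... | inj₂ a2 = OccSym-distinctness k a ys a2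

OccSym-instances : ∀ k a x G ys → Any (OccSym k a) (map (λ y → subst x y G) ys) → OccSym k a G
OccSym-instances k a x G (y ∷ ys) (here o) = OccSym-subst k a x y G o
OccSym-instances k a x G (y ∷ ys) (there w) = OccSym-instances k a x G ys w

OccSym-distinctWitnesses : ∀ k a x G ys → OccSym k a (distinctWitnesses x G ys) → OccSym k a G
OccSym-distinctWitnesses k a x G ys o with any++⁻ (map (λ y → subst x y G) ys) (OccSym-⋀ k a _ (OccSym-∃ᶠ* k a _ ys o))
... | inj₁ a1 = OccSym-instances k a x G ys a1
... | inj₂ a2 = ⊥-elim (OccSym-distinctness k a ys a2)

FreeV-substT : ∀ v x y t → OccT v (substT x y t) → v ≡ y ⊎ (OccT v t × v ≢ x)
FreeV-substT v x y (var z) o with z ≡ᵇ x in h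
... | true = inj₁ o
... | false = inj₂ (o , (λ vx → ≡ᵇ-false⇒≢ {z} {x} h (trans (sym o) vx)))
FreeV-substT v x y (con c) ()

FreeV-subst : ∀ v x y G → FreeV v (subst x y G) → v ≡ y ⊎ (FreeV v G × v ≢ x)
FreeV-subst v x y (app q t) o = FreeV-substT v x y t o
FreeV-subst v x y (eqᶠ t s) (inj₁ o) = Sum.map₂ (λ { (a , b) → inj₁ a , b }) (FreeV-substT v x y t o)
FreeV-subst v x y (eqᶠ t s) (inj₂ o) = Sum.map₂ (λ { (a , b) → inj₂ a , b }) (FreeV-substT v x y s o)
FreeV-subst v x y ⊤ᶠ ()
FreeV-subst v x y ⊥ᶠ ()
FreeV-subst v x y (nul q) ()
FreeV-subst v x y (¬ᶠ G) o = FreeV-subst v x y G o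
FreeV-subst v x y (G ∧ᶠ H) (inj₁ o) = Sum.map₂ (λ { (a , b) → inj₁ a , b }) (FreeV-subst v x y G o)
FreeV-subst v x y (G ∧ᶠ H) (inj₂ o) = Sum.map₂ (λ { (a , b) → inj₂ a , b }) (FreeV-subst v x y H o)
FreeV-subst v x y (G ∨ᶠ H) (inj₁ o) = Sum.map₂ (λ { (a , b) → inj₁ a , b }) (FreeV-subst v x y G o)
FreeV-subst v x y (G ∨ᶠ H) (inj₂ o) = Sum.map₂ (λ { (a , b) → inj₂ a , b }) (FreeV-subst v x y H o)
FreeV-subst v x y (∀ᶠ z G) o with z ≡ᵇ x in h
... | true = inj₂ (o , (λ vx → proj₁ o (trans vx (sym (≡ᵇ-true⇒≡ {z} {x} h)))))
... | false = Sum.map₂ (λ { (a , b) → (proj₁ o , a) , b }) (FreeV-subst v x y G (proj₂ o))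
FreeV-subst v x y (∃ᶠ z G) o with z ≡ᵇ x in h
... | true = inj₂ (o , (λ vx → proj₁ o (trans vx (sym (≡ᵇ-true⇒≡ {z} {x} h)))))
... | false = Sum.map₂ (λ { (a , b) → (proj₁ o , a) , b }) (FreeV-subst v x y G (proj₂ o))
FreeV-subst v x y (∀₀ q G) o = FreeV-subst v x y G o
FreeV-subst v x y (∃₀ q G) o = FreeV-subst v x y G o
FreeV-subst v x y (∀₁ q G) o = FreeV-subst v x y G o
FreeV-subst v x y (∃₁ q G) o = FreeV-subst v x y G o

FreeV-∃ᶠ* : ∀ v B ys → FreeV v (foldr ∃ᶠ B ys) → FreeV v B × v ∉ ys
FreeV-∃ᶠ* v B [] o = o , (λ ())
FreeV-∃ᶠ* v B (y ∷ ys) (ne , o) = let (a , b) = FreeV-∃ᶠ* v B ys o in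
  a , (λ { (here e) → ne e ; (there m) → b m })

FreeV-⋀∷ : ∀ v G Gs → FreeV v (⋀ (G ∷ Gs)) → Any (FreeV v) (G ∷ Gs)
FreeV-⋀∷ v G [] o = here o
FreeV-⋀∷ v G (G' ∷ Gs) (inj₁ o) = here o
FreeV-⋀∷ v G (G' ∷ Gs) (inj₂ o) = there (FreeV-⋀∷ v G' Gs o)

FreeV-⋀ : ∀ v Gs → FreeV v (⋀ Gs) → Any (FreeV v) Gs
FreeV-⋀ v [] ()
FreeV-⋀ v (G ∷ Gs) o = FreeV-⋀∷ v G Gs o

FreeV-distinctness : ∀ v ys → Any (FreeV v) (distinctness ys) → v ∈ ys
FreeV-distinctness v (y ∷ ys) an with any++⁻ (map (λ z → ¬ᶠ eqᶠ (var y) (var z)) ys) an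
... | inj₁ a1 = h ys a1
  where
  h : ∀ zs → Any (FreeV v) (map (λ z → ¬ᶠ eqᶠ (var y) (var z)) zs) → v ∈ y ∷ zs
  h (z ∷ zs) (here (inj₁ e)) = here e
  h (z ∷ zs) (here (inj₂ e)) = there (here e)
  h (z ∷ zs) (there w) with h zs w
  ... | here e = here e
  ... | there m = there (there m)
... | inj₂ a2 = there (FreeV-distinctness v ys a2)

FreeV-instances : ∀ v x G ys → Any (FreeV v) (map (λ y → subst x y G) ys) → v ∈ ys ⊎ (FreeV v G × v ≢ x)
FreeV-instances v x G (y ∷ ys) (here o) = Sum.map₁ here (FreeV-subst v x y G o)
FreeV-instances v x G (y ∷ ys) (there w) = Sum.map₁ there (FreeV-instances v x G ys w)

FreeV-distinctWitnesses : ∀ v x G ys → FreeV v (distinctWitnesses x G ys) → FreeV v G × v ≢ x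
FreeV-distinctWitnesses v x G ys o with FreeV-∃ᶠ* v _ ys o
... | b , nin with any++⁻ (map (λ y → subst x y G) ys) (FreeV-⋀ v _ b)
...   | inj₁ a1 with FreeV-instances v x G ys a1
...     | inj₁ m = ⊥-elim (nin m)
...     | inj₂ r = r
FreeV-distinctWitnesses v x G ys o | b , nin | inj₂ a2 = ⊥-elim (nin (FreeV-distinctness v ys a2))

nfNuls : NF → List PName
nfNuls (atom (nulA q)) = q ∷ []
nfNuls (neg Φ) = nfNuls Φ
nfNuls (conj Φ Ψ) = nfNuls Φ ++ nfNuls Ψ
nfNuls (disj Φ Ψ) = nfNuls Φ ++ nfNuls Ψ
nfNuls _ = []

constNF-terms : ∀ b s → s ∈ nfTerms (constNF b) → ⊥
constNF-terms true s ()
constNF-terms false s ()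
constNF-preds : ∀ b s → s ∈ nfPreds (constNF b) → ⊥
constNF-preds true s ()
constNF-preds false s ()
constNF-nuls : ∀ b s → s ∈ nfNuls (constNF b) → ⊥
constNF-nuls true s ()
constNF-nuls false s ()

replT-terms : ∀ x t s0 s → s ∈ (replT x t s0 ∷ []) → s ≡ t ⊎ (s ∈ (s0 ∷ []) × isVar x s ≡ false)
replT-terms x t s0 s (here refl) with isVar x s0 in h
... | true = inj₁ refl
... | false = inj₂ (here refl , h)

replL-terms : ∀ x t K s → s ∈ cellTerms (map (replL x t) K) → s ≡ t ⊎ (s ∈ cellTerms K × isVar x s ≡ false)
replL-terms x t [] s ()
replL-terms x t (predL q b ∷ K) s m = replL-terms x t K s m
replL-terms x t (eqL s0 b ∷ K) s (here e) with replT-terms x t s0 s (here e)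
... | inj₁ q = inj₁ q
... | inj₂ (here r , h) = inj₂ (here r , h)
replL-terms x t (eqL s0 b ∷ K) s (there m) = Sum.map₂ (λ { (a , h) → there a , h }) (replL-terms x t K s m)

replL-preds : ∀ x t K q → q ∈ cellPreds (map (replL x t) K) → q ∈ cellPreds K
replL-preds x t [] q ()
replL-preds x t (predL r b ∷ K) q (here e) = here e
replL-preds x t (predL r b ∷ K) q (there m) = there (replL-preds x t K q m)
replL-preds x t (eqL s0 b ∷ K) q m = replL-preds x t K q m

replN-terms : ∀ x t Φ s → s ∈ nfTerms (replN x t Φ) → s ≡ t ⊎ (s ∈ nfTerms Φ × isVar x s ≡ false)
replN-terms x t ⊤ⁿ s ()
replN-terms x t ⊥ⁿ s ()
replN-terms x t (atom (nulA q)) s ()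
replN-terms x t (atom (unA q s0)) s m = replT-terms x t s0 s m
replN-terms x t (atom (eqA s0 s1)) s (here e) = Sum.map₂ (λ { (here r , h) → here r , h }) (replT-terms x t s0 s (here e))
replN-terms x t (atom (eqA s0 s1)) s (there (here e)) = Sum.map₂ (λ { (here r , h) → there (here r) , h }) (replT-terms x t s1 s (here e))
replN-terms x t (atom (cntA n K)) s m = replL-terms x t K s m
replN-terms x t (neg Φ) s m = replN-terms x t Φ s m
replN-terms x t (conj Φ Ψ) s m with ∈-++⁻ (nfTerms (replN x t Φ)) m
... | inj₁ m' = Sum.map₂ (λ { (a , h) → ∈-++⁺ˡ a , h }) (replN-terms x t Φ s m')
... | inj₂ m' = Sum.map₂ (λ { (a , h) → ∈-++⁺ʳ (nfTerms Φ) a , h }) (replN-terms x t Ψ s m')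
replN-terms x t (disj Φ Ψ) s m with ∈-++⁻ (nfTerms (replN x t Φ)) m
... | inj₁ m' = Sum.map₂ (λ { (a , h) → ∈-++⁺ˡ a , h }) (replN-terms x t Φ s m')
... | inj₂ m' = Sum.map₂ (λ { (a , h) → ∈-++⁺ʳ (nfTerms Φ) a , h }) (replN-terms x t Ψ s m')

++-mono-∈ : ∀ {A : Set} (xs ys xs' ys' : List A) {a} → (a ∈ xs → a ∈ xs') → (a ∈ ys → a ∈ ys') → a ∈ xs ++ ys → a ∈ xs' ++ ys'
++-mono-∈ xs ys xs' ys' f g m with ∈-++⁻ xs m
... | inj₁ m' = ∈-++⁺ˡ (f m')
... | inj₂ m' = ∈-++⁺ʳ xs' (g m')

replN-preds : ∀ x t Φ q → q ∈ nfPreds (replN x t Φ) → q ∈ nfPreds Φ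
replN-preds x t ⊤ⁿ q ()
replN-preds x t ⊥ⁿ q ()
replN-preds x t (atom (nulA r)) q ()
replN-preds x t (atom (unA r s0)) q m = m
replN-preds x t (atom (eqA s0 s1)) q ()
replN-preds x t (atom (cntA n K)) q m = replL-preds x t K q m
replN-preds x t (neg Φ) q m = replN-preds x t Φ q m
replN-preds x t (conj Φ Ψ) q m = ++-mono-∈ (nfPreds (replN x t Φ)) _ (nfPreds Φ) _ (replN-preds x t Φ q) (replN-preds x t Ψ q) m
replN-preds x t (disj Φ Ψ) q m = ++-mono-∈ (nfPreds (replN x t Φ)) _ (nfPreds Φ) _ (replN-preds x t Φ q) (replN-preds x t Ψ q) m

replN-nuls : ∀ x t Φ q → q ∈ nfNuls (replN x t Φ) → q ∈ nfNuls Φ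
replN-nuls x t ⊤ⁿ q ()
replN-nuls x t ⊥ⁿ q ()
replN-nuls x t (atom (nulA r)) q m = m
replN-nuls x t (atom (unA r s0)) q ()
replN-nuls x t (atom (eqA s0 s1)) q ()
replN-nuls x t (atom (cntA n K)) q ()
replN-nuls x t (neg Φ) q m = replN-nuls x t Φ q m
replN-nuls x t (conj Φ Ψ) q m = ++-mono-∈ (nfNuls (replN x t Φ)) _ (nfNuls Φ) _ (replN-nuls x t Φ q) (replN-nuls x t Ψ q) m
replN-nuls x t (disj Φ Ψ) q m = ++-mono-∈ (nfNuls (replN x t Φ)) _ (nfNuls Φ) _ (replN-nuls x t Φ q) (replN-nuls x t Ψ q) m

instCount-terms : ∀ n K' v bs s → s ∈ nfTerms (instCount n K' v bs) → s ∈ cellTerms K'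
instCount-terms n K' v [] s m = m
instCount-terms n K' v (b ∷ bs) s m with or (b ∷ bs)
... | true = ⊥-elim (constNF-terms ((n ≡ᵇ 0) ∧ (v ∧ and (b ∷ bs))) s m)
... | false with v
...   | true = m
...   | false = m

instCount-preds : ∀ n K' v bs s → s ∈ nfPreds (instCount n K' v bs) → s ∈ cellPreds K'
instCount-preds n K' v [] s m = m
instCount-preds n K' v (b ∷ bs) s m with or (b ∷ bs)
... | true = ⊥-elim (constNF-preds ((n ≡ᵇ 0) ∧ (v ∧ and (b ∷ bs))) s m)
... | false with v
...   | true = m
...   | false = m

instCount-nuls : ∀ n K' v bs s → s ∈ nfNuls (instCount n K' v bs) → ⊥
instCount-nuls n K' v [] s ()
instCount-nuls n K' v (b ∷ bs) s m with or (b ∷ bs)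
... | true = constNF-nuls ((n ≡ᵇ 0) ∧ (v ∧ and (b ∷ bs))) s m
... | false with v
instCount-nuls n K' v (b ∷ bs) s () | false | true
instCount-nuls n K' v (b ∷ bs) s () | false | false

instNF-terms : ∀ x L Φ s → s ∈ nfTerms (instNF x L Φ) → s ∈ nfTerms Φ × isVar x s ≡ false
instNF-terms x L ⊤ⁿ s ()
instNF-terms x L ⊥ⁿ s ()
instNF-terms x L (atom (nulA q)) s ()
instNF-terms x L (atom (unA q s0)) s m with isVar x s0 in h
... | true = ⊥-elim (constNF-terms (lookupColour L q) s m)
instNF-terms x L (atom (unA q s0)) s (here refl) | false = here refl , h
instNF-terms x L (atom (eqA s0 s1)) s m with isVar x s0 in h | isVar x s1 in h'
... | true | b = ⊥-elim (constNF-terms b s m)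
... | false | true = ⊥-elim (constNF-terms false s m)
instNF-terms x L (atom (eqA s0 s1)) s (here refl) | false | false = here refl , h
instNF-terms x L (atom (eqA s0 s1)) s (there (here refl)) | false | false = there (here refl) , h'
instNF-terms x L (atom (cntA n K)) s m = dropVarLits-terms x K s (instCount-terms n (dropVarLits x K) (evalCell x L (dropVarLits x K)) (varLits x K) s m)
instNF-terms x L (neg Φ) s m = instNF-terms x L Φ s m
instNF-terms x L (conj Φ Ψ) s m with ∈-++⁻ (nfTerms (instNF x L Φ)) m
... | inj₁ m' = let (a , h) = instNF-terms x L Φ s m' in ∈-++⁺ˡ a , h
... | inj₂ m' = let (a , h) = instNF-terms x L Ψ s m' in ∈-++⁺ʳ (nfTerms Φ) a , h
instNF-terms x L (disj Φ Ψ) s m with ∈-++⁻ (nfTerms (instNF x L Φ)) m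
... | inj₁ m' = let (a , h) = instNF-terms x L Φ s m' in ∈-++⁺ˡ a , h
... | inj₂ m' = let (a , h) = instNF-terms x L Ψ s m' in ∈-++⁺ʳ (nfTerms Φ) a , h

instNF-preds : ∀ x L Φ q → q ∈ nfPreds (instNF x L Φ) → q ∈ nfPreds Φ
instNF-preds x L ⊤ⁿ q ()
instNF-preds x L ⊥ⁿ q ()
instNF-preds x L (atom (nulA r)) q ()
instNF-preds x L (atom (unA r s0)) q m with isVar x s0
... | true = ⊥-elim (constNF-preds (lookupColour L r) q m)
... | false = m
instNF-preds x L (atom (eqA s0 s1)) q m with isVar x s0 | isVar x s1
... | true | b = ⊥-elim (constNF-preds b q m)
... | false | true = ⊥-elim (constNF-preds false q m)
instNF-preds x L (atom (eqA s0 s1)) q () | false | false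
instNF-preds x L (atom (cntA n K)) q m = dropVarLits-preds x K q (instCount-preds n (dropVarLits x K) (evalCell x L (dropVarLits x K)) (varLits x K) q m)
instNF-preds x L (neg Φ) q m = instNF-preds x L Φ q m
instNF-preds x L (conj Φ Ψ) q m = ++-mono-∈ (nfPreds (instNF x L Φ)) _ (nfPreds Φ) _ (instNF-preds x L Φ q) (instNF-preds x L Ψ q) m
instNF-preds x L (disj Φ Ψ) q m = ++-mono-∈ (nfPreds (instNF x L Φ)) _ (nfPreds Φ) _ (instNF-preds x L Φ q) (instNF-preds x L Ψ q) m

instNF-nuls : ∀ x L Φ q → q ∈ nfNuls (instNF x L Φ) → q ∈ nfNuls Φ
instNF-nuls x L ⊤ⁿ q ()
instNF-nuls x L ⊥ⁿ q ()
instNF-nuls x L (atom (nulA r)) q m = m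
instNF-nuls x L (atom (unA r s0)) q m with isVar x s0
... | true = ⊥-elim (constNF-nuls (lookupColour L r) q m)
instNF-nuls x L (atom (unA r s0)) q () | false
instNF-nuls x L (atom (eqA s0 s1)) q m with isVar x s0 | isVar x s1
... | true | b = ⊥-elim (constNF-nuls b q m)
... | false | true = ⊥-elim (constNF-nuls false q m)
instNF-nuls x L (atom (eqA s0 s1)) q () | false | false
instNF-nuls x L (atom (cntA n K)) q m = ⊥-elim (instCount-nuls n (dropVarLits x K) (evalCell x L (dropVarLits x K)) (varLits x K) q m)
instNF-nuls x L (neg Φ) q m = instNF-nuls x L Φ q m
instNF-nuls x L (conj Φ Ψ) q m = ++-mono-∈ (nfNuls (instNF x L Φ)) _ (nfNuls Φ) _ (instNF-nuls x L Φ q) (instNF-nuls x L Ψ q) m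
instNF-nuls x L (disj Φ Ψ) q m = ++-mono-∈ (nfNuls (instNF x L Φ)) _ (nfNuls Φ) _ (instNF-nuls x L Φ q) (instNF-nuls x L Ψ q) m

cellOf-terms : ∀ L Ts s → s ∈ cellTerms (cellOf L Ts) → s ∈ Ts
cellOf-terms ((q , b) ∷ L) Ts s m = cellOf-terms L Ts s m
cellOf-terms [] (t ∷ Ts) s (here e) = here e
cellOf-terms [] (t ∷ Ts) s (there m) = there (cellOf-terms [] Ts s m)

cellOf-preds : ∀ L Ts q → q ∈ cellPreds (cellOf L Ts) → q ∈ map proj₁ L
cellOf-preds ((r , b) ∷ L) Ts q (here e) = here e
cellOf-preds ((r , b) ∷ L) Ts q (there m) = there (cellOf-preds L Ts q m)
cellOf-preds [] (t ∷ Ts) q m = cellOf-preds [] Ts q m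

splitColours-terms : ∀ x Ts L Qs Φ s → s ∈ nfTerms (splitColours x Ts L Qs Φ) → s ∈ Ts ⊎ (s ∈ nfTerms Φ × isVar x s ≡ false)
splitColours-terms x Ts L [] Φ s m with ∈-++⁻ (cellTerms (cellOf L Ts)) m
... | inj₁ m' = inj₁ (cellOf-terms L Ts s m')
... | inj₂ m' = inj₂ (instNF-terms x L Φ s m')
splitColours-terms x Ts L (q ∷ Qs) Φ s m with ∈-++⁻ (nfTerms (splitColours x Ts ((q , true) ∷ L) Qs Φ)) m
... | inj₁ m' = splitColours-terms x Ts ((q , true) ∷ L) Qs Φ s m'
... | inj₂ m' = splitColours-terms x Ts ((q , false) ∷ L) Qs Φ s m'

splitColours-preds : ∀ x Ts L Qs Φ → (∀ r → r ∈ map proj₁ L → r ∈ nfPreds Φ) → (∀ r → r ∈ Qs → r ∈ nfPreds Φ) →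
       ∀ q → q ∈ nfPreds (splitColours x Ts L Qs Φ) → q ∈ nfPreds Φ
splitColours-preds x Ts L [] Φ hL hQ q m with ∈-++⁻ (cellPreds (cellOf L Ts)) m
... | inj₁ m' = hL q (cellOf-preds L Ts q m')
... | inj₂ m' = instNF-preds x L Φ q m'
splitColours-preds x Ts L (r ∷ Qs) Φ hL hQ q m with ∈-++⁻ (nfPreds (splitColours x Ts ((r , true) ∷ L) Qs Φ)) m
... | inj₁ m' = splitColours-preds x Ts ((r , true) ∷ L) Qs Φ (λ { r' (here e) → hQ r' (here e) ; r' (there w) → hL r' w }) (λ r' w → hQ r' (there w)) q m'
... | inj₂ m' = splitColours-preds x Ts ((r , false) ∷ L) Qs Φ (λ { r' (here e) → hQ r' (here e) ; r' (there w) → hL r' w }) (λ r' w → hQ r' (there w)) q m'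

splitColours-nuls : ∀ x Ts L Qs Φ q → q ∈ nfNuls (splitColours x Ts L Qs Φ) → q ∈ nfNuls Φ
splitColours-nuls x Ts L [] Φ q m = instNF-nuls x L Φ q m
splitColours-nuls x Ts L (r ∷ Qs) Φ q m with ∈-++⁻ (nfNuls (splitColours x Ts ((r , true) ∷ L) Qs Φ)) m
... | inj₁ m' = splitColours-nuls x Ts ((r , true) ∷ L) Qs Φ q m'
... | inj₂ m' = splitColours-nuls x Ts ((r , false) ∷ L) Qs Φ q m'

⋁ⁿ-∈ : ∀ {A : Set} (g : NF → List A) → (∀ Φ Ψ → g (disj Φ Ψ) ≡ g Φ ++ g Ψ) → (g ⊥ⁿ ≡ []) →
          ∀ (f : Term → NF) ts a → a ∈ g (⋁ⁿ (map f ts)) → Any (λ t → a ∈ g (f t)) ts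
⋁ⁿ-∈ g hd hb f [] a m rewrite hb with m
... | ()
⋁ⁿ-∈ g hd hb f (t ∷ ts) a m rewrite hd (f t) (⋁ⁿ (map f ts)) with ∈-++⁻ (g (f t)) m
... | inj₁ m' = here m'
... | inj₂ m' = there (⋁ⁿ-∈ g hd hb f ts a m')

existsNF-terms : ∀ x Φ s → s ∈ nfTerms (existsNF x Φ) → s ∈ nfTerms Φ × isVar x s ≡ false
existsNF-terms x Φ s m with ∈-++⁻ (nfTerms (⋁ⁿ (map (λ t → replN x t Φ) (dropVar x (nfTerms Φ))))) m
... | inj₁ m' with find (⋁ⁿ-∈ nfTerms (λ _ _ → refl) refl (λ t → replN x t Φ) (dropVar x (nfTerms Φ)) s m')
...   | t , tin , sm with replN-terms x t Φ s sm
...     | inj₁ refl = dropVar⁻ x (nfTerms Φ) s tin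
...     | inj₂ r = r
existsNF-terms x Φ s m | inj₂ m' with splitColours-terms x (dropVar x (nfTerms Φ)) [] (nfPreds Φ) Φ s m'
...   | inj₁ m'' = dropVar⁻ x (nfTerms Φ) s m''
...   | inj₂ r = r

existsNF-preds : ∀ x Φ q → q ∈ nfPreds (existsNF x Φ) → q ∈ nfPreds Φ
existsNF-preds x Φ q m with ∈-++⁻ (nfPreds (⋁ⁿ (map (λ t → replN x t Φ) (dropVar x (nfTerms Φ))))) m
... | inj₁ m' with find (⋁ⁿ-∈ nfPreds (λ _ _ → refl) refl (λ t → replN x t Φ) (dropVar x (nfTerms Φ)) q m')
...   | t , tin , sm = replN-preds x t Φ q sm
existsNF-preds x Φ q m | inj₂ m' = splitColours-preds x (dropVar x (nfTerms Φ)) [] (nfPreds Φ) Φ (λ r ()) (λ r w → w) q m'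

existsNF-nuls : ∀ x Φ q → q ∈ nfNuls (existsNF x Φ) → q ∈ nfNuls Φ
existsNF-nuls x Φ q m with ∈-++⁻ (nfNuls (⋁ⁿ (map (λ t → replN x t Φ) (dropVar x (nfTerms Φ))))) m
... | inj₁ m' with find (⋁ⁿ-∈ nfNuls (λ _ _ → refl) refl (λ t → replN x t Φ) (dropVar x (nfTerms Φ)) q m')
...   | t , tin , sm = replN-nuls x t Φ q sm
existsNF-nuls x Φ q m | inj₂ m' = splitColours-nuls x (dropVar x (nfTerms Φ)) [] (nfPreds Φ) Φ q m'

¬isVar-OccT : ∀ x v s → isVar x s ≡ false → OccT v s → v ≢ x
¬isVar-OccT x v (var y) h refl = ≡ᵇ-false⇒≢ {v} {x} h
¬isVar-OccT x v (con c) h ()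

toNF-terms : ∀ F s → s ∈ nfTerms (toNF F) → (∀ v → OccT v s → FreeV v F) × (∀ c → ConT c s → OccC c F)
toNF-terms ⊤ᶠ s ()
toNF-terms ⊥ᶠ s ()
toNF-terms (nul q) s ()
toNF-terms (app q t) s (here refl) = (λ v o → o) , (λ c o → o)
toNF-terms (eqᶠ t t') s (here refl) = (λ v o → inj₁ o) , (λ c o → inj₁ o)
toNF-terms (eqᶠ t t') s (there (here refl)) = (λ v o → inj₂ o) , (λ c o → inj₂ o)
toNF-terms (¬ᶠ G) s m = toNF-terms G s m
toNF-terms (G ∧ᶠ H) s m with ∈-++⁻ (nfTerms (toNF G)) m
... | inj₁ m' = let (a , b) = toNF-terms G s m' in (λ v o → inj₁ (a v o)) , (λ c o → inj₁ (b c o))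
... | inj₂ m' = let (a , b) = toNF-terms H s m' in (λ v o → inj₂ (a v o)) , (λ c o → inj₂ (b c o))
toNF-terms (G ∨ᶠ H) s m with ∈-++⁻ (nfTerms (toNF G)) m
... | inj₁ m' = let (a , b) = toNF-terms G s m' in (λ v o → inj₁ (a v o)) , (λ c o → inj₁ (b c o))
... | inj₂ m' = let (a , b) = toNF-terms H s m' in (λ v o → inj₂ (a v o)) , (λ c o → inj₂ (b c o))
toNF-terms (∀ᶠ x G) s m with existsNF-terms x (neg (toNF G)) s m
... | m' , h = let (a , b) = toNF-terms G s m' in (λ v o → ¬isVar-OccT x v s h o , a v o) , (λ c o → b c o)
toNF-terms (∃ᶠ x G) s m with existsNF-terms x (toNF G) s m
... | m' , h = let (a , b) = toNF-terms G s m' in (λ v o → ¬isVar-OccT x v s h o , a v o) , (λ c o → b c o)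
toNF-terms (∀₀ q G) s ()
toNF-terms (∃₀ q G) s ()
toNF-terms (∀₁ q G) s ()
toNF-terms (∃₁ q G) s ()

toNF-preds : ∀ F q → q ∈ nfPreds (toNF F) → OccU q F
toNF-preds ⊤ᶠ q ()
toNF-preds ⊥ᶠ q ()
toNF-preds (nul r) q ()
toNF-preds (app r t) q (here e) = e
toNF-preds (eqᶠ t t') q ()
toNF-preds (¬ᶠ G) q m = toNF-preds G q m
toNF-preds (G ∧ᶠ H) q m = Sum.map (toNF-preds G q) (toNF-preds H q) (∈-++⁻ (nfPreds (toNF G)) m)
toNF-preds (G ∨ᶠ H) q m = Sum.map (toNF-preds G q) (toNF-preds H q) (∈-++⁻ (nfPreds (toNF G)) m)
toNF-preds (∀ᶠ x G) q m = toNF-preds G q (existsNF-preds x (neg (toNF G)) q m)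
toNF-preds (∃ᶠ x G) q m = toNF-preds G q (existsNF-preds x (toNF G) q m)
toNF-preds (∀₀ r G) q ()
toNF-preds (∃₀ r G) q ()
toNF-preds (∀₁ r G) q ()
toNF-preds (∃₁ r G) q ()

toNF-nuls : ∀ F q → q ∈ nfNuls (toNF F) → OccN q F
toNF-nuls ⊤ᶠ q ()
toNF-nuls ⊥ᶠ q ()
toNF-nuls (nul r) q (here e) = e
toNF-nuls (app r t) q ()
toNF-nuls (eqᶠ t t') q ()
toNF-nuls (¬ᶠ G) q m = toNF-nuls G q m
toNF-nuls (G ∧ᶠ H) q m = Sum.map (toNF-nuls G q) (toNF-nuls H q) (∈-++⁻ (nfNuls (toNF G)) m)
toNF-nuls (G ∨ᶠ H) q m = Sum.map (toNF-nuls G q) (toNF-nuls H q) (∈-++⁻ (nfNuls (toNF G)) m)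
toNF-nuls (∀ᶠ x G) q m = toNF-nuls G q (existsNF-nuls x (neg (toNF G)) q m)
toNF-nuls (∃ᶠ x G) q m = toNF-nuls G q (existsNF-nuls x (toNF G) q m)
toNF-nuls (∀₀ r G) q ()
toNF-nuls (∃₀ r G) q ()
toNF-nuls (∀₁ r G) q ()
toNF-nuls (∃₁ r G) q ()

InTerms : (Term → Set) → List Term → Set
InTerms P ts = Σ Term (λ t → t ∈ ts × P t)

InTerms-mono : ∀ {P xs ys} → (∀ {t} → t ∈ xs → t ∈ ys) → InTerms P xs → InTerms P ys
InTerms-mono f (t , m , p) = t , f m , p

FreeV-litFm : ∀ m v l → FreeV v (litFm m l) → v ≢ m → InTerms (OccT v) (cellTerms (l ∷ []))
FreeV-litFm m v (predL q true) refl n = ⊥-elim (n refl)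
FreeV-litFm m v (predL q false) refl n = ⊥-elim (n refl)
FreeV-litFm m v (eqL t true) (inj₁ refl) n = ⊥-elim (n refl)
FreeV-litFm m v (eqL t true) (inj₂ o) n = t , here refl , o
FreeV-litFm m v (eqL t false) (inj₁ refl) n = ⊥-elim (n refl)
FreeV-litFm m v (eqL t false) (inj₂ o) n = t , here refl , o

cellTerms-head : ∀ l K {t} → t ∈ cellTerms (l ∷ []) → t ∈ cellTerms (l ∷ K)
cellTerms-head (eqL s b) K (here e) = here e
cellTerms-head (predL q b) K ()

cellTerms-tail : ∀ l K {t} → t ∈ cellTerms K → t ∈ cellTerms (l ∷ K)
cellTerms-tail (eqL s b) K m = there m
cellTerms-tail (predL q b) K m = m

FreeV-cellFm : ∀ m v K → FreeV v (cellFm m K) → v ≢ m → InTerms (OccT v) (cellTerms K)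
FreeV-cellFm m v K o n = h K (FreeV-⋀ v (map (litFm m) K) o)
  where
  h : ∀ K → Any (FreeV v) (map (litFm m) K) → InTerms (OccT v) (cellTerms K)
  h (l ∷ K) (here o) = InTerms-mono (cellTerms-head l K) (FreeV-litFm m v l o n)
  h (l ∷ K) (there a) = InTerms-mono (cellTerms-tail l K) (h K a)

OccC-litFm : ∀ m c l → OccC c (litFm m l) → InTerms (ConT c) (cellTerms (l ∷ []))
OccC-litFm m c (predL q true) ()
OccC-litFm m c (predL q false) ()
OccC-litFm m c (eqL t true) (inj₁ ())
OccC-litFm m c (eqL t true) (inj₂ o) = t , here refl , o
OccC-litFm m c (eqL t false) (inj₁ ())
OccC-litFm m c (eqL t false) (inj₂ o) = t , here refl , o

OccC-cellFm : ∀ m c K → OccC c (cellFm m K) → InTerms (ConT c) (cellTerms K)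
OccC-cellFm m c K o = h K (OccSym-⋀ const c (map (litFm m) K) o)
  where
  h : ∀ K → Any (OccC c) (map (litFm m) K) → InTerms (ConT c) (cellTerms K)
  h (l ∷ K) (here o) = InTerms-mono (cellTerms-head l K) (OccC-litFm m c l o)
  h (l ∷ K) (there a) = InTerms-mono (cellTerms-tail l K) (h K a)

OccN-litFm : ∀ m q l → OccN q (litFm m l) → ⊥
OccN-litFm m q (predL r true) ()
OccN-litFm m q (predL r false) ()
OccN-litFm m q (eqL t true) ()
OccN-litFm m q (eqL t false) ()

OccN-cellFm : ∀ m q K → OccN q (cellFm m K) → ⊥
OccN-cellFm m q K o = h K (OccSym-⋀ nullary q (map (litFm m) K) o)
  where
  h : ∀ K → Any (OccN q) (map (litFm m) K) → ⊥
  h (l ∷ K) (here o) = OccN-litFm m q l o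
  h (l ∷ K) (there a) = h K a

OccU-litFm : ∀ m q l → OccU q (litFm m l) → q ∈ cellPreds (l ∷ [])
OccU-litFm m q (predL r true) e = here e
OccU-litFm m q (predL r false) e = here e
OccU-litFm m q (eqL t true) ()
OccU-litFm m q (eqL t false) ()

OccU-cellFm : ∀ m q K → OccU q (cellFm m K) → q ∈ cellPreds K
OccU-cellFm m q K o = h K (OccSym-⋀ unary q (map (litFm m) K) o)
  where
  h : ∀ K → Any (OccU q) (map (litFm m) K) → q ∈ cellPreds K
  h (predL r b ∷ K) (here o) with OccU-litFm m q (predL r b) o
  ... | here e = here e
  h (eqL t b ∷ K) (here o) with OccU-litFm m q (eqL t b) o
  ... | ()
  h (predL r b ∷ K) (there a) = there (h K a)
  h (eqL t b ∷ K) (there a) = h K a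

FreeV-nfFm : ∀ m v Ψ → FreeV v (nfFm m Ψ) → InTerms (OccT v) (nfTerms Ψ)
FreeV-nfFm m v ⊤ⁿ ()
FreeV-nfFm m v ⊥ⁿ ()
FreeV-nfFm m v (atom (nulA q)) ()
FreeV-nfFm m v (atom (unA q t)) o = t , here refl , o
FreeV-nfFm m v (atom (eqA t s)) (inj₁ o) = t , here refl , o
FreeV-nfFm m v (atom (eqA t s)) (inj₂ o) = s , there (here refl) , o
FreeV-nfFm m v (atom (cntA n K)) o = let (a , b) = FreeV-distinctWitnesses v m (cellFm m K) (freshVars (suc m) (suc n)) o in FreeV-cellFm m v K a b
FreeV-nfFm m v (neg Ψ) o = FreeV-nfFm m v Ψ o
FreeV-nfFm m v (conj Φ Ψ) (inj₁ o) = InTerms-mono ∈-++⁺ˡ (FreeV-nfFm m v Φ o)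
FreeV-nfFm m v (conj Φ Ψ) (inj₂ o) = InTerms-mono (∈-++⁺ʳ (nfTerms Φ)) (FreeV-nfFm m v Ψ o)
FreeV-nfFm m v (disj Φ Ψ) (inj₁ o) = InTerms-mono ∈-++⁺ˡ (FreeV-nfFm m v Φ o)
FreeV-nfFm m v (disj Φ Ψ) (inj₂ o) = InTerms-mono (∈-++⁺ʳ (nfTerms Φ)) (FreeV-nfFm m v Ψ o)

OccC-nfFm : ∀ m c Ψ → OccC c (nfFm m Ψ) → InTerms (ConT c) (nfTerms Ψ)
OccC-nfFm m c ⊤ⁿ ()
OccC-nfFm m c ⊥ⁿ ()
OccC-nfFm m c (atom (nulA q)) ()
OccC-nfFm m c (atom (unA q t)) o = t , here refl , o
OccC-nfFm m c (atom (eqA t s)) (inj₁ o) = t , here refl , o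
OccC-nfFm m c (atom (eqA t s)) (inj₂ o) = s , there (here refl) , o
OccC-nfFm m c (atom (cntA n K)) o = OccC-cellFm m c K (OccSym-distinctWitnesses const c m (cellFm m K) (freshVars (suc m) (suc n)) o)
OccC-nfFm m c (neg Ψ) o = OccC-nfFm m c Ψ o
OccC-nfFm m c (conj Φ Ψ) (inj₁ o) = InTerms-mono ∈-++⁺ˡ (OccC-nfFm m c Φ o)
OccC-nfFm m c (conj Φ Ψ) (inj₂ o) = InTerms-mono (∈-++⁺ʳ (nfTerms Φ)) (OccC-nfFm m c Ψ o)
OccC-nfFm m c (disj Φ Ψ) (inj₁ o) = InTerms-mono ∈-++⁺ˡ (OccC-nfFm m c Φ o)
OccC-nfFm m c (disj Φ Ψ) (inj₂ o) = InTerms-mono (∈-++⁺ʳ (nfTerms Φ)) (OccC-nfFm m c Ψ o)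

OccN-nfFm : ∀ m q Ψ → OccN q (nfFm m Ψ) → q ∈ nfNuls Ψ
OccN-nfFm m q ⊤ⁿ ()
OccN-nfFm m q ⊥ⁿ ()
OccN-nfFm m q (atom (nulA r)) e = here e
OccN-nfFm m q (atom (unA r t)) ()
OccN-nfFm m q (atom (eqA t s)) ()
OccN-nfFm m q (atom (cntA n K)) o = ⊥-elim (OccN-cellFm m q K (OccSym-distinctWitnesses nullary q m (cellFm m K) (freshVars (suc m) (suc n)) o))
OccN-nfFm m q (neg Ψ) o = OccN-nfFm m q Ψ o
OccN-nfFm m q (conj Φ Ψ) (inj₁ o) = ∈-++⁺ˡ (OccN-nfFm m q Φ o)
OccN-nfFm m q (conj Φ Ψ) (inj₂ o) = ∈-++⁺ʳ (nfNuls Φ) (OccN-nfFm m q Ψ o)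
OccN-nfFm m q (disj Φ Ψ) (inj₁ o) = ∈-++⁺ˡ (OccN-nfFm m q Φ o)
OccN-nfFm m q (disj Φ Ψ) (inj₂ o) = ∈-++⁺ʳ (nfNuls Φ) (OccN-nfFm m q Ψ o)

OccU-nfFm : ∀ m q Ψ → OccU q (nfFm m Ψ) → q ∈ nfPreds Ψ
OccU-nfFm m q ⊤ⁿ ()
OccU-nfFm m q ⊥ⁿ ()
OccU-nfFm m q (atom (nulA r)) ()
OccU-nfFm m q (atom (unA r t)) e = here e
OccU-nfFm m q (atom (eqA t s)) ()
OccU-nfFm m q (atom (cntA n K)) o = OccU-cellFm m q K (OccSym-distinctWitnesses unary q m (cellFm m K) (freshVars (suc m) (suc n)) o)
OccU-nfFm m q (neg Ψ) o = OccU-nfFm m q Ψ o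
OccU-nfFm m q (conj Φ Ψ) (inj₁ o) = ∈-++⁺ˡ (OccU-nfFm m q Φ o)
OccU-nfFm m q (conj Φ Ψ) (inj₂ o) = ∈-++⁺ʳ (nfPreds Φ) (OccU-nfFm m q Ψ o)
OccU-nfFm m q (disj Φ Ψ) (inj₁ o) = ∈-++⁺ˡ (OccU-nfFm m q Φ o)
OccU-nfFm m q (disj Φ Ψ) (inj₂ o) = ∈-++⁺ʳ (nfPreds Φ) (OccU-nfFm m q Ψ o)

unmentioned-cellPreds : ∀ p K q → nonEmpty (predSigns p K) ≡ false → q ∈ cellPreds K → q ≢ p
unmentioned-cellPreds p (predL r b ∷ K) q h m with r ≡ᵇ p in e
unmentioned-cellPreds p (predL r b ∷ K) q () m | true
unmentioned-cellPreds p (predL r b ∷ K) q h (here refl) | false = ≡ᵇ-false⇒≢ {q} {p} e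
unmentioned-cellPreds p (predL r b ∷ K) q h (there m) | false = unmentioned-cellPreds p K q h m
unmentioned-cellPreds p (eqL t b ∷ K) q h m = unmentioned-cellPreds p K q h m

assume-terms : ∀ p L Φ s → s ∈ nfTerms (assume p L Φ) → s ∈ nfTerms Φ
assume-terms p L ⊤ⁿ s ()
assume-terms p L ⊥ⁿ s ()
assume-terms p L (atom A) s m with mentions p A
... | true = ⊥-elim (constNF-terms (lookupAtom L A) s m)
... | false = m
assume-terms p L (neg Φ) s m = assume-terms p L Φ s m
assume-terms p L (conj Φ Ψ) s m = ++-mono-∈ (nfTerms (assume p L Φ)) _ (nfTerms Φ) _ (assume-terms p L Φ s) (assume-terms p L Ψ s) m
assume-terms p L (disj Φ Ψ) s m = ++-mono-∈ (nfTerms (assume p L Φ)) _ (nfTerms Φ) _ (assume-terms p L Φ s) (assume-terms p L Ψ s) m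

assume-preds : ∀ p L Φ q → q ∈ nfPreds (assume p L Φ) → q ∈ nfPreds Φ × q ≢ p
assume-preds p L ⊤ⁿ q ()
assume-preds p L ⊥ⁿ q ()
assume-preds p L (atom A) q m with mentions p A in h
... | true = ⊥-elim (constNF-preds (lookupAtom L A) q m)
assume-preds p L (atom (unA r t)) q (here refl) | false = here refl , ≡ᵇ-false⇒≢ {q} {p} h
assume-preds p L (atom (cntA n K)) q m | false = m , unmentioned-cellPreds p K q h m
assume-preds p L (atom (nulA r)) q () | false
assume-preds p L (atom (eqA t s)) q () | false
assume-preds p L (neg Φ) q m = assume-preds p L Φ q m
assume-preds p L (conj Φ Ψ) q m with ∈-++⁻ (nfPreds (assume p L Φ)) m
... | inj₁ m' = let (a , b) = assume-preds p L Φ q m' in ∈-++⁺ˡ a , b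
... | inj₂ m' = let (a , b) = assume-preds p L Ψ q m' in ∈-++⁺ʳ (nfPreds Φ) a , b
assume-preds p L (disj Φ Ψ) q m with ∈-++⁻ (nfPreds (assume p L Φ)) m
... | inj₁ m' = let (a , b) = assume-preds p L Φ q m' in ∈-++⁺ˡ a , b
... | inj₂ m' = let (a , b) = assume-preds p L Ψ q m' in ∈-++⁺ʳ (nfPreds Φ) a , b

assume-nuls : ∀ p L Φ q → q ∈ nfNuls (assume p L Φ) → q ∈ nfNuls Φ
assume-nuls p L ⊤ⁿ q ()
assume-nuls p L ⊥ⁿ q ()
assume-nuls p L (atom A) q m with mentions p A
... | true = ⊥-elim (constNF-nuls (lookupAtom L A) q m)
... | false = m
assume-nuls p L (neg Φ) q m = assume-nuls p L Φ q m
assume-nuls p L (conj Φ Ψ) q m = ++-mono-∈ (nfNuls (assume p L Φ)) _ (nfNuls Φ) _ (assume-nuls p L Φ q) (assume-nuls p L Ψ q) m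
assume-nuls p L (disj Φ Ψ) q m = ++-mono-∈ (nfNuls (assume p L Φ)) _ (nfNuls Φ) _ (assume-nuls p L Φ q) (assume-nuls p L Ψ q) m

record SymbolsOf (m : ℕ) (A : At) (G : Fm) : Set where
  field
    free⊆  : ∀ v → FreeV v G → v ≢ m → InTerms (OccT v) (atomTerms A)
    const⊆ : ∀ c → OccC c G → InTerms (ConT c) (atomTerms A)
    no-nul : ∀ q → ¬ OccN q G
    unary⊆ : ∀ q → OccU q G → q ∈ atomPreds A
open SymbolsOf

SpecSymbols : ℕ → At → Spec → Set
SpecSymbols m A (n , x , G) = x ≡ m × SymbolsOf m A G

dropPred-terms : ∀ p K {t} → t ∈ cellTerms (dropPred p K) → t ∈ cellTerms K
dropPred-terms p (predL q b ∷ K) m with q ≡ᵇ p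
... | true = dropPred-terms p K m
... | false = dropPred-terms p K m
dropPred-terms p (eqL t b ∷ K) (here e) = here e
dropPred-terms p (eqL t b ∷ K) (there m) = there (dropPred-terms p K m)

dropPred-preds : ∀ p K {q} → q ∈ cellPreds (dropPred p K) → q ∈ cellPreds K
dropPred-preds p (predL r b ∷ K) m with r ≡ᵇ p
... | true = there (dropPred-preds p K m)
dropPred-preds p (predL r b ∷ K) (here e) | false = here e
dropPred-preds p (predL r b ∷ K) (there m) | false = there (dropPred-preds p K m)
dropPred-preds p (eqL t b ∷ K) m = dropPred-preds p K m

cellFm-SymbolsOf : ∀ m p n K → SymbolsOf m (cntA n K) (cellFm m (dropPred p K))
cellFm-SymbolsOf m p n K = record
  { free⊆ = λ v o ne → InTerms-mono (dropPred-terms p K) (FreeV-cellFm m v (dropPred p K) o ne)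
  ; const⊆ = λ c o → InTerms-mono (dropPred-terms p K) (OccC-cellFm m c (dropPred p K) o)
  ; no-nul = λ q o → OccN-cellFm m q (dropPred p K) o
  ; unary⊆ = λ q o → dropPred-preds p K (OccU-cellFm m q (dropPred p K) o) }

cellOrFalse-SymbolsOf : ∀ m p n K a → SymbolsOf m (cntA n K) (cellOrFalse m a (dropPred p K))
cellOrFalse-SymbolsOf m p n K true = cellFm-SymbolsOf m p n K
cellOrFalse-SymbolsOf m p n K false = record { free⊆ = λ v () ; const⊆ = λ c () ; no-nul = λ q () ; unary⊆ = λ q () }

SymbolsOf-¬ : ∀ {m A G} → SymbolsOf m A G → SymbolsOf m A (¬ᶠ G)
SymbolsOf-¬ syms = record { free⊆ = free⊆ syms ; const⊆ = const⊆ syms ; no-nul = no-nul syms ; unary⊆ = unary⊆ syms }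

=var-SymbolsOf : ∀ m q t → SymbolsOf m (unA q t) (eqᶠ (var m) t)
=var-SymbolsOf m q t = record
  { free⊆ = λ { v (inj₁ refl) ne → ⊥-elim (ne refl) ; v (inj₂ o) ne → t , here refl , o }
  ; const⊆ = λ { c (inj₂ o) → t , here refl , o }
  ; no-nul = λ q ()
  ; unary⊆ = λ q () }

AllLists⁴ : (Spec → Set) → Specs⁴ → Set
AllLists⁴ Q S = All Q (proj₁ S) × All Q (proj₁ (proj₂ S)) × All Q (proj₁ (proj₂ (proj₂ S))) × All Q (proj₂ (proj₂ (proj₂ S)))

literalSpecs-symbols : ∀ p m l → AllLists⁴ (SpecSymbols m (proj₁ l)) (literalSpecs p m l)
literalSpecs-symbols p m (nulA q , b) = [] , [] , [] , []
literalSpecs-symbols p m (eqA t s , b) = [] , [] , [] , []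
literalSpecs-symbols p m (unA q t , true) = [] , [] , (refl , =var-SymbolsOf m q t) ∷ [] , []
literalSpecs-symbols p m (unA q t , false) = [] , [] , [] , (refl , =var-SymbolsOf m q t) ∷ []
literalSpecs-symbols p m (cntA n K , b) with or (predSigns p K) | and (predSigns p K) | b
... | true | a | true = [] , [] , (refl , cellOrFalse-SymbolsOf m p n K a) ∷ [] , []
... | true | a | false = [] , (refl , SymbolsOf-¬ (cellOrFalse-SymbolsOf m p n K a)) ∷ [] , [] , []
... | false | a | true = [] , [] , [] , (refl , cellFm-SymbolsOf m p n K) ∷ []
... | false | a | false = (refl , SymbolsOf-¬ (cellFm-SymbolsOf m p n K)) ∷ [] , [] , [] , []

AllConj⁴ : (Fm → Set) → PName → ℕ → Spec → Set
AllConj⁴ R p m s = R (conjA p m s) × R (conjB p m s) × R (conjC p m s) × R (conjD p m s)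

AllConj⁴-map : ∀ {R R′ : Fm → Set} {p m s} → (∀ {H} → R H → R′ H) → AllConj⁴ R p m s → AllConj⁴ R′ p m s
AllConj⁴-map f (a , b , c , d) = f a , f b , f c , f d

AllSpecs⁴-from : ∀ {Q : Spec → Set} {R : Fm → Set} p m S → (∀ s → Q s → AllConj⁴ R p m s) → AllLists⁴ Q S → AllSpecs⁴ R p m S
AllSpecs⁴-from p m S f (qa , qb , qc , qd) =
  All.map (λ q → proj₁ (f _ q)) qa , All.map (λ q → proj₁ (proj₂ (f _ q))) qb ,
  All.map (λ q → proj₁ (proj₂ (proj₂ (f _ q)))) qc , All.map (λ q → proj₂ (proj₂ (proj₂ (f _ q)))) qd

All-apply-Any : ∀ {A B : Set} {P : A → Set} {xs} → All (λ x → P x → B) xs → Any P xs → B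
All-apply-Any (f ∷ _) (here p) = f p
All-apply-Any (_ ∷ fs) (there a) = All-apply-Any fs a

module _ (p : PName) (m : ℕ) where
  conjuncts-FreeV : ∀ v n x G → AllConj⁴ (λ H → FreeV v H → FreeV v G × v ≢ x) p m (n , x , G)
  conjuncts-FreeV v n x G =
    drop-x ∘ FreeV-distinctWitnesses v x (¬ᶠ (G ∨ᶠ px)) ys , drop-x ∘ FreeV-distinctWitnesses v x (¬ᶠ (G ∨ᶠ (¬ᶠ px))) ys ,
    drop-x ∘ FreeV-distinctWitnesses v x (G ∧ᶠ px) ys , drop-x ∘ FreeV-distinctWitnesses v x (G ∧ᶠ (¬ᶠ px)) ys
    where
    px = app p (var x)
    ys = freshVars (suc m) n
    drop-x : (FreeV v G ⊎ v ≡ x) × v ≢ x → FreeV v G × v ≢ x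
    drop-x (inj₁ o , v≢x) = o , v≢x
    drop-x (inj₂ refl , v≢x) = ⊥-elim (v≢x refl)

  OccSym-app : ∀ k a x → OccSym k a (app p (var x)) → k ≡ unary × a ≡ p
  OccSym-app unary a x a≡p = refl , a≡p

  conjuncts-OccSym : ∀ k a n x G → AllConj⁴ (λ H → OccSym k a H → OccSym k a G ⊎ (k ≡ unary × a ≡ p)) p m (n , x , G)
  conjuncts-OccSym k a n x G =
    (λ o → Sum.map₂ (OccSym-app k a x) (proj₁ (OccSym-∨ k a _ _) (proj₁ (OccSym-¬ k a _) (witnesses (proj₁ (OccSym-¬ k a _) o))))) ,
    (λ o → Sum.map₂ (OccSym-app k a x ∘ proj₁ (OccSym-¬ k a _)) (proj₁ (OccSym-∨ k a _ _) (proj₁ (OccSym-¬ k a _) (witnesses (proj₁ (OccSym-¬ k a _) o))))) ,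
    (λ o → Sum.map₂ (OccSym-app k a x) (proj₁ (OccSym-∧ k a _ _) (witnesses o))) ,
    (λ o → Sum.map₂ (OccSym-app k a x ∘ proj₁ (OccSym-¬ k a _)) (proj₁ (OccSym-∧ k a _ _) (witnesses o)))
    where
    witnesses : ∀ {B} → OccSym k a (distinctWitnesses x B (freshVars (suc m) n)) → OccSym k a B
    witnesses = OccSym-distinctWitnesses k a x _ (freshVars (suc m) n)

BlockFreeV : Var → List (At × Bool) → Set
BlockFreeV v L = Σ (At × Bool) (λ l → l ∈ L × InTerms (OccT v) (atomTerms (proj₁ l)))

FreeV-blockBody : ∀ p m L v → FreeV v (blockBody p m L) → BlockFreeV v L
FreeV-blockBody p m L v o =
  All-apply-Any (proj₂ (All-blockConjuncts p m L) (All.tabulate per-literal)) (FreeV-⋀ v _ o)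
  where
  per-literal : ∀ {l} → l ∈ L → AllSpecs⁴ (λ H → FreeV v H → BlockFreeV v L) p m (literalSpecs p m l)
  per-literal {l} l∈L = AllSpecs⁴-from {R = λ H → FreeV v H → BlockFreeV v L} p m _ via (literalSpecs-symbols p m l)
    where
    via : ∀ s → SpecSymbols m (proj₁ l) s → AllConj⁴ (λ H → FreeV v H → BlockFreeV v L) p m s
    via (n , x , G) (refl , syms) =
      AllConj⁴-map {R = λ H → FreeV v H → FreeV v G × v ≢ x} {p = p} {m = m} {s = n , x , G}
                   (λ f o → let (o′ , v≢m) = f o in l , l∈L , free⊆ syms v o′ v≢m) (conjuncts-FreeV p m v n x G)

AtomSym : Sym → ℕ → At → Set
AtomSym const c A = InTerms (ConT c) (atomTerms A)
AtomSym nullary q A = ⊥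
AtomSym unary q A = q ∈ atomPreds A

OccSym-SymbolsOf : ∀ k a {m A G} → SymbolsOf m A G → OccSym k a G → AtomSym k a A
OccSym-SymbolsOf const a syms o = const⊆ syms a o
OccSym-SymbolsOf nullary a syms o = no-nul syms a o
OccSym-SymbolsOf unary a syms o = unary⊆ syms a o

BlockSym : Sym → ℕ → PName → List (At × Bool) → Set
BlockSym k a p L = (k ≡ unary × a ≡ p) ⊎ Σ (At × Bool) (λ l → l ∈ L × AtomSym k a (proj₁ l))

OccSym-blockBody : ∀ k a p m L → OccSym k a (blockBody p m L) → BlockSym k a p L
OccSym-blockBody k a p m L o =
  All-apply-Any (proj₂ (All-blockConjuncts p m L) (All.tabulate per-literal)) (OccSym-⋀ k a _ o)
  where
  per-literal : ∀ {l} → l ∈ L → AllSpecs⁴ (λ H → OccSym k a H → BlockSym k a p L) p m (literalSpecs p m l)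
  per-literal {l} l∈L = AllSpecs⁴-from {R = λ H → OccSym k a H → BlockSym k a p L} p m _ via (literalSpecs-symbols p m l)
    where
    via : ∀ s → SpecSymbols m (proj₁ l) s → AllConj⁴ (λ H → OccSym k a H → BlockSym k a p L) p m s
    via (n , x , G) (_ , syms) =
      AllConj⁴-map {R = λ H → OccSym k a H → OccSym k a G ⊎ (k ≡ unary × a ≡ p)} {p = p} {m = m} {s = n , x , G}
                   (λ f o → Sum.[ (λ o′ → inj₂ (l , l∈L , OccSym-SymbolsOf k a syms o′)) , inj₁ ] (f o))
                   (conjuncts-OccSym p m k a n x G)

predAtoms-terms : ∀ p Φ A {t} → A ∈ predAtoms p Φ → t ∈ atomTerms A → t ∈ nfTerms Φ
predAtoms-terms p ⊤ⁿ A () mt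
predAtoms-terms p ⊥ⁿ A () mt
predAtoms-terms p (atom B) A ma mt with mentions p B
predAtoms-terms p (atom B) A (here refl) mt | true = mt
predAtoms-terms p (atom B) A (there ()) mt | true
predAtoms-terms p (atom B) A () mt | false
predAtoms-terms p (neg Φ) A ma mt = predAtoms-terms p Φ A ma mt
predAtoms-terms p (conj Φ Ψ) A ma mt with ∈-++⁻ (predAtoms p Φ) ma
... | inj₁ m' = ∈-++⁺ˡ (predAtoms-terms p Φ A m' mt)
... | inj₂ m' = ∈-++⁺ʳ (nfTerms Φ) (predAtoms-terms p Ψ A m' mt)
predAtoms-terms p (disj Φ Ψ) A ma mt with ∈-++⁻ (predAtoms p Φ) ma
... | inj₁ m' = ∈-++⁺ˡ (predAtoms-terms p Φ A m' mt)
... | inj₂ m' = ∈-++⁺ʳ (nfTerms Φ) (predAtoms-terms p Ψ A m' mt)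

predAtoms-preds : ∀ p Φ A {q} → A ∈ predAtoms p Φ → q ∈ atomPreds A → q ∈ nfPreds Φ
predAtoms-preds p ⊤ⁿ A () mt
predAtoms-preds p ⊥ⁿ A () mt
predAtoms-preds p (atom B) A ma mt with mentions p B
predAtoms-preds p (atom B) A (here refl) mt | true = mt
predAtoms-preds p (atom B) A (there ()) mt | true
predAtoms-preds p (atom B) A () mt | false
predAtoms-preds p (neg Φ) A ma mt = predAtoms-preds p Φ A ma mt
predAtoms-preds p (conj Φ Ψ) A ma mt with ∈-++⁻ (predAtoms p Φ) ma
... | inj₁ m' = ∈-++⁺ˡ (predAtoms-preds p Φ A m' mt)
... | inj₂ m' = ∈-++⁺ʳ (nfPreds Φ) (predAtoms-preds p Ψ A m' mt)
predAtoms-preds p (disj Φ Ψ) A ma mt with ∈-++⁻ (predAtoms p Φ) ma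
... | inj₁ m' = ∈-++⁺ˡ (predAtoms-preds p Φ A m' mt)
... | inj₂ m' = ∈-++⁺ʳ (nfPreds Φ) (predAtoms-preds p Ψ A m' mt)

predAtoms-mentions : ∀ p Φ A → A ∈ predAtoms p Φ → mentions p A ≡ true
predAtoms-mentions p ⊤ⁿ A ()
predAtoms-mentions p ⊥ⁿ A ()
predAtoms-mentions p (atom B) A ma with mentions p B in h
predAtoms-mentions p (atom B) A (here refl) | true = h
predAtoms-mentions p (atom B) A (there ()) | true
predAtoms-mentions p (atom B) A () | false
predAtoms-mentions p (neg Φ) A ma = predAtoms-mentions p Φ A ma
predAtoms-mentions p (conj Φ Ψ) A ma with ∈-++⁻ (predAtoms p Φ) ma
... | inj₁ m' = predAtoms-mentions p Φ A m'
... | inj₂ m' = predAtoms-mentions p Ψ A m'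
predAtoms-mentions p (disj Φ Ψ) A ma with ∈-++⁻ (predAtoms p Φ) ma
... | inj₁ m' = predAtoms-mentions p Φ A m'
... | inj₂ m' = predAtoms-mentions p Ψ A m'

mentions-preds : ∀ p A → mentions p A ≡ true → p ∈ atomPreds A
mentions-preds p (nulA q) ()
mentions-preds p (eqA t s) ()
mentions-preds p (unA q t) h = here (sym (≡ᵇ-true⇒≡ {q} {p} h))
mentions-preds p (cntA n K) h = g K h
  where
  g : ∀ K → nonEmpty (predSigns p K) ≡ true → p ∈ cellPreds K
  g [] ()
  g (eqL t b ∷ K) h = g K h
  g (predL q b ∷ K) h with q ≡ᵇ p in e
  ... | true = here (sym (≡ᵇ-true⇒≡ {q} {p} e))
  ... | false = there (g K h)

NFSym : Sym → ℕ → NF → Set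
NFSym const c Φ = InTerms (ConT c) (nfTerms Φ)
NFSym nullary q Φ = q ∈ nfNuls Φ
NFSym unary q Φ = q ∈ nfPreds Φ

OccSym-nfFm : ∀ k a m Ψ → OccSym k a (nfFm m Ψ) → NFSym k a Ψ
OccSym-nfFm const a m Ψ o = OccC-nfFm m a Ψ o
OccSym-nfFm nullary a m Ψ o = OccN-nfFm m a Ψ o
OccSym-nfFm unary a m Ψ o = OccU-nfFm m a Ψ o

assume-NFSym : ∀ k a p L Φ → NFSym k a (assume p L Φ) → NFSym k a Φ
assume-NFSym const a p L Φ o = InTerms-mono (assume-terms p L Φ _) o
assume-NFSym nullary a p L Φ o = assume-nuls p L Φ a o
assume-NFSym unary a p L Φ o = proj₁ (assume-preds p L Φ a o)

predAtom-NFSym : ∀ k a p Φ A → A ∈ predAtoms p Φ → AtomSym k a A → NFSym k a Φ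
predAtom-NFSym const a p Φ A ma o = InTerms-mono (predAtoms-terms p Φ A ma) o
predAtom-NFSym nullary a p Φ A ma ()
predAtom-NFSym unary a p Φ A ma o = predAtoms-preds p Φ A ma o

OccSym-block : ∀ k a p m L → OccSym k a (block p m L) → BlockSym k a p L
OccSym-block const a p m L o = OccSym-blockBody const a p m L o
OccSym-block nullary a p m L o = OccSym-blockBody nullary a p m L o
OccSym-block unary a p m L (inj₁ a≡p) = inj₁ (refl , a≡p)
OccSym-block unary a p m L (inj₂ o) = OccSym-blockBody unary a p m L o

predAtoms⇒p∈nfPreds : ∀ p Φ {A} → A ∈ predAtoms p Φ → p ∈ nfPreds Φ
predAtoms⇒p∈nfPreds p Φ {A} A∈ = predAtoms-preds p Φ A A∈ (mentions-preds p A (predAtoms-mentions p Φ A A∈))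

OccSym-splitAtoms : ∀ k a p m Φ L As → p ∈ nfPreds Φ → All (λ l → proj₁ l ∈ predAtoms p Φ) L → All (_∈ predAtoms p Φ) As →
                    OccSym k a (splitAtoms p m Φ L As) → NFSym k a Φ
OccSym-splitAtoms k a p m Φ L [] p∈Φ hL hA o with proj₁ (OccSym-∧ k a _ _) o
... | inj₁ o′ = assume-NFSym k a p L Φ (OccSym-nfFm k a m (assume p L Φ) o′)
... | inj₂ o′ with OccSym-block k a p m L o′
...   | inj₁ (refl , refl) = p∈Φ
...   | inj₂ (l , l∈L , o″) = predAtom-NFSym k a p Φ (proj₁ l) (All.lookup hL l∈L) o″
OccSym-splitAtoms k a p m Φ L (A ∷ As) p∈Φ hL (A∈ ∷ hA) o with proj₁ (OccSym-∨ k a _ _) o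
... | inj₁ o′ = OccSym-splitAtoms k a p m Φ ((A , true) ∷ L) As p∈Φ (A∈ ∷ hL) hA o′
... | inj₂ o′ = OccSym-splitAtoms k a p m Φ ((A , false) ∷ L) As p∈Φ (A∈ ∷ hL) hA o′

FreeV-splitAtoms : ∀ v p m Φ L As → All (λ l → proj₁ l ∈ predAtoms p Φ) L → All (_∈ predAtoms p Φ) As →
                   FreeV v (splitAtoms p m Φ L As) → InTerms (OccT v) (nfTerms Φ)
FreeV-splitAtoms v p m Φ L [] hL hA (inj₁ o) = InTerms-mono (assume-terms p L Φ _) (FreeV-nfFm m v (assume p L Φ) o)
FreeV-splitAtoms v p m Φ L [] hL hA (inj₂ o) =
  let (l , l∈L , o′) = FreeV-blockBody p m L v o in InTerms-mono (predAtoms-terms p Φ (proj₁ l) (All.lookup hL l∈L)) o′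
FreeV-splitAtoms v p m Φ L (A ∷ As) hL (A∈ ∷ hA) (inj₁ o) = FreeV-splitAtoms v p m Φ ((A , true) ∷ L) As (A∈ ∷ hL) hA o
FreeV-splitAtoms v p m Φ L (A ∷ As) hL (A∈ ∷ hA) (inj₂ o) = FreeV-splitAtoms v p m Φ ((A , false) ∷ L) As (A∈ ∷ hL) hA o

OccSym-eliminateOn : ∀ k a p m Φ As → All (_∈ predAtoms p Φ) As → OccSym k a (eliminateOn p m Φ As) → NFSym k a Φ
OccSym-eliminateOn k a p m Φ [] _ o = assume-NFSym k a p [] Φ (OccSym-nfFm k a m (assume p [] Φ) o)
OccSym-eliminateOn k a p m Φ (A ∷ As) hA@(A∈ ∷ _) o =
  OccSym-splitAtoms k a p m Φ [] (A ∷ As) (predAtoms⇒p∈nfPreds p Φ A∈) [] hA o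

FreeV-eliminateOn : ∀ v p m Φ As → All (_∈ predAtoms p Φ) As → FreeV v (eliminateOn p m Φ As) → InTerms (OccT v) (nfTerms Φ)
FreeV-eliminateOn v p m Φ [] _ o = InTerms-mono (assume-terms p [] Φ _) (FreeV-nfFm m v (assume p [] Φ) o)
FreeV-eliminateOn v p m Φ (A ∷ As) hA o = FreeV-splitAtoms v p m Φ [] (A ∷ As) [] hA o

OccSym-eliminate : ∀ k a p Φ → OccSym k a (eliminate p Φ) → NFSym k a Φ
OccSym-eliminate k a p Φ = OccSym-eliminateOn k a p _ Φ (predAtoms p Φ) (All.tabulate (λ A∈ → A∈))

FreeV-eliminate : ∀ v p Φ → FreeV v (eliminate p Φ) → InTerms (OccT v) (nfTerms Φ)
FreeV-eliminate v p Φ = FreeV-eliminateOn v p _ Φ (predAtoms p Φ) (All.tabulate (λ A∈ → A∈))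

method-symbols : ∀ p F → SymbolsFrom F (method p F)
method-symbols p F = fv , cc , nn , uu
  where
  fv : ∀ x → FreeV x (method p F) → FreeV x F
  fv x o = let (t , mt , ot) = FreeV-eliminate x p (toNF F) o in proj₁ (toNF-terms F t mt) x ot
  cc : ∀ c → OccC c (method p F) → OccC c F
  cc c o = let (t , mt , ot) = OccSym-eliminate const c p (toNF F) o in proj₂ (toNF-terms F t mt) c ot
  nn : ∀ q → OccN q (method p F) → OccN q F
  nn q o = toNF-nuls F q (OccSym-eliminate nullary q p (toNF F) o)
  uu : ∀ q → OccU q (method p F) → OccU q F
  uu q o = toNF-preds F q (OccSym-eliminate unary q p (toNF F) o)

subst-IsFO : ∀ x y G → IsFO G → IsFO (subst x y G)
subst-IsFO x y ⊤ᶠ h = h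
subst-IsFO x y ⊥ᶠ h = h
subst-IsFO x y (nul q) h = h
subst-IsFO x y (app q t) h = tt
subst-IsFO x y (eqᶠ t s) h = tt
subst-IsFO x y (¬ᶠ G) h = subst-IsFO x y G h
subst-IsFO x y (G ∧ᶠ H) (a , b) = subst-IsFO x y G a , subst-IsFO x y H b
subst-IsFO x y (G ∨ᶠ H) (a , b) = subst-IsFO x y G a , subst-IsFO x y H b
subst-IsFO x y (∀ᶠ z G) h with z ≡ᵇ x
... | true = h
... | false = subst-IsFO x y G h
subst-IsFO x y (∃ᶠ z G) h with z ≡ᵇ x
... | true = h
... | false = subst-IsFO x y G h

⋀-IsFO : ∀ Gs → All IsFO Gs → IsFO (⋀ Gs)
⋀-IsFO [] [] = tt
⋀-IsFO (G ∷ []) (h ∷ []) = h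
⋀-IsFO (G ∷ G' ∷ Gs) (h ∷ hs) = h , ⋀-IsFO (G' ∷ Gs) hs

distinctness-IsFO : ∀ ys → All IsFO (distinctness ys)
distinctness-IsFO [] = []
distinctness-IsFO (y ∷ ys) = ++⁺ (map⁺ {f = λ z → ¬ᶠ eqᶠ (var y) (var z)} (All.tabulate (λ _ → tt))) (distinctness-IsFO ys)

distinctWitnesses-IsFO : ∀ x G ys → IsFO G → IsFO (distinctWitnesses x G ys)
distinctWitnesses-IsFO x G ys h = under-∃ ys
  where
  under-∃ : ∀ zs → IsFO (foldr ∃ᶠ (⋀ (map (λ y → subst x y G) ys ++ distinctness ys)) zs)
  under-∃ [] = ⋀-IsFO _ (++⁺ (map⁺ {xs = ys} {f = λ y → subst x y G} (All.tabulate (λ {y} _ → subst-IsFO x y G h))) (distinctness-IsFO ys))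
  under-∃ (z ∷ zs) = under-∃ zs

litFm-IsFO : ∀ m l → IsFO (litFm m l)
litFm-IsFO m (predL q true) = tt
litFm-IsFO m (predL q false) = tt
litFm-IsFO m (eqL t true) = tt
litFm-IsFO m (eqL t false) = tt

cellFm-IsFO : ∀ m K → IsFO (cellFm m K)
cellFm-IsFO m K = ⋀-IsFO _ (map⁺ {xs = K} {f = litFm m} (All.tabulate (λ {l} _ → litFm-IsFO m l)))

nfFm-IsFO : ∀ m Ψ → IsFO (nfFm m Ψ)
nfFm-IsFO m ⊤ⁿ = tt
nfFm-IsFO m ⊥ⁿ = tt
nfFm-IsFO m (atom (nulA q)) = tt
nfFm-IsFO m (atom (unA q t)) = tt
nfFm-IsFO m (atom (eqA t s)) = tt
nfFm-IsFO m (atom (cntA n K)) = distinctWitnesses-IsFO m (cellFm m K) (freshVars (suc m) (suc n)) (cellFm-IsFO m K)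
nfFm-IsFO m (neg Ψ) = nfFm-IsFO m Ψ
nfFm-IsFO m (conj Φ Ψ) = nfFm-IsFO m Φ , nfFm-IsFO m Ψ
nfFm-IsFO m (disj Φ Ψ) = nfFm-IsFO m Φ , nfFm-IsFO m Ψ

IsFO⇒OnlyQuantifies : ∀ p G → IsFO G → OnlyQuantifies p G
IsFO⇒OnlyQuantifies p ⊤ᶠ h = tt
IsFO⇒OnlyQuantifies p ⊥ᶠ h = tt
IsFO⇒OnlyQuantifies p (nul q) h = tt
IsFO⇒OnlyQuantifies p (app q t) h = tt
IsFO⇒OnlyQuantifies p (eqᶠ t s) h = tt
IsFO⇒OnlyQuantifies p (¬ᶠ G) h = IsFO⇒OnlyQuantifies p G h
IsFO⇒OnlyQuantifies p (G ∧ᶠ H) (a , b) = IsFO⇒OnlyQuantifies p G a , IsFO⇒OnlyQuantifies p H b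
IsFO⇒OnlyQuantifies p (G ∨ᶠ H) (a , b) = IsFO⇒OnlyQuantifies p G a , IsFO⇒OnlyQuantifies p H b
IsFO⇒OnlyQuantifies p (∀ᶠ y G) h = IsFO⇒OnlyQuantifies p G h
IsFO⇒OnlyQuantifies p (∃ᶠ y G) h = IsFO⇒OnlyQuantifies p G h

GoodSpec : PName → ℕ → Spec → Set
GoodSpec p m (n , x , A) = n ≥ 1 × IsFO A × ¬ OccU p A × x ≡ m × VarsAtMost m A

dropPred-unmentioned : ∀ p K → p ∉ cellPreds (dropPred p K)
dropPred-unmentioned p (eqL t b ∷ K) m = dropPred-unmentioned p K m
dropPred-unmentioned p (predL q b ∷ K) m with q ≡ᵇ p in h
... | true = dropPred-unmentioned p K m
dropPred-unmentioned p (predL q b ∷ K) (here e) | false = ≡ᵇ-false⇒≢ {q} {p} h (sym e)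
dropPred-unmentioned p (predL q b ∷ K) (there m) | false = dropPred-unmentioned p K m

cellFm-GoodSpec : ∀ p m n K → All (LitBelow m) K → GoodSpec p m (suc n , m , cellFm m (dropPred p K))
cellFm-GoodSpec p m n K b =
  s≤s z≤n , cellFm-IsFO m (dropPred p K) , (λ o → dropPred-unmentioned p K (OccU-cellFm m p (dropPred p K) o)) , refl ,
  VarOcc-cellFm m (dropPred p K) (dropPred-below m p K b)

cellOrFalse-GoodSpec : ∀ p m n K a → All (LitBelow m) K → GoodSpec p m (suc n , m , cellOrFalse m a (dropPred p K))
cellOrFalse-GoodSpec p m n K true b = cellFm-GoodSpec p m n K b
cellOrFalse-GoodSpec p m n K false b = s≤s z≤n , tt , (λ ()) , refl , (λ y ())

literalSpecs-good : ∀ p m l → PLiteral p m l → AllLists⁴ (GoodSpec p m) (literalSpecs p m l)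
literalSpecs-good p m (unA q t , true) (_ , b) = [] , [] , (s≤s z≤n , tt , (λ ()) , refl , VarOcc-=var-below m t b) ∷ [] , []
literalSpecs-good p m (unA q t , false) (_ , b) = [] , [] , [] , (s≤s z≤n , tt , (λ ()) , refl , VarOcc-=var-below m t b) ∷ []
literalSpecs-good p m (cntA n K , s) (_ , b) with or (predSigns p K) | and (predSigns p K) | s
... | true | a | true = [] , [] , cellOrFalse-GoodSpec p m n K a b ∷ [] , []
... | true | a | false = [] , cellOrFalse-GoodSpec p m n K a b ∷ [] , [] , []
... | false | a | true = [] , [] , [] , cellFm-GoodSpec p m n K b ∷ []
... | false | a | false = cellFm-GoodSpec p m n K b ∷ [] , [] , [] , []

GoodSpec⇒SpecOK : ∀ p m s → GoodSpec p m s → SpecOK p s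
GoodSpec⇒SpecOK p m (n , x , A) (n≥1 , fo , p∉A , _) = n≥1 , fo , p∉A

distinctWitnesses-CountGE : ∀ m n x G → VarsAtMost m G → CountGE n x G (distinctWitnesses x G (freshVars (suc m) n))
distinctWitnesses-CountGE m n x G bound =
  freshVars (suc m) n , freshVars-length (suc m) n , freshVars-unique (suc m) n , freshVars-fresh m n G bound , refl

module _ (p : PName) (m : ℕ) where
  conjuncts-IsFO : ∀ s → GoodSpec p m s → AllConj⁴ IsFO p m s
  conjuncts-IsFO (n , x , A) (_ , fo , _) =
    distinctWitnesses-IsFO x (¬ᶠ (A ∨ᶠ px)) ys (fo , tt) , distinctWitnesses-IsFO x (¬ᶠ (A ∨ᶠ (¬ᶠ px))) ys (fo , tt) ,
    distinctWitnesses-IsFO x (A ∧ᶠ px) ys (fo , tt) , distinctWitnesses-IsFO x (A ∧ᶠ (¬ᶠ px)) ys (fo , tt)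
    where
    ys = freshVars (suc m) n
    px = app p (var x)

  conjuncts-Conj : ∀ s → GoodSpec p m s →
                   ConjA p s (conjA p m s) × ConjB p s (conjB p m s) × ConjC p s (conjC p m s) × ConjD p s (conjD p m s)
  conjuncts-Conj (n , .m , A) (_ , _ , _ , refl , bound) =
    (_ , distinctWitnesses-CountGE m n m (¬ᶠ (A ∨ᶠ pm)) with-m , refl) ,
    (_ , distinctWitnesses-CountGE m n m (¬ᶠ (A ∨ᶠ (¬ᶠ pm))) with-m , refl) ,
    distinctWitnesses-CountGE m n m (A ∧ᶠ pm) with-m , distinctWitnesses-CountGE m n m (A ∧ᶠ (¬ᶠ pm)) with-m
    where
    pm = app p (var m)
    with-m = VarsAtMost-∪ {G = A} bound

  Pointwise-map : ∀ {R : Spec → Fm → Set} (f : Spec → Fm) ss → All (GoodSpec p m) ss →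
                  (∀ s → GoodSpec p m s → R s (f s)) → Pointwise R ss (map f ss)
  Pointwise-map f [] [] h = []
  Pointwise-map f (s ∷ ss) (g ∷ gs) h = h s g ∷ Pointwise-map f ss gs h

  block-Block : ∀ L → All (PLiteral p m) L → Block p (block p m L)
  block-Block L pL =
    as , bs , cs , ds , _ , _ , _ , _ ,
    All.map (λ {s} → GoodSpec⇒SpecOK p m s) ga , All.map (λ {s} → GoodSpec⇒SpecOK p m s) gb ,
    All.map (λ {s} → GoodSpec⇒SpecOK p m s) gc , All.map (λ {s} → GoodSpec⇒SpecOK p m s) gd ,
    Pointwise-map (conjA p m) as ga (λ s g → proj₁ (conjuncts-Conj s g)) ,
    Pointwise-map (conjB p m) bs gb (λ s g → proj₁ (proj₂ (conjuncts-Conj s g))) ,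
    Pointwise-map (conjC p m) cs gc (λ s g → proj₁ (proj₂ (proj₂ (conjuncts-Conj s g)))) ,
    Pointwise-map (conjD p m) ds gd (λ s g → proj₂ (proj₂ (proj₂ (conjuncts-Conj s g)))) , refl
    where
    as = concatMap (specsA p m) L
    bs = concatMap (specsB p m) L
    cs = concatMap (specsC p m) L
    ds = concatMap (specsD p m) L
    good = All.map (λ {l} → literalSpecs-good p m l) pL
    ga = concat⁺ (map⁺ (All.map proj₁ good))
    gb = concat⁺ (map⁺ (All.map (proj₁ ∘ proj₂) good))
    gc = concat⁺ (map⁺ (All.map (proj₁ ∘ proj₂ ∘ proj₂) good))
    gd = concat⁺ (map⁺ (All.map (proj₂ ∘ proj₂ ∘ proj₂) good))

  blockBody-IsFO : ∀ L → All (PLiteral p m) L → IsFO (blockBody p m L)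
  blockBody-IsFO L pL =
    ⋀-IsFO _ (proj₂ (All-blockConjuncts p m L)
      (All.map (λ {l} pl → AllSpecs⁴-from {Q = GoodSpec p m} {R = IsFO} p m _ conjuncts-IsFO (literalSpecs-good p m l pl)) pL))

unmentioned-Guarded : ∀ p s G → ¬ OccU p G → Guarded p s G
unmentioned-Guarded p s ⊤ᶠ n = inj₂ tt
unmentioned-Guarded p s ⊥ᶠ n = inj₂ tt
unmentioned-Guarded p s (nul q) n = inj₂ tt
unmentioned-Guarded p s (app q t) n = inj₂ n
unmentioned-Guarded p s (eqᶠ t u) n = inj₂ tt
unmentioned-Guarded p s (¬ᶠ G) n = inj₂ (unmentioned-Guarded p (not s) G n)
unmentioned-Guarded p s (G ∧ᶠ H) n = inj₂ (unmentioned-Guarded p s G (λ o → n (inj₁ o)) , unmentioned-Guarded p s H (λ o → n (inj₂ o)))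
unmentioned-Guarded p s (G ∨ᶠ H) n = inj₂ (unmentioned-Guarded p s G (λ o → n (inj₁ o)) , unmentioned-Guarded p s H (λ o → n (inj₂ o)))
unmentioned-Guarded p s (∀ᶠ y G) n = inj₂ (unmentioned-Guarded p s G n)
unmentioned-Guarded p s (∃ᶠ y G) n = inj₂ (unmentioned-Guarded p s G n)
unmentioned-Guarded p s (∀₀ q G) n = inj₂ (unmentioned-Guarded p s G n)
unmentioned-Guarded p s (∃₀ q G) n = inj₂ (unmentioned-Guarded p s G n)
unmentioned-Guarded p s (∀₁ q G) n = inj₂ ((λ e → n (inj₁ e)) , unmentioned-Guarded p s G (λ o → n (inj₂ o)))
unmentioned-Guarded p s (∃₁ q G) n = inj₂ ((λ e → n (inj₁ e)) , unmentioned-Guarded p s G (λ o → n (inj₂ o)))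

nfFm-assume-unmentioned : ∀ p m L Φ → ¬ OccU p (nfFm m (assume p L Φ))
nfFm-assume-unmentioned p m L Φ o = proj₂ (assume-preds p L Φ p (OccU-nfFm m p (assume p L Φ) o)) refl

nfFm-assume-shape : ∀ p m L Φ → Guarded p true (nfFm m (assume p L Φ)) × OnlyQuantifies p (nfFm m (assume p L Φ))
nfFm-assume-shape p m L Φ =
  unmentioned-Guarded p true (nfFm m (assume p L Φ)) (nfFm-assume-unmentioned p m L Φ) ,
  IsFO⇒OnlyQuantifies p (nfFm m (assume p L Φ)) (nfFm-IsFO m (assume p L Φ))

splitAtoms-shape : ∀ p m Φ L As → All (PLiteral p m) L → All (PAtom p m) As →
                   Guarded p true (splitAtoms p m Φ L As) × OnlyQuantifies p (splitAtoms p m Φ L As)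
splitAtoms-shape p m Φ L [] pL pA =
  let (guarded , only-p) = nfFm-assume-shape p m L Φ in
  inj₂ (guarded , inj₁ (refl , block-Block p m L pL)) ,
  only-p , refl , IsFO⇒OnlyQuantifies p (blockBody p m L) (blockBody-IsFO p m L pL)
splitAtoms-shape p m Φ L (A ∷ As) pL (pa ∷ pA) =
  let (guarded₁ , only-p₁) = splitAtoms-shape p m Φ ((A , true) ∷ L) As (pa ∷ pL) pA
      (guarded₂ , only-p₂) = splitAtoms-shape p m Φ ((A , false) ∷ L) As (pa ∷ pL) pA in
  inj₂ (guarded₁ , guarded₂) , only-p₁ , only-p₂

eliminate-shape : ∀ p Φ → Guarded p true (eliminate p Φ) × OnlyQuantifies p (eliminate p Φ)
eliminate-shape p Φ = on (predAtoms p Φ) (predAtoms-PAtom p m Φ (maxVarNF-below Φ (maxVarNF Φ) ≤-refl))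
  where
  m = suc (maxVarNF Φ)
  on : ∀ As → All (PAtom p m) As → Guarded p true (eliminateOn p m Φ As) × OnlyQuantifies p (eliminateOn p m Φ As)
  on [] _ = nfFm-assume-shape p m [] Φ
  on (A ∷ As) pA = splitAtoms-shape p m Φ [] (A ∷ As) [] pA

lemma3 : Σ (PName → Fm → Fm) λ method →
    (p : PName) (F : Fm) → IsFO F →
    (method p F ≈ᶠ ∃₁ p F) ×
    OnlyQuantifies p (method p F) ×
    Guarded p true (method p F) ×
    SymbolsFrom F (method p F)
lemma3 = method , λ p F fo →
  method-correct p F fo , proj₂ (eliminate-shape p (toNF F)) , proj₁ (eliminate-shape p (toNF F)) , method-symbols p F
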